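{- For a graph $G$, $X_G(\mathbf x)=\sum_{\mathcal S\in\mathrm{ST}(G)}\mathrm{sign}(\mathcal S)e_{\mathrm{type}(\mathcal S)}$.
   Context: $X_G(\mathbf x)=\sum_\kappa x_{\kappa(1)}\cdots x_{\kappa(n)}$ over proper colourings $\kappa:[n]\to\{1,2,\dots\}$; $e_\lambda$ elementary symmetric functions. A connected subgraph triple of $G$ is $(H,\alpha,r)$ with $H$ a connected subgraph (vertex subset and edge subset) of $G$, $\alpha$ a composition of $|V(H)|$ and $1\le r\le\alpha_1$. A subgraph triple is a sequence $\mathcal S=((H_1,\alpha^{(1)},r_1),\dots,(H_m,\alpha^{(m)},r_m))$ of connected subgraph triples whose vertex sets partition $V(G)$ with $\min H_1<\dots<\min H_m$; $\mathrm{ST}(G)$ is the set of these. $\mathrm{type}(\mathcal S)$ is the partition obtained by sorting $\alpha^{(1)}\cdots\alpha^{(m)}$, and $\mathrm{sign}(\mathcal S)=(-1)^{\sum_k(\ell(\alpha^{(k)})-1+|E(H_k)|-|V(H_k)|+1)}$. -}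

module Defs where

open import Level using (Level)
open import Data.Bool using (Bool; true; false; if_then_else_)
open import Data.Nat using (ℕ; zero; suc; _≤_; _<_)
open import Data.Nat.Properties using (≤-decTotalOrder)
open import Data.Fin using (Fin; toℕ)
import Data.Fin.Properties as FinP
import Data.Bool.Properties as BoolP
open import Data.Vec using (Vec; []; _∷_; lookup)
open import Data.Fin.Subset using (Subset; ∣_∣)
open import Data.List using (List; []; _∷_; map; foldr; filter; length; concatMap; allFin; _++_)
open import Data.List.Relation.Unary.All using (All)
open import Data.List.Relation.Unary.Linked using (Linked)
open import Data.Product using (_×_; ∃)
open import Data.Integer as ℤ using (ℤ; +_)
open import Relation.Binary.PropositionalEquality using (_≡_; _≢_)
open import Relation.Nullary using (Dec; ¬?)
open import Relation.Nullary.Decidable using (_→-dec_)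
open import Relation.Binary.Properties.DecTotalOrder ≤-decTotalOrder using (≥-decTotalOrder)
open import Data.List.Sort ≥-decTotalOrder using (sort)
open import Algebra.Bundles using (CommutativeRing)

record Graph (n : ℕ) : Set where
  field
    adj    : Fin n → Fin n → Bool
    sym    : ∀ i j → adj i j ≡ adj j i
    irrefl : ∀ i → adj i i ≡ false
open Graph public

-- an edge set on Fin n, as a (symmetric) 0/1 adjacency matrix
EdgeSet : ℕ → Set
EdgeSet n = Vec (Vec Bool n) n

edge : ∀ {n} → EdgeSet n → Fin n → Fin n → Bool
edge M i j = lookup (lookup M i) j

_∈V_ : ∀ {n} → Fin n → Subset n → Set
i ∈V V = lookup V i ≡ true

-- raw data of a triple (H, α, r) with H = (verts, edges)
record RawTriple (n : ℕ) : Set where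
  constructor triple
  field
    verts : Subset n
    edges : EdgeSet n
    comp  : List ℕ
    r     : ℕ
open RawTriple public

IsSubgraph : ∀ {n} → Graph n → Subset n → EdgeSet n → Set
IsSubgraph G V M =
  (∀ i j → edge M i j ≡ true → (adj G i j ≡ true) × (i ∈V V) × (j ∈V V))
  × (∀ i j → edge M i j ≡ edge M j i)

data Walk {n} (M : EdgeSet n) : Fin n → Fin n → Set where
  here : ∀ {i} → Walk M i i
  step : ∀ {i j k} → edge M i j ≡ true → Walk M j k → Walk M i k

Connected : ∀ {n} → Subset n → EdgeSet n → Set
Connected V M = ∃ (λ i → i ∈V V) × (∀ i j → i ∈V V → j ∈V V → Walk M i j)

sumℕ : List ℕ → ℕ
sumℕ = foldr Data.Nat._+_ 0

IsComposition : List ℕ → ℕ → Set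
IsComposition α k = All (λ a → 1 ≤ a) α × sumℕ α ≡ k

firstPart : List ℕ → ℕ
firstPart []      = 0
firstPart (a ∷ _) = a

IsConnTriple : ∀ {n} → Graph n → RawTriple n → Set
IsConnTriple G t =
  IsSubgraph G (verts t) (edges t)
  × Connected (verts t) (edges t)
  × IsComposition (comp t) ∣ verts t ∣
  × 1 ≤ r t × r t ≤ firstPart (comp t)

-- index of the smallest element of a subset (n if empty)
minV : ∀ {n} → Subset n → ℕ
minV []          = 0
minV (true ∷ _)  = 0
minV (false ∷ v) = suc (minV v)

occ : ∀ {n} → Fin n → List (RawTriple n) → ℕ
occ v S = length (filter (λ t → lookup (verts t) v BoolP.≟ true) S)

IsST : ∀ {n} → Graph n → List (RawTriple n) → Set
IsST G S =
  All (IsConnTriple G) S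
  × (∀ v → occ v S ≡ 1)
  × Linked _<_ (map (λ t → minV (verts t)) S)

numEdges : ∀ {n} → EdgeSet n → ℕ
numEdges {n} M =
  sumℕ (map (λ i → sumℕ (map (λ j →
    if Data.Nat._<ᵇ_ (toℕ i) (toℕ j) then (if edge M i j then 1 else 0) else 0)
    (allFin n))) (allFin n))

type : ∀ {n} → List (RawTriple n) → List ℕ
type S = sort (concatMap comp S)

signExp : ∀ {n} → List (RawTriple n) → ℤ
signExp S = foldr ℤ._+_ (+ 0) (map (λ t →
  ((+ length (comp t)) ℤ.- (+ 1)) ℤ.+ (+ numEdges (edges t)) ℤ.- (+ ∣ verts t ∣) ℤ.+ (+ 1)) S)

module _ {c ℓ : Level} (R : CommutativeRing c ℓ) where
  open CommutativeRing R

  sumR : List Carrier → Carrier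
  sumR = foldr _+_ 0#

  prodR : List Carrier → Carrier
  prodR = foldr _*_ 1#

  negOnePow : ℕ → Carrier
  negOnePow zero    = 1#
  negOnePow (suc k) = - negOnePow k

  sign : ∀ {n} → List (RawTriple n) → Carrier
  sign S = negOnePow (ℤ.∣ signExp S ∣)

  allSubsets : ∀ N → List (Subset N)
  allSubsets zero    = [] ∷ []
  allSubsets (suc N) = map (true ∷_) (allSubsets N) ++ map (false ∷_) (allSubsets N)

  elem : ∀ {N} → ℕ → (Fin N → Carrier) → Carrier
  elem {N} k x = sumR (map (λ s → prodR (map (λ i → if lookup s i then x i else 1#) (allFin N)))
                           (filter (λ s → ∣ s ∣ Data.Nat.≟ k) (allSubsets N)))

  elemλ : ∀ {N} → List ℕ → (Fin N → Carrier) → Carrier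
  elemλ λs x = prodR (map (λ k → elem k x) λs)

  allMaps : ∀ N n → List (Vec (Fin N) n)
  allMaps N zero    = [] ∷ []
  allMaps N (suc n) = concatMap (λ a → map (a ∷_) (allMaps N n)) (allFin N)

  Proper : ∀ {n N} → Graph n → Vec (Fin N) n → Set
  Proper G κ = ∀ i j → adj G i j ≡ true → lookup κ i ≢ lookup κ j

  proper? : ∀ {n N} (G : Graph n) (κ : Vec (Fin N) n) → Dec (Proper G κ)
  proper? G κ = FinP.all? (λ i → FinP.all? (λ j →
    (adj G i j BoolP.≟ true) →-dec ¬? (lookup κ i FinP.≟ lookup κ j)))

  chromSym : ∀ {n N} → Graph n → (Fin N → Carrier) → Carrier
  chromSym {n} {N} G x =
    sumR (map (λ κ → prodR (map (λ i → x (lookup κ i)) (allFin n)))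
              (filter (proper? G) (allMaps N n)))

module Submission where

-- The proof follows Stanley's expansion X_G = ∑_{S ⊆ E(G)} (-1)^{|S|} p_{λ(S)}, organised as a recurrence over
-- vertex sets W. Toggling a monochromatic edge is a sign-reversing involution, so ∑_{S ⊆ E(G[W])} (-1)^{|S|}
-- [κ is constant along S] is the indicator that κ properly colours G[W]. Grouping the edge sets S by the component
-- (B, H) of the least vertex w₀ of W then gives
--   X_{G[W]} = ∑_{(B, H)} (-1)^{|E(H)|} p_{|B|} X_{G[W ─ B]},   H connected with vertex set B ∋ w₀.
-- Newton's identities give p_k = ∑_{α ⊨ k} α₁ (-1)^{k - ℓ(α)} e_α, and α₁ counts the choices of r, so unfolding the
-- recurrence enumerates the subgraph triples 𝒮, each contributing sign(𝒮) e_{type(𝒮)}.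

open import Algebra.Bundles using (CommutativeRing)
open import Data.Nat using (ℕ)
open import Defs using (Graph)
open import Data.Fin using (Fin)

module ListEnumeration where

  open import Data.List using (List; []; _∷_; map; concatMap; _++_)
  open import Data.List.Membership.Propositional using (_∈_; find; lose)
  open import Data.List.Membership.Propositional.Properties
    using (∈-map⁺; ∈-map⁻; ∈-concatMap⁺; ∈-concatMap⁻)
  open import Data.List.Relation.Unary.Any using (here; there)
  import Data.List.Relation.Unary.All as All
  import Data.List.Relation.Unary.All.Properties as All
  open import Data.List.Relation.Unary.AllPairs using ([]; _∷_)
  open import Data.List.Relation.Unary.Unique.Propositional using (Unique)
  import Data.List.Relation.Unary.Unique.Propositional.Properties as Unique
  open import Data.Product using (∃; ∃₂; _×_; _,_; proj₁; proj₂)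
  open import Function using (_∘_)
  open import Relation.Binary.PropositionalEquality using (_≡_; refl; sym; trans; cong; cong₂)

  module _ {A B : Set} where

    ∈-concatMap⁻′ : ∀ {f : A → List B} xs {y} → y ∈ concatMap f xs → ∃ λ a → a ∈ xs × y ∈ f a
    ∈-concatMap⁻′ xs y∈ = find (∈-concatMap⁻ _ {xs = xs} y∈)

    ∈-concatMap⁺′ : ∀ {f : A → List B} {xs a y} → a ∈ xs → y ∈ f a → y ∈ concatMap f xs
    ∈-concatMap⁺′ {f} a∈ y∈ = ∈-concatMap⁺ f (lose a∈ y∈)

    InjectiveOn : (A → B) → List A → Set
    InjectiveOn f xs = ∀ {a a'} → a ∈ xs → a' ∈ xs → f a ≡ f a' → a ≡ a'

    Unique-map⁺ : ∀ {f : A → B} {xs} → InjectiveOn f xs → Unique xs → Unique (map f xs)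
    Unique-map⁺ inj [] = []
    Unique-map⁺ inj (x∉ ∷ u) =
      All.map⁺ (All.tabulate (λ y∈ eq → All.lookup x∉ y∈ (inj (here refl) (there y∈) eq)))
      ∷ Unique-map⁺ (λ a∈ a'∈ → inj (there a∈) (there a'∈)) u

    Unique-concatMap⁺ : ∀ {f : A → List B} {xs} → Unique xs → (∀ {a} → a ∈ xs → Unique (f a)) →
      (∀ {a a' y} → a ∈ xs → a' ∈ xs → y ∈ f a → y ∈ f a' → a ≡ a') → Unique (concatMap f xs)
    Unique-concatMap⁺ [] uf disj = []
    Unique-concatMap⁺ {f} {x ∷ xs} (x∉ ∷ u) uf disj =
      Unique.++⁺ (uf (here refl)) (Unique-concatMap⁺ u (uf ∘ there) (λ a∈ a'∈ → disj (there a∈) (there a'∈)))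
        λ (y∈fx , y∈rest) → let (a , a∈ , y∈fa) = ∈-concatMap⁻′ xs y∈rest in
                            All.lookup x∉ a∈ (disj (here refl) (there a∈) y∈fx y∈fa)

  module _ {A B C : Set} where

    productWith : (A → B → C) → (xs : List A) → (A → List B) → List C
    productWith k xs ys = concatMap (λ a → map (k a) (ys a)) xs

    ∈-productWith⁻ : ∀ (k : A → B → C) xs ys {c} → c ∈ productWith k xs ys →
      ∃₂ λ a b → a ∈ xs × b ∈ ys a × c ≡ k a b
    ∈-productWith⁻ k xs ys c∈ =
      let (a , a∈ , c∈′) = ∈-concatMap⁻′ xs c∈
          (b , b∈ , c≡) = ∈-map⁻ (k a) c∈′
      in a , b , a∈ , b∈ , c≡

    ∈-productWith⁺ : ∀ (k : A → B → C) {xs ys a b} → a ∈ xs → b ∈ ys a → k a b ∈ productWith k xs ys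
    ∈-productWith⁺ k a∈ b∈ = ∈-concatMap⁺′ a∈ (∈-map⁺ (k _) b∈)

    Unique-productWith⁺ : ∀ (k : A → B → C) {xs ys} → Unique xs → (∀ {a} → a ∈ xs → Unique (ys a)) →
      (∀ {a a' b b'} → a ∈ xs → a' ∈ xs → b ∈ ys a → b' ∈ ys a' → k a b ≡ k a' b' → a ≡ a' × b ≡ b') →
      Unique (productWith k xs ys)
    Unique-productWith⁺ k {ys = ys} uxs uys inj =
      Unique-concatMap⁺ uxs
        (λ a∈ → Unique-map⁺ (λ b∈ b'∈ eq → proj₂ (inj a∈ a∈ b∈ b'∈ eq)) (uys a∈))
        λ {a} {a'} a∈ a'∈ c∈ c∈′ →
          let (b , b∈ , c≡) = ∈-map⁻ (k a) c∈
              (b' , b'∈ , c≡′) = ∈-map⁻ (k a') c∈′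
          in proj₁ (inj a∈ a'∈ b∈ b'∈ (trans (sym c≡) c≡′))

    productWith-cong : ∀ (k : A → B → C) xs {ys zs : A → List B} →
      (∀ {a} → a ∈ xs → ys a ≡ zs a) → productWith k xs ys ≡ productWith k xs zs
    productWith-cong k []       ys≡zs = refl
    productWith-cong k (x ∷ xs) ys≡zs =
      cong₂ _++_ (cong (map (k x)) (ys≡zs (here refl))) (productWith-cong k xs (ys≡zs ∘ there))

module RingSums {c ℓ} (R : CommutativeRing c ℓ) where

  open import Data.Bool using (if_then_else_)
  open import Data.List using (List; []; _∷_; map; filter; concatMap; _++_; length)
  open import Data.List.Membership.Propositional using (_∈_)
  open import Data.List.Membership.Propositional.Properties using (∈-map⁺; ∈-map⁻)
  open import Data.List.Membership.Propositional.Properties.WithK using (unique∧set⇒bag)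
  open import Data.List.Relation.Binary.BagAndSetEquality using (∼bag⇒↭)
  open import Data.List.Relation.Binary.Permutation.Propositional using (_↭_; ↭⇒↭ₛ′)
  import Data.List.Relation.Binary.Permutation.Propositional.Properties as ↭
  import Data.List.Relation.Binary.Permutation.Setoid.Properties as ↭ₛ
  open import Data.List.Relation.Unary.Any using (here; there)
  import Data.List.Relation.Unary.All as All
  open import Data.List.Relation.Unary.AllPairs using (_∷_)
  open import Data.List.Relation.Unary.Unique.Propositional using (Unique)
  open import Data.Empty using (⊥-elim)
  open import Data.Product using (∃; _×_; _,_; proj₁; proj₂)
  open import Function using (_∘_; _⇔_; mk⇔)
  open import Relation.Nullary using (Dec; yes; no; does; ¬_; ¬?)
  open import Relation.Unary using (Pred; Decidable)
  import Relation.Binary.PropositionalEquality as ≡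

  open import Defs using (sumR; prodR)
  open ListEnumeration

  open CommutativeRing R
  open import Algebra.Properties.Ring ring using (-0#≈0#; -‿+-comm)
  open import Algebra.Properties.CommutativeSemigroup +-commutativeSemigroup
    using () renaming (interchange to +-interchange; x∙yz≈y∙xz to x+yz≈y+xz)
  open import Algebra.Properties.CommutativeSemigroup *-commutativeSemigroup
    using () renaming (interchange to *-interchange)
  open import Algebra.Properties.Monoid.Mult +-monoid using () renaming (_×_ to _×ₙ_)

  private variable
    A B : Set

  ∑ : List A → (A → Carrier) → Carrier
  ∑ xs f = sumR R (map f xs)

  ∏ : List A → (A → Carrier) → Carrier
  ∏ xs f = prodR R (map f xs)

  ∑-cong-∈ : ∀ xs {f g : A → Carrier} → (∀ {a} → a ∈ xs → f a ≈ g a) → ∑ xs f ≈ ∑ xs g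
  ∑-cong-∈ []       f≈g = refl
  ∑-cong-∈ (x ∷ xs) f≈g = +-cong (f≈g (here ≡.refl)) (∑-cong-∈ xs (f≈g ∘ there))

  ∑-cong : ∀ xs {f g : A → Carrier} → (∀ a → f a ≈ g a) → ∑ xs f ≈ ∑ xs g
  ∑-cong xs f≈g = ∑-cong-∈ xs (λ {a} _ → f≈g a)

  ∑-++ : ∀ xs ys (f : A → Carrier) → ∑ (xs ++ ys) f ≈ ∑ xs f + ∑ ys f
  ∑-++ []       ys f = sym (+-identityˡ _)
  ∑-++ (x ∷ xs) ys f = trans (+-congˡ (∑-++ xs ys f)) (sym (+-assoc _ _ _))

  ∑-map : ∀ (φ : A → B) xs (f : B → Carrier) → ∑ (map φ xs) f ≈ ∑ xs (f ∘ φ)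
  ∑-map φ []       f = refl
  ∑-map φ (x ∷ xs) f = +-congˡ (∑-map φ xs f)

  ∑-concatMap : ∀ (h : A → List B) xs (f : B → Carrier) → ∑ (concatMap h xs) f ≈ ∑ xs (λ a → ∑ (h a) f)
  ∑-concatMap h []       f = refl
  ∑-concatMap h (x ∷ xs) f = trans (∑-++ (h x) (concatMap h xs) f) (+-congˡ (∑-concatMap h xs f))

  ∑-productWith : ∀ {C : Set} (k : A → B → C) xs (ys : A → List B) (f : C → Carrier) →
    ∑ (productWith k xs ys) f ≈ ∑ xs (λ a → ∑ (ys a) (f ∘ k a))
  ∑-productWith k xs ys f =
    trans (∑-concatMap _ xs f) (∑-cong xs (λ a → ∑-map (k a) (ys a) f))

  *-distribˡ-∑ : ∀ k xs (f : A → Carrier) → k * ∑ xs f ≈ ∑ xs (λ a → k * f a)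
  *-distribˡ-∑ k []       f = zeroʳ k
  *-distribˡ-∑ k (x ∷ xs) f = trans (distribˡ k _ _) (+-congˡ (*-distribˡ-∑ k xs f))

  *-distribʳ-∑ : ∀ k xs (f : A → Carrier) → ∑ xs f * k ≈ ∑ xs (λ a → f a * k)
  *-distribʳ-∑ k xs f = trans (*-comm _ _) (trans (*-distribˡ-∑ k xs f) (∑-cong xs (λ _ → *-comm _ _)))

  ∑-distrib-+ : ∀ xs (f g : A → Carrier) → ∑ xs (λ a → f a + g a) ≈ ∑ xs f + ∑ xs g
  ∑-distrib-+ []       f g = sym (+-identityˡ _)
  ∑-distrib-+ (x ∷ xs) f g = trans (+-congˡ (∑-distrib-+ xs f g)) (+-interchange _ _ _ _)

  ∑-neg : ∀ xs (f : A → Carrier) → ∑ xs (λ a → - f a) ≈ - ∑ xs f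
  ∑-neg []       f = sym -0#≈0#
  ∑-neg (x ∷ xs) f = trans (+-congˡ (∑-neg xs f)) (-‿+-comm _ _)

  ∑-zero : ∀ xs {f : A → Carrier} → (∀ {a} → a ∈ xs → f a ≈ 0#) → ∑ xs f ≈ 0#
  ∑-zero []       f≈0 = refl
  ∑-zero (x ∷ xs) f≈0 = trans (+-cong (f≈0 (here ≡.refl)) (∑-zero xs (f≈0 ∘ there))) (+-identityˡ 0#)

  ∑-comm : ∀ xs ys (f : A → B → Carrier) → ∑ xs (λ a → ∑ ys (f a)) ≈ ∑ ys (λ b → ∑ xs (λ a → f a b))
  ∑-comm []       ys f = sym (∑-zero ys (λ _ → refl))
  ∑-comm (x ∷ xs) ys f = trans (+-congˡ (∑-comm xs ys f)) (sym (∑-distrib-+ ys (f x) _))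

  ∑-↭ : ∀ {xs ys} (f : A → Carrier) → xs ↭ ys → ∑ xs f ≈ ∑ ys f
  ∑-↭ f xs↭ys = ↭ₛ.foldr-commMonoid setoid +-isCommutativeMonoid (↭⇒↭ₛ′ isEquivalence (↭.map⁺ f xs↭ys))

  ∑-bag : ∀ {xs ys} (f : A → Carrier) → Unique xs → Unique ys → (∀ {a} → a ∈ xs ⇔ a ∈ ys) → ∑ xs f ≈ ∑ ys f
  ∑-bag f uxs uys xs⇔ys = ∑-↭ f (∼bag⇒↭ (unique∧set⇒bag uxs uys xs⇔ys))

  ∑-reindex : ∀ xs ys (φ : A → B) → Unique xs → Unique ys → InjectiveOn φ xs →
    (∀ {a} → a ∈ xs → φ a ∈ ys) → (∀ {b} → b ∈ ys → ∃ λ a → a ∈ xs × φ a ≡.≡ b) →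
    (g : B → Carrier) → ∑ xs (g ∘ φ) ≈ ∑ ys g
  ∑-reindex xs ys φ uxs uys inj into onto g =
    trans (sym (∑-map φ xs g)) (∑-bag g (Unique-map⁺ inj uxs) uys (mk⇔ to from))
    where
    to : ∀ {b} → b ∈ map φ xs → b ∈ ys
    to b∈ with ∈-map⁻ φ b∈
    ... | a , a∈ , ≡.refl = into a∈
    from : ∀ {b} → b ∈ ys → b ∈ map φ xs
    from b∈ with onto b∈
    ... | a , a∈ , ≡.refl = ∈-map⁺ φ a∈

  ∑-single : ∀ xs (f : A → Carrier) {a} → Unique xs → a ∈ xs →
    (∀ {b} → b ∈ xs → b ≡.≢ a → f b ≈ 0#) → ∑ xs f ≈ f a
  ∑-single (x ∷ xs) f (x∉ ∷ u) (here ≡.refl) f≈0 =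
    trans (+-congˡ (∑-zero xs (λ b∈ → f≈0 (there b∈) (λ b≡x → All.lookup x∉ b∈ (≡.sym b≡x))))) (+-identityʳ _)
  ∑-single (x ∷ xs) f (x∉ ∷ u) (there a∈) f≈0 =
    trans (+-congʳ (f≈0 (here ≡.refl) (All.lookup x∉ a∈))) (trans (+-identityˡ _) (∑-single xs f u a∈ (f≈0 ∘ there)))

  𝟙 : ∀ {p} {P : Set p} → Dec P → Carrier
  𝟙 d = if does d then 1# else 0#

  𝟙-yes : ∀ {p} {P : Set p} (d : Dec P) → P → 𝟙 d ≡.≡ 1#
  𝟙-yes (yes _) _ = ≡.refl
  𝟙-yes (no ¬p) p = ⊥-elim (¬p p)

  𝟙-no : ∀ {p} {P : Set p} (d : Dec P) → ¬ P → 𝟙 d ≡.≡ 0#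
  𝟙-no (yes p) ¬p = ⊥-elim (¬p p)
  𝟙-no (no _)  _  = ≡.refl

  𝟙-⇔ : ∀ {p q} {P : Set p} {Q : Set q} (d : Dec P) (e : Dec Q) → (P → Q) → (Q → P) → 𝟙 d ≡.≡ 𝟙 e
  𝟙-⇔ (yes p) (yes q) to from = ≡.refl
  𝟙-⇔ (yes p) (no ¬q) to from = ⊥-elim (¬q (to p))
  𝟙-⇔ (no ¬p) (yes q) to from = ⊥-elim (¬p (from q))
  𝟙-⇔ (no ¬p) (no ¬q) to from = ≡.refl

  𝟙-× : ∀ {p q r} {P : Set p} {Q : Set q} {S : Set r} (d : Dec S) (e : Dec P) (f : Dec Q) →
    (S → P × Q) → (P × Q → S) → 𝟙 d ≈ 𝟙 e * 𝟙 f
  𝟙-× (yes s) (yes p) (yes q) to from = sym (*-identityˡ _)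
  𝟙-× (yes s) (no ¬p) f       to from = ⊥-elim (¬p (proj₁ (to s)))
  𝟙-× (yes s) (yes p) (no ¬q) to from = ⊥-elim (¬q (proj₂ (to s)))
  𝟙-× (no ¬s) (yes p) (yes q) to from = ⊥-elim (¬s (from (p , q)))
  𝟙-× (no ¬s) (no ¬p) f       to from = sym (zeroˡ _)
  𝟙-× (no ¬s) (yes p) (no ¬q) to from = sym (zeroʳ _)

  ∑-filter : ∀ {p} {P : Pred A p} (P? : Decidable P) xs (f : A → Carrier) →
    ∑ (filter P? xs) f ≈ ∑ xs (λ a → 𝟙 (P? a) * f a)
  ∑-filter P? []       f = refl
  ∑-filter P? (x ∷ xs) f with P? x
  ... | yes _ = +-cong (sym (*-identityˡ _)) (∑-filter P? xs f)
  ... | no  _ = trans (∑-filter P? xs f) (trans (sym (+-identityˡ _)) (+-congʳ (sym (zeroˡ _))))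

  ∑-partition : ∀ {p} {P : Pred A p} (P? : Decidable P) xs (f : A → Carrier) →
    ∑ xs f ≈ ∑ (filter P? xs) f + ∑ (filter (¬? ∘ P?) xs) f
  ∑-partition P? []       f = sym (+-identityˡ _)
  ∑-partition P? (x ∷ xs) f with P? x
  ... | yes _ = trans (+-congˡ (∑-partition P? xs f)) (sym (+-assoc _ _ _))
  ... | no  _ = trans (+-congˡ (∑-partition P? xs f)) (x+yz≈y+xz _ _ _)

  ∏-cong : ∀ xs {f g : A → Carrier} → (∀ a → f a ≈ g a) → ∏ xs f ≈ ∏ xs g
  ∏-cong []       f≈g = refl
  ∏-cong (a ∷ xs) f≈g = *-cong (f≈g a) (∏-cong xs f≈g)

  ∏-distrib-* : ∀ xs (f g : A → Carrier) → ∏ xs (λ a → f a * g a) ≈ ∏ xs f * ∏ xs g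
  ∏-distrib-* []       f g = sym (*-identityˡ _)
  ∏-distrib-* (a ∷ xs) f g = trans (*-congˡ (∏-distrib-* xs f g)) (*-interchange _ _ _ _)

  ∏-one : ∀ (xs : List A) → ∏ xs (λ _ → 1#) ≈ 1#
  ∏-one []       = refl
  ∏-one (a ∷ xs) = trans (*-identityˡ _) (∏-one xs)

  prodR-↭ : ∀ {xs ys : List Carrier} → xs ↭ ys → prodR R xs ≈ prodR R ys
  prodR-↭ xs↭ys = ↭ₛ.foldr-commMonoid setoid *-isCommutativeMonoid (↭⇒↭ₛ′ isEquivalence xs↭ys)

  ∑-const : ∀ (xs : List A) k → ∑ xs (λ _ → k) ≈ length xs ×ₙ k
  ∑-const []       k = refl
  ∑-const (x ∷ xs) k = +-congˡ (∑-const xs k)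

module Compositions where

  open import Data.List using (List; []; _∷_; map)
  open import Data.List.Membership.Propositional using (_∈_)
  open import Data.List.Membership.Propositional.Properties using (∈-map⁺; ∈-map⁻)
  open import Data.List.Relation.Unary.Any using (here; there)
  import Data.List.Relation.Unary.All as All
  open import Data.List.Relation.Unary.AllPairs using ([]; _∷_)
  open import Data.List.Relation.Unary.Unique.Propositional using (Unique)
  open import Data.Nat using (ℕ; zero; suc; _+_; _≤_; z≤n; s≤s)
  open import Data.Nat.Properties using (suc-injective; +-cancelˡ-≡; +-assoc; m≤n+m; ≤-refl; ≤-trans)
  open import Data.Product using (_×_; _,_; proj₁; proj₂; map₁)
  open import Function using (_∘_; _⇔_; mk⇔)
  open import Relation.Nullary using (¬_)
  open import Relation.Binary.PropositionalEquality using (_≡_; refl; sym; trans; cong; subst)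

  open import Defs using (IsComposition; sumℕ)
  open ListEnumeration

  antidiagonal : ℕ → List (ℕ × ℕ)
  antidiagonal zero    = (0 , 0) ∷ []
  antidiagonal (suc m) = (0 , suc m) ∷ map (map₁ suc) (antidiagonal m)

  ∈-antidiagonal⁻ : ∀ m {i j} → (i , j) ∈ antidiagonal m → i + j ≡ m
  ∈-antidiagonal⁻ zero    (here refl) = refl
  ∈-antidiagonal⁻ (suc m) (here refl) = refl
  ∈-antidiagonal⁻ (suc m) (there p) with ∈-map⁻ _ p
  ... | _ , q , refl = cong suc (∈-antidiagonal⁻ m q)

  ∈-antidiagonal⁺ : ∀ m i j → i + j ≡ m → (i , j) ∈ antidiagonal m
  ∈-antidiagonal⁺ zero    zero    zero refl = here refl
  ∈-antidiagonal⁺ (suc m) zero    j    j≡   = here (cong (0 ,_) j≡)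
  ∈-antidiagonal⁺ (suc m) (suc i) j    i+j≡ = there (∈-map⁺ _ (∈-antidiagonal⁺ m i j (suc-injective i+j≡)))

  antidiagonal-snd≤ : ∀ m {i j} → (i , j) ∈ antidiagonal m → j ≤ m
  antidiagonal-snd≤ m {i} {j} p = subst (j ≤_) (∈-antidiagonal⁻ m p) (m≤n+m j i)

  antidiagonal-unique : ∀ m → Unique (antidiagonal m)
  antidiagonal-unique zero    = All.[] ∷ []
  antidiagonal-unique (suc m) =
    All.tabulate head∉ ∷ Unique-map⁺ (λ { {_ , _} {_ , _} _ _ refl → refl }) (antidiagonal-unique m)
    where
    head∉ : ∀ {p} → p ∈ map (map₁ suc) (antidiagonal m) → ¬ (0 , suc m) ≡ p
    head∉ p∈ eq with ∈-map⁻ _ p∈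
    head∉ p∈ () | _ , _ , refl

  antidiagonal₃ˡ : ℕ → List (ℕ × ℕ × ℕ)
  antidiagonal₃ˡ m = productWith (λ (_ , k) (i , j) → i , j , k) (antidiagonal m) (antidiagonal ∘ proj₁)

  antidiagonal₃ʳ : ℕ → List (ℕ × ℕ × ℕ)
  antidiagonal₃ʳ m = productWith (λ (i , _) (j , k) → i , j , k) (antidiagonal m) (antidiagonal ∘ proj₂)

  ∈-antidiagonal₃ˡ : ∀ m {i j k} → (i , j , k) ∈ antidiagonal₃ˡ m ⇔ i + (j + k) ≡ m
  ∈-antidiagonal₃ˡ m {i} {j} {k} = mk⇔ to from
    where
    to : (i , j , k) ∈ antidiagonal₃ˡ m → i + (j + k) ≡ m
    to t∈ with ∈-productWith⁻ _ (antidiagonal m) _ t∈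
    ... | (s , k) , (i , j) , sk∈ , ij∈ , refl =
      trans (sym (+-assoc i j k)) (trans (cong (_+ k) (∈-antidiagonal⁻ s ij∈)) (∈-antidiagonal⁻ m sk∈))
    from : i + (j + k) ≡ m → (i , j , k) ∈ antidiagonal₃ˡ m
    from eq = ∈-productWith⁺ _ (∈-antidiagonal⁺ m (i + j) k (trans (+-assoc i j k) eq)) (∈-antidiagonal⁺ (i + j) i j refl)

  ∈-antidiagonal₃ʳ : ∀ m {i j k} → (i , j , k) ∈ antidiagonal₃ʳ m ⇔ i + (j + k) ≡ m
  ∈-antidiagonal₃ʳ m {i} {j} {k} = mk⇔ to from
    where
    to : (i , j , k) ∈ antidiagonal₃ʳ m → i + (j + k) ≡ m
    to t∈ with ∈-productWith⁻ _ (antidiagonal m) _ t∈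
    ... | (i , t) , (j , k) , it∈ , jk∈ , refl = trans (cong (i +_) (∈-antidiagonal⁻ t jk∈)) (∈-antidiagonal⁻ m it∈)
    from : i + (j + k) ≡ m → (i , j , k) ∈ antidiagonal₃ʳ m
    from eq = ∈-productWith⁺ _ (∈-antidiagonal⁺ m i (j + k) eq) (∈-antidiagonal⁺ (j + k) j k refl)

  antidiagonal₃ˡ-unique : ∀ m → Unique (antidiagonal₃ˡ m)
  antidiagonal₃ˡ-unique m = Unique-productWith⁺ _ (antidiagonal-unique m) (λ _ → antidiagonal-unique _) inj
    where
    inj : ∀ {a a' b b'} → a ∈ antidiagonal m → a' ∈ antidiagonal m → b ∈ antidiagonal (proj₁ a) →
          b' ∈ antidiagonal (proj₁ a') →
          (proj₁ b , proj₂ b , proj₂ a) ≡ (proj₁ b' , proj₂ b' , proj₂ a') → a ≡ a' × b ≡ b'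
    inj {s , k} {s' , .k} {i , j} {.i , .j} _ _ ij∈ ij∈′ refl =
      cong (_, k) (trans (sym (∈-antidiagonal⁻ s ij∈)) (∈-antidiagonal⁻ s' ij∈′)) , refl

  antidiagonal₃ʳ-unique : ∀ m → Unique (antidiagonal₃ʳ m)
  antidiagonal₃ʳ-unique m = Unique-productWith⁺ _ (antidiagonal-unique m) (λ _ → antidiagonal-unique _) inj
    where
    inj : ∀ {a a' b b'} → a ∈ antidiagonal m → a' ∈ antidiagonal m → b ∈ antidiagonal (proj₂ a) →
          b' ∈ antidiagonal (proj₂ a') →
          (proj₁ a , proj₁ b , proj₂ b) ≡ (proj₁ a' , proj₁ b' , proj₂ b') → a ≡ a' × b ≡ b'
    inj {i , t} {.i , t'} {j , k} {.j , .k} _ _ jk∈ jk∈′ refl =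
      cong (i ,_) (trans (sym (∈-antidiagonal⁻ t jk∈)) (∈-antidiagonal⁻ t' jk∈′)) , refl

  prependPart : ℕ × ℕ → List ℕ → List ℕ
  prependPart (a , _) β = suc a ∷ β

  -- The first argument is fuel: compositions′ f m lists the compositions of m whenever m ≤ f.
  compositions′ : ℕ → ℕ → List (List ℕ)
  compositions′ f       zero    = [] ∷ []
  compositions′ zero    (suc m) = []
  compositions′ (suc f) (suc m) = productWith prependPart (antidiagonal m) (compositions′ f ∘ proj₂)

  compositions : ℕ → List (List ℕ)
  compositions m = compositions′ m m

  compositions′-fuel : ∀ f g m → m ≤ f → m ≤ g → compositions′ f m ≡ compositions′ g m
  compositions′-fuel f       g       zero    _         _         = refl
  compositions′-fuel (suc f) (suc g) (suc m) (s≤s m≤f) (s≤s m≤g) =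
    productWith-cong prependPart (antidiagonal m) λ ab∈ →
      compositions′-fuel f g _ (≤-trans (antidiagonal-snd≤ m ab∈) m≤f) (≤-trans (antidiagonal-snd≤ m ab∈) m≤g)

  compositions-suc : ∀ m →
    compositions (suc m) ≡ productWith prependPart (antidiagonal m) (compositions ∘ proj₂)
  compositions-suc m = productWith-cong prependPart (antidiagonal m) λ ab∈ →
    compositions′-fuel m _ _ (antidiagonal-snd≤ m ab∈) ≤-refl

  ∈-compositions′⁻ : ∀ f m {α} → m ≤ f → α ∈ compositions′ f m → IsComposition α m
  ∈-compositions′⁻ f       zero    _         (here refl) = All.[] , refl
  ∈-compositions′⁻ (suc f) (suc m) (s≤s m≤f) α∈
    with ∈-productWith⁻ prependPart (antidiagonal m) (compositions′ f ∘ proj₂) α∈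
  ... | (a , b) , β , ab∈ , β∈ , refl
    with ∈-compositions′⁻ f b (≤-trans (antidiagonal-snd≤ m ab∈) m≤f) β∈
  ... | β-pos , Σβ≡b = s≤s z≤n All.∷ β-pos , cong suc (trans (cong (a +_) Σβ≡b) (∈-antidiagonal⁻ m ab∈))

  ∈-compositions′⁺ : ∀ f m {α} → m ≤ f → IsComposition α m → α ∈ compositions′ f m
  ∈-compositions′⁺ f       zero    {[]}        _         _                  = here refl
  ∈-compositions′⁺ f       zero    {suc a ∷ β} _         (_ , ())
  ∈-compositions′⁺ f       (suc m) {[]}        _         (_ , ())
  ∈-compositions′⁺ f       m       {zero ∷ β}  _         (() All.∷ _ , _)
  ∈-compositions′⁺ (suc f) (suc m) {suc a ∷ β} (s≤s m≤f) (_ All.∷ β-pos , Σα≡) =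
    ∈-productWith⁺ prependPart (∈-antidiagonal⁺ m a (sumℕ β) Σβ) (∈-compositions′⁺ f (sumℕ β) Σβ≤f (β-pos , refl))
    where
    Σβ = suc-injective Σα≡
    Σβ≤f = ≤-trans (subst (sumℕ β ≤_) Σβ (m≤n+m (sumℕ β) a)) m≤f

  compositions′-unique : ∀ f m → Unique (compositions′ f m)
  compositions′-unique f       zero    = All.[] ∷ []
  compositions′-unique zero    (suc m) = []
  compositions′-unique (suc f) (suc m) =
    Unique-productWith⁺ prependPart (antidiagonal-unique m) (λ {ab} _ → compositions′-unique f (proj₂ ab)) inj
    where
    inj : ∀ {ab ab' β β'} → ab ∈ antidiagonal m → ab' ∈ antidiagonal m → _ → _ →
          prependPart ab β ≡ prependPart ab' β' → ab ≡ ab' × β ≡ β'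
    inj {i , j} {.i , j'} ab∈ ab'∈ _ _ refl =
      cong (i ,_) (+-cancelˡ-≡ i j j' (trans (∈-antidiagonal⁻ m ab∈) (sym (∈-antidiagonal⁻ m ab'∈)))) , refl

  ∈-compositions⁻ : ∀ m {α} → α ∈ compositions m → IsComposition α m
  ∈-compositions⁻ m = ∈-compositions′⁻ m m ≤-refl

  ∈-compositions⁺ : ∀ m {α} → IsComposition α m → α ∈ compositions m
  ∈-compositions⁺ m = ∈-compositions′⁺ m m ≤-refl

  compositions-unique : ∀ m → Unique (compositions m)
  compositions-unique m = compositions′-unique m m

module PowerSums {c ℓ} (R : CommutativeRing c ℓ) where

  open import Data.Bool using (true; false; if_then_else_)
  open import Data.Fin using (Fin; zero; suc)
  open import Data.Fin.Subset using (Subset; ∣_∣)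
  open import Data.List using (List; _∷_; map; allFin; length)
  open import Data.List.Membership.Propositional using (_∈_)
  open import Data.List.Properties using (map-tabulate)
  open import Data.Nat as ℕ using (ℕ; zero; suc)
  import Data.Nat.Properties as ℕ
  open import Data.Product using (_×_; _,_; proj₂; map₁)
  open import Data.Vec using (_∷_; lookup)
  open import Function using (_∘_; id)
  import Function.Properties.Equivalence as ⇔
  import Relation.Binary.PropositionalEquality as ≡

  open import Defs using (sumR; prodR; elem; elemλ; allSubsets; negOnePow; firstPart)
  open ListEnumeration
  open Compositions
  open RingSums R

  open CommutativeRing R hiding (zero)
  open import Algebra.Properties.Semiring.Exp semiring using (_^_)
  open import Algebra.Properties.Ring ring using (-‿distribˡ-*; -‿distribʳ-*; -‿involutive; -1*x≈-x)
  open import Algebra.Properties.Semiring.Mult semiring using (×-congʳ; ×-comm-*; ×-assoc-*)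
    renaming (_×_ to _×ₙ_)
  open import Algebra.Properties.CommutativeMonoid.Mult +-commutativeMonoid using (×-distrib-+)
  open import Algebra.Properties.CommutativeSemigroup *-commutativeSemigroup
    using (interchange; x∙yz≈y∙xz)
  open import Relation.Binary.Reasoning.Setoid setoid
  import Algebra.Properties.CommutativeSemigroup ℕ.+-commutativeSemigroup as ℕ+
  open import Algebra.Properties.CommutativeSemigroup +-commutativeSemigroup
    using () renaming (x∙yz≈y∙xz to x+yz≈y+xz)

  -1^_ : ℕ → Carrier
  -1^_ = negOnePow R

  -1^-+ : ∀ a b → -1^ (a ℕ.+ b) ≈ -1^ a * -1^ b
  -1^-+ zero    b = sym (*-identityˡ _)
  -1^-+ (suc a) b = trans (-‿cong (-1^-+ a b)) (-‿distribˡ-* _ _)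

  ×ₙ-neg : ∀ k a → k ×ₙ (- a) ≈ - (k ×ₙ a)
  ×ₙ-neg k a = begin
    k ×ₙ (- a)        ≈⟨ ×-congʳ k (-1*x≈-x a) ⟨
    k ×ₙ (- 1# * a)   ≈⟨ ×-comm-* k (- 1#) a ⟨
    - 1# * (k ×ₙ a)   ≈⟨ -1*x≈-x _ ⟩
    - (k ×ₙ a)        ∎

  infixl 7 _⋆_
  _⋆_ : (ℕ → Carrier) → (ℕ → Carrier) → ℕ → Carrier
  (u ⋆ v) m = ∑ (antidiagonal m) (λ (a , b) → u a * v b)

  ⋆-cong : ∀ {u u' v v'} → (∀ i → u i ≈ u' i) → (∀ j → v j ≈ v' j) → ∀ m → (u ⋆ v) m ≈ (u' ⋆ v') m
  ⋆-cong u≈ v≈ m = ∑-cong (antidiagonal m) (λ (a , b) → *-cong (u≈ a) (v≈ b))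

  ⋆-congˡ : ∀ {u u'} → (∀ i → u i ≈ u' i) → ∀ v m → (u ⋆ v) m ≈ (u' ⋆ v) m
  ⋆-congˡ u≈ v = ⋆-cong u≈ (λ _ → refl)

  ⋆-congʳ : ∀ u {v v'} → (∀ j → v j ≈ v' j) → ∀ m → (u ⋆ v) m ≈ (u ⋆ v') m
  ⋆-congʳ u = ⋆-cong (λ _ → refl)

  ∑-antidiagonal-suc : ∀ m (F : ℕ × ℕ → Carrier) →
    ∑ (antidiagonal (suc m)) F ≈ ∑ (antidiagonal m) (λ (a , b) → F (a , suc b)) + F (suc m , 0)
  ∑-antidiagonal-suc zero    F = trans (+-congˡ (+-identityʳ _)) (+-congʳ (sym (+-identityʳ _)))
  ∑-antidiagonal-suc (suc m) F = begin
    F (0 , suc (suc m)) + ∑ (map (map₁ suc) (antidiagonal (suc m))) F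
      ≈⟨ +-congˡ (trans (∑-map (map₁ suc) (antidiagonal (suc m)) F) (∑-antidiagonal-suc m (F ∘ map₁ suc))) ⟩
    F (0 , suc (suc m)) + (∑ (antidiagonal m) (λ (a , b) → F (suc a , suc b)) + F (suc (suc m) , 0))
      ≈⟨ +-assoc _ _ _ ⟨
    (F (0 , suc (suc m)) + ∑ (antidiagonal m) (λ (a , b) → F (suc a , suc b))) + F (suc (suc m) , 0)
      ≈⟨ +-congʳ (+-congˡ (∑-map (map₁ suc) (antidiagonal m) _)) ⟨
    ∑ (antidiagonal (suc m)) (λ (a , b) → F (a , suc b)) + F (suc (suc m) , 0) ∎

  δ : ℕ → Carrier
  δ zero    = 1#
  δ (suc _) = 0#

  ⋆-identityʳ : ∀ u m → (u ⋆ δ) m ≈ u m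
  ⋆-identityʳ u zero    = trans (+-identityʳ _) (*-identityʳ _)
  ⋆-identityʳ u (suc m) = begin
    (u ⋆ δ) (suc m)                                          ≈⟨ ∑-antidiagonal-suc m _ ⟩
    ∑ (antidiagonal m) (λ (a , _) → u a * 0#) + u (suc m) * 1#  ≈⟨ +-cong (∑-zero (antidiagonal m) (λ _ → zeroʳ _)) (*-identityʳ _) ⟩
    0# + u (suc m)                                           ≈⟨ +-identityˡ _ ⟩
    u (suc m)                                                ∎

  ⋆-distribʳ-+ : ∀ u u' v m → ((λ i → u i + u' i) ⋆ v) m ≈ (u ⋆ v) m + (u' ⋆ v) m
  ⋆-distribʳ-+ u u' v m =
    trans (∑-cong (antidiagonal m) (λ (a , b) → distribʳ (v b) (u a) (u' a))) (∑-distrib-+ (antidiagonal m) _ _)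

  ⋆-distribˡ-+ : ∀ u v v' m → (u ⋆ (λ j → v j + v' j)) m ≈ (u ⋆ v) m + (u ⋆ v') m
  ⋆-distribˡ-+ u v v' m =
    trans (∑-cong (antidiagonal m) (λ (a , b) → distribˡ (u a) (v b) (v' b))) (∑-distrib-+ (antidiagonal m) _ _)

  ⋆-*ʳ : ∀ u k v m → (u ⋆ (λ j → k * v j)) m ≈ k * (u ⋆ v) m
  ⋆-*ʳ u k v m =
    trans (∑-cong (antidiagonal m) (λ (a , b) → x∙yz≈y∙xz (u a) k (v b))) (sym (*-distribˡ-∑ k (antidiagonal m) _))

  ⋆-assoc : ∀ u v w m → ((u ⋆ v) ⋆ w) m ≈ (u ⋆ (v ⋆ w)) m
  ⋆-assoc u v w m = begin
    ((u ⋆ v) ⋆ w) m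
      ≈⟨ ∑-cong (antidiagonal m) (λ (s , k) → trans (*-distribʳ-∑ (w k) (antidiagonal s) _)
                                                (∑-cong (antidiagonal s) (λ _ → *-assoc _ _ _))) ⟩
    ∑ (antidiagonal m) (λ (s , k) → ∑ (antidiagonal s) (λ (i , j) → F (i , j , k)))
      ≈⟨ ∑-productWith _ (antidiagonal m) _ F ⟨
    ∑ (antidiagonal₃ˡ m) F
      ≈⟨ ∑-bag F (antidiagonal₃ˡ-unique m) (antidiagonal₃ʳ-unique m)
                 (⇔.trans (∈-antidiagonal₃ˡ m) (⇔.sym (∈-antidiagonal₃ʳ m))) ⟩
    ∑ (antidiagonal₃ʳ m) F
      ≈⟨ ∑-productWith _ (antidiagonal m) _ F ⟩
    ∑ (antidiagonal m) (λ (i , t) → ∑ (antidiagonal t) (λ (j , k) → u i * (v j * w k)))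
      ≈⟨ ∑-cong (antidiagonal m) (λ (i , t) → *-distribˡ-∑ (u i) (antidiagonal t) _) ⟨
    (u ⋆ (v ⋆ w)) m ∎
    where
    F : ℕ × ℕ × ℕ → Carrier
    F (i , j , k) = u i * (v j * w k)

  negShift : (ℕ → Carrier) → ℕ → Carrier
  negShift u zero    = 0#
  negShift u (suc j) = - u j

  ⋆-negShift : ∀ u v m → (u ⋆ negShift v) m ≈ negShift (u ⋆ v) m
  ⋆-negShift u v zero    = trans (+-identityʳ _) (zeroʳ _)
  ⋆-negShift u v (suc m) = begin
    (u ⋆ negShift v) (suc m)                                        ≈⟨ ∑-antidiagonal-suc m _ ⟩
    ∑ (antidiagonal m) (λ (a , b) → u a * - v b) + u (suc m) * 0#    ≈⟨ +-cong (∑-cong (antidiagonal m) (λ _ → sym (-‿distribʳ-* _ _))) (zeroʳ _) ⟩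
    ∑ (antidiagonal m) (λ (a , b) → - (u a * v b)) + 0#              ≈⟨ trans (+-identityʳ _) (∑-neg (antidiagonal m) _) ⟩
    - (u ⋆ v) m                                                      ∎

  map-allFin-suc : ∀ {a} {A : Set a} {n} (g : Fin (suc n) → A) →
    map g (allFin (suc n)) ≡.≡ g zero ∷ map (g ∘ suc) (allFin n)
  map-allFin-suc {n = n} g =
    ≡.cong (g zero ∷_) (≡.trans (map-tabulate suc g) (≡.sym (map-tabulate id (g ∘ suc))))

  module _ {N : ℕ} where

    monomial : (Fin N → Carrier) → Subset N → Carrier
    monomial x s = ∏ (allFin N) (λ i → if lookup s i then x i else 1#)

    elem-∑ : ∀ k (x : Fin N → Carrier) → elem R k x ≈ ∑ (allSubsets R N) (λ s → 𝟙 (∣ s ∣ ℕ.≟ k) * monomial x s)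
    elem-∑ k x = ∑-filter (λ s → ∣ s ∣ ℕ.≟ k) (allSubsets R N) (monomial x)

    psum : ℕ → (Fin N → Carrier) → Carrier
    psum k x = ∑ (allFin N) (λ c → x c ^ k)

  module _ {N : ℕ} (x : Fin (suc N) → Carrier) where

    monomial-∷ : ∀ b s → monomial x (b ∷ s) ≈ (if b then x zero else 1#) * monomial (x ∘ suc) s
    monomial-∷ b s = reflexive (≡.cong (prodR R) (map-allFin-suc (λ i → if lookup (b ∷ s) i then x i else 1#)))

    ∑-allSubsets-suc : ∀ (F : Subset (suc N) → Carrier) →
      ∑ (allSubsets R (suc N)) F ≈ ∑ (allSubsets R N) (F ∘ (true ∷_)) + ∑ (allSubsets R N) (F ∘ (false ∷_))
    ∑-allSubsets-suc F = trans (∑-++ (map (true ∷_) (allSubsets R N)) _ F)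
                               (+-cong (∑-map (true ∷_) (allSubsets R N) F) (∑-map (false ∷_) (allSubsets R N) F))

    psum-suc : ∀ k → psum k x ≈ x zero ^ k + psum k (x ∘ suc)
    psum-suc k = reflexive (≡.cong (sumR R) (map-allFin-suc (λ c → x c ^ k)))

  elem-zero : ∀ {N} (x : Fin N → Carrier) → elem R 0 x ≈ 1#
  elem-zero {zero}  x = +-identityʳ _
  elem-zero {suc N} x = begin
    elem R 0 x
      ≈⟨ trans (elem-∑ 0 x) (∑-allSubsets-suc x _) ⟩
    ∑ (allSubsets R N) (λ s → 0# * monomial x (true ∷ s))
      + ∑ (allSubsets R N) (λ s → 𝟙 (∣ s ∣ ℕ.≟ 0) * monomial x (false ∷ s))
      ≈⟨ +-cong (∑-zero (allSubsets R N) (λ _ → zeroˡ _))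
                (∑-cong (allSubsets R N) (λ s → *-congˡ (trans (monomial-∷ x false s) (*-identityˡ _)))) ⟩
    0# + ∑ (allSubsets R N) (λ s → 𝟙 (∣ s ∣ ℕ.≟ 0) * monomial (x ∘ suc) s)
      ≈⟨ trans (+-identityˡ _) (sym (elem-∑ 0 (x ∘ suc))) ⟩
    elem R 0 (x ∘ suc)
      ≈⟨ elem-zero (x ∘ suc) ⟩
    1# ∎

  elem-suc : ∀ {N} k (x : Fin (suc N) → Carrier) →
    elem R (suc k) x ≈ elem R (suc k) (x ∘ suc) + x zero * elem R k (x ∘ suc)
  elem-suc {N} k x = begin
    elem R (suc k) x
      ≈⟨ trans (elem-∑ (suc k) x) (∑-allSubsets-suc x _) ⟩
    ∑ (allSubsets R N) (λ s → 𝟙 (∣ s ∣ ℕ.≟ k) * monomial x (true ∷ s))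
      + ∑ (allSubsets R N) (λ s → 𝟙 (∣ s ∣ ℕ.≟ suc k) * monomial x (false ∷ s))
      ≈⟨ +-comm _ _ ⟩
    ∑ (allSubsets R N) (λ s → 𝟙 (∣ s ∣ ℕ.≟ suc k) * monomial x (false ∷ s))
      + ∑ (allSubsets R N) (λ s → 𝟙 (∣ s ∣ ℕ.≟ k) * monomial x (true ∷ s))
      ≈⟨ +-cong (∑-cong (allSubsets R N) (λ s → *-congˡ (trans (monomial-∷ x false s) (*-identityˡ _))))
                (∑-cong (allSubsets R N) (λ s → trans (*-congˡ (monomial-∷ x true s)) (x∙yz≈y∙xz _ _ _))) ⟩
    ∑ (allSubsets R N) (λ s → 𝟙 (∣ s ∣ ℕ.≟ suc k) * monomial (x ∘ suc) s)
      + ∑ (allSubsets R N) (λ s → x zero * (𝟙 (∣ s ∣ ℕ.≟ k) * monomial (x ∘ suc) s))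
      ≈⟨ +-cong (elem-∑ (suc k) (x ∘ suc)) (trans (*-congˡ (elem-∑ k (x ∘ suc))) (*-distribˡ-∑ _ (allSubsets R N) _)) ⟨
    elem R (suc k) (x ∘ suc) + x zero * elem R k (x ∘ suc) ∎

  module _ {N : ℕ} (x : Fin N → Carrier) where

    signedElem : ℕ → Carrier
    signedElem j = -1^ j * elem R j x

    shiftedPsum : ℕ → Carrier
    shiftedPsum i = psum (suc i) x

    newtonTerm : ℕ → Carrier
    newtonTerm m = suc m ×ₙ (-1^ m * elem R (suc m) x)

  negShift-cong : ∀ {u v} → (∀ j → u j ≈ v j) → ∀ j → negShift u j ≈ negShift v j
  negShift-cong u≈v zero    = refl
  negShift-cong u≈v (suc j) = -‿cong (u≈v j)

  -- Induction on the number of variables: split off y = x₀ using e_{j+1}(x) = e_{j+1}(x') + y e_j(x').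
  module NewtonStep {N : ℕ} (x : Fin (suc N) → Carrier) where
    private
      y  = x zero
      x' = x ∘ suc

    signedElem-step : ∀ j → signedElem x j ≈ signedElem x' j + y * negShift (signedElem x') j
    signedElem-step zero    =
      trans (*-congˡ (trans (elem-zero x) (sym (elem-zero x')))) (sym (trans (+-congˡ (zeroʳ y)) (+-identityʳ _)))
    signedElem-step (suc j) = begin
      -1^ suc j * elem R (suc j) x                              ≈⟨ *-congˡ (elem-suc j x) ⟩
      -1^ suc j * (elem R (suc j) x' + y * elem R j x')         ≈⟨ distribˡ _ _ _ ⟩
      signedElem x' (suc j) + - -1^ j * (y * elem R j x')       ≈⟨ +-congˡ (-‿distribˡ-* _ _) ⟨
      signedElem x' (suc j) + - (-1^ j * (y * elem R j x'))     ≈⟨ +-congˡ (-‿cong (x∙yz≈y∙xz _ _ _)) ⟩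
      signedElem x' (suc j) + - (y * signedElem x' j)           ≈⟨ +-congˡ (-‿distribʳ-* _ _) ⟩
      signedElem x' (suc j) + y * negShift (signedElem x') (suc j) ∎

    newtonTerm-step : ∀ m → newtonTerm x m ≈ newtonTerm x' m + y * (signedElem x' m + negShift (newtonTerm x') m)
    newtonTerm-step m = begin
      suc m ×ₙ (-1^ m * elem R (suc m) x)
        ≈⟨ ×-congʳ (suc m) (trans (*-congˡ (elem-suc m x)) (trans (distribˡ _ _ _) (+-congˡ (x∙yz≈y∙xz _ _ _)))) ⟩
      suc m ×ₙ (-1^ m * elem R (suc m) x' + y * (-1^ m * elem R m x'))
        ≈⟨ ×-distrib-+ _ _ (suc m) ⟩
      newtonTerm x' m + suc m ×ₙ (y * (-1^ m * elem R m x'))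
        ≈⟨ +-congˡ (×-comm-* (suc m) y _) ⟨
      newtonTerm x' m + y * (signedElem x' m + m ×ₙ (-1^ m * elem R m x'))
        ≈⟨ +-congˡ (*-congˡ (+-congˡ (lower m))) ⟩
      newtonTerm x' m + y * (signedElem x' m + negShift (newtonTerm x') m) ∎
      where
      lower : ∀ m → m ×ₙ (-1^ m * elem R m x') ≈ negShift (newtonTerm x') m
      lower zero    = refl
      lower (suc m) = trans (×-congʳ (suc m) (sym (-‿distribˡ-* _ _))) (×ₙ-neg (suc m) _)

    telescope : ∀ u m → ((λ a → y ^ suc a) ⋆ (λ b → u b + y * negShift u b)) m ≈ y * u m
    telescope u zero    = trans (+-identityʳ _) (*-cong (*-identityʳ y) (trans (+-congˡ (zeroʳ y)) (+-identityʳ _)))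
    telescope u (suc m) = begin
      y ^ 1 * (u (suc m) + y * - u m) + ∑ (map (map₁ suc) (antidiagonal m)) F
        ≈⟨ +-congˡ (trans (∑-map _ (antidiagonal m) F) (∑-cong (antidiagonal m) (λ _ → *-assoc _ _ _))) ⟩
      y ^ 1 * (u (suc m) + y * - u m) + ∑ (antidiagonal m) (λ (a , b) → y * (y ^ suc a * (u b + y * negShift u b)))
        ≈⟨ +-congˡ (*-distribˡ-∑ y (antidiagonal m) _) ⟨
      y ^ 1 * (u (suc m) + y * - u m) + y * ((λ a → y ^ suc a) ⋆ (λ b → u b + y * negShift u b)) m
        ≈⟨ +-congˡ (*-congˡ (telescope u m)) ⟩
      y ^ 1 * (u (suc m) + y * - u m) + y * (y * u m)
        ≈⟨ +-congʳ (*-congʳ (*-identityʳ y)) ⟩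
      y * (u (suc m) + y * - u m) + y * (y * u m)
        ≈⟨ distribˡ y _ _ ⟨
      y * ((u (suc m) + y * - u m) + y * u m)
        ≈⟨ *-congˡ (trans (+-assoc _ _ _) (+-congˡ (sym (distribˡ y _ _)))) ⟩
      y * (u (suc m) + y * (- u m + u m))
        ≈⟨ *-congˡ (+-congˡ (trans (*-congˡ (-‿inverseˡ _)) (zeroʳ y))) ⟩
      y * (u (suc m) + 0#)
        ≈⟨ *-congˡ (+-identityʳ _) ⟩
      y * u (suc m) ∎
      where
      F : ℕ × ℕ → Carrier
      F (a , b) = y ^ suc a * (u b + y * negShift u b)

    newton-step : (∀ m → newtonTerm x' m ≈ (shiftedPsum x' ⋆ signedElem x') m) →
                  ∀ m → newtonTerm x m ≈ (shiftedPsum x ⋆ signedElem x) m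
    newton-step ih m = sym (begin
      (shiftedPsum x ⋆ signedElem x) m
        ≈⟨ ⋆-cong (λ i → psum-suc x (suc i)) signedElem-step m ⟩
      ((λ a → y ^ suc a + shiftedPsum x' a) ⋆ V) m
        ≈⟨ ⋆-distribʳ-+ _ _ V m ⟩
      ((λ a → y ^ suc a) ⋆ V) m + (shiftedPsum x' ⋆ V) m
        ≈⟨ +-cong (telescope (signedElem x') m) (⋆-distribˡ-+ (shiftedPsum x') _ _ m) ⟩
      y * signedElem x' m + ((shiftedPsum x' ⋆ signedElem x') m + (shiftedPsum x' ⋆ (λ b → y * negShift (signedElem x') b)) m)
        ≈⟨ +-congˡ (+-cong (sym (ih m)) (trans (⋆-*ʳ _ y _ m) (*-congˡ (shifted-ih m)))) ⟩
      y * signedElem x' m + (newtonTerm x' m + y * negShift (newtonTerm x') m)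
        ≈⟨ trans (x+yz≈y+xz _ _ _) (+-congˡ (sym (distribˡ y _ _))) ⟩
      newtonTerm x' m + y * (signedElem x' m + negShift (newtonTerm x') m)
        ≈⟨ newtonTerm-step m ⟨
      newtonTerm x m ∎)
      where
      V = λ b → signedElem x' b + y * negShift (signedElem x') b
      shifted-ih : ∀ m → (shiftedPsum x' ⋆ negShift (signedElem x')) m ≈ negShift (newtonTerm x') m
      shifted-ih m = trans (⋆-negShift _ _ m) (negShift-cong (λ j → sym (ih j)) m)

  newton-identity : ∀ {N} (x : Fin N → Carrier) m → newtonTerm x m ≈ (shiftedPsum x ⋆ signedElem x) m
  newton-identity {zero}  x m =
    trans (sym (×-assoc-* (suc m) _ _)) (trans (zeroʳ _) (sym (∑-zero (antidiagonal m) (λ _ → zeroˡ _))))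
  newton-identity {suc N} x m = NewtonStep.newton-step x (newton-identity (x ∘ suc)) m

  ∑-compositions-suc : ∀ m (F : ℕ → List ℕ → Carrier) →
    ∑ (compositions (suc m)) (F (suc m)) ≈
    ∑ (antidiagonal m) (λ (a , b) → ∑ (compositions b) (λ β → F (suc (a ℕ.+ b)) (suc a ∷ β)))
  ∑-compositions-suc m F = begin
    ∑ (compositions (suc m)) (F (suc m))
      ≡⟨ ≡.cong (λ αs → ∑ αs (F (suc m))) (compositions-suc m) ⟩
    ∑ (productWith prependPart (antidiagonal m) (compositions ∘ proj₂)) (F (suc m))
      ≈⟨ ∑-productWith prependPart (antidiagonal m) _ (F (suc m)) ⟩
    ∑ (antidiagonal m) (λ (a , b) → ∑ (compositions b) (λ β → F (suc m) (suc a ∷ β)))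
      ≈⟨ ∑-cong-∈ (antidiagonal m) (λ ab∈ → reflexive (unfold ab∈)) ⟩
    ∑ (antidiagonal m) (λ (a , b) → ∑ (compositions b) (λ β → F (suc (a ℕ.+ b)) (suc a ∷ β))) ∎
    where
    unfold : ∀ {a b} → (a , b) ∈ antidiagonal m →
      ∑ (compositions b) (λ β → F (suc m) (suc a ∷ β)) ≡.≡ ∑ (compositions b) (λ β → F (suc (a ℕ.+ b)) (suc a ∷ β))
    unfold ab∈ rewrite ∈-antidiagonal⁻ m ab∈ = ≡.refl

  module _ {N : ℕ} (x : Fin N → Carrier) where

    compositionTerm : ℕ → List ℕ → Carrier
    compositionTerm m α = -1^ (length α ℕ.+ m) * elemλ R α x

    compositionSum : ℕ → Carrier
    compositionSum m = ∑ (compositions m) (compositionTerm m)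

    signedElem⁺ : ℕ → Carrier
    signedElem⁺ a = -1^ a * elem R (suc a) x

    compositionTerm-prepend : ∀ a b β →
      compositionTerm (suc (a ℕ.+ b)) (suc a ∷ β) ≈ signedElem⁺ a * compositionTerm b β
    compositionTerm-prepend a b β = begin
      -1^ (suc (length β) ℕ.+ suc (a ℕ.+ b)) * (elem R (suc a) x * elemλ R β x)
        ≡⟨ ≡.cong (λ k → -1^ suc k * (elem R (suc a) x * elemλ R β x)) (ℕ.+-suc (length β) (a ℕ.+ b)) ⟩
      - - -1^ (length β ℕ.+ (a ℕ.+ b)) * (elem R (suc a) x * elemλ R β x)
        ≈⟨ *-congʳ (-‿involutive _) ⟩
      -1^ (length β ℕ.+ (a ℕ.+ b)) * (elem R (suc a) x * elemλ R β x)
        ≡⟨ ≡.cong (λ k → -1^ k * (elem R (suc a) x * elemλ R β x)) (ℕ+.x∙yz≈y∙xz (length β) a b) ⟩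
      -1^ (a ℕ.+ (length β ℕ.+ b)) * (elem R (suc a) x * elemλ R β x)
        ≈⟨ trans (*-congʳ (-1^-+ a _)) (interchange _ _ _ _) ⟩
      signedElem⁺ a * compositionTerm b β ∎

    compositionSum-suc : ∀ m → compositionSum (suc m) ≈ (signedElem⁺ ⋆ compositionSum) m
    compositionSum-suc m = begin
      compositionSum (suc m)
        ≈⟨ ∑-compositions-suc m compositionTerm ⟩
      ∑ (antidiagonal m) (λ (a , b) → ∑ (compositions b) (λ β → compositionTerm (suc (a ℕ.+ b)) (suc a ∷ β)))
        ≈⟨ ∑-cong (antidiagonal m) (λ (a , b) → trans (∑-cong (compositions b) (compositionTerm-prepend a b))
                                                    (sym (*-distribˡ-∑ _ (compositions b) _))) ⟩
      (signedElem⁺ ⋆ compositionSum) m ∎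

    signedElem⋆compositionSum : ∀ m → (signedElem x ⋆ compositionSum) m ≈ δ m
    signedElem⋆compositionSum zero    =
      trans (+-identityʳ _) (trans (*-cong (trans (*-identityˡ _) (elem-zero x)) (trans (+-identityʳ _) (*-identityˡ _)))
                                   (*-identityˡ 1#))
    signedElem⋆compositionSum (suc m) = begin
      signedElem x 0 * compositionSum (suc m)
        + ∑ (map (map₁ suc) (antidiagonal m)) (λ (a , b) → signedElem x a * compositionSum b)
        ≈⟨ +-cong (trans (*-congʳ (trans (*-identityˡ _) (elem-zero x))) (*-identityˡ _)) (∑-map _ (antidiagonal m) _) ⟩
      compositionSum (suc m) + ∑ (antidiagonal m) (λ (a , b) → signedElem x (suc a) * compositionSum b)
        ≈⟨ +-cong (compositionSum-suc m)
                  (∑-cong (antidiagonal m) (λ _ → sym (trans (-‿distribˡ-* _ _) (*-congʳ (-‿distribˡ-* _ _))))) ⟩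
      (signedElem⁺ ⋆ compositionSum) m + ∑ (antidiagonal m) (λ (a , b) → - (signedElem⁺ a * compositionSum b))
        ≈⟨ +-congˡ (∑-neg (antidiagonal m) _) ⟩
      (signedElem⁺ ⋆ compositionSum) m - (signedElem⁺ ⋆ compositionSum) m
        ≈⟨ -‿inverseʳ _ ⟩
      0# ∎

    -- p_{m+1} = ∑_{α ⊨ m+1} α₁ (-1)^{m+1-ℓ(α)} e_α, via p ⋆ (signed e) = newtonTerm and (signed e) ⋆ compositionSum = δ.
    psum-compositions : ∀ m →
      ∑ (compositions (suc m)) (λ α → firstPart α ×ₙ compositionTerm (suc m) α) ≈ psum (suc m) x
    psum-compositions m = begin
      ∑ (compositions (suc m)) (λ α → firstPart α ×ₙ compositionTerm (suc m) α)
        ≈⟨ ∑-compositions-suc m (λ k α → firstPart α ×ₙ compositionTerm k α) ⟩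
      ∑ (antidiagonal m) (λ (a , b) → ∑ (compositions b) (λ β → suc a ×ₙ compositionTerm (suc (a ℕ.+ b)) (suc a ∷ β)))
        ≈⟨ ∑-cong (antidiagonal m) (λ (a , b) → trans
             (∑-cong (compositions b) (λ β → trans (×-congʳ (suc a) (compositionTerm-prepend a b β)) (sym (×-assoc-* (suc a) _ _))))
             (sym (*-distribˡ-∑ _ (compositions b) _))) ⟩
      (newtonTerm x ⋆ compositionSum) m
        ≈⟨ ⋆-congˡ (newton-identity x) compositionSum m ⟩
      ((shiftedPsum x ⋆ signedElem x) ⋆ compositionSum) m
        ≈⟨ ⋆-assoc _ _ _ m ⟩
      (shiftedPsum x ⋆ (signedElem x ⋆ compositionSum)) m
        ≈⟨ ⋆-congʳ (shiftedPsum x) signedElem⋆compositionSum m ⟩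
      (shiftedPsum x ⋆ δ) m
        ≈⟨ ⋆-identityʳ _ m ⟩
      psum (suc m) x ∎

module VectorEnumeration where

  open import Data.Bool using (Bool; true; false)
  open import Data.Fin using (zero; suc)
  open import Data.List using (List; []; _∷_)
  open import Data.List.Membership.Propositional using (_∈_)
  open import Data.List.Relation.Unary.Any using (here; there)
  import Data.List.Relation.Unary.All as All
  open import Data.List.Relation.Unary.AllPairs using ([]; _∷_)
  open import Data.List.Relation.Unary.Unique.Propositional using (Unique)
  open import Data.Nat using (ℕ)
  open import Data.Product using (_,_)
  open import Data.Vec using (Vec; []; _∷_; lookup; replicate)
  open import Data.Vec.Properties using (lookup-replicate)
  open import Function using (_∘_)
  open import Relation.Binary.PropositionalEquality using (_≡_; refl; cong₂; subst; sym)

  open ListEnumeration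

  Vec-ext : ∀ {A : Set} {m} {u v : Vec A m} → (∀ i → lookup u i ≡ lookup v i) → u ≡ v
  Vec-ext {u = []}    {[]}    u≗v = refl
  Vec-ext {u = x ∷ u} {y ∷ v} u≗v = cong₂ _∷_ (u≗v zero) (Vec-ext (u≗v ∘ suc))

  module _ {A : Set} where

    vectorsFrom : ∀ {m} → Vec (List A) m → List (Vec A m)
    vectorsFrom []         = [] ∷ []
    vectorsFrom (xs ∷ xss) = productWith _∷_ xs (λ _ → vectorsFrom xss)

    ∈-vectorsFrom⁺ : ∀ {m} (xss : Vec (List A) m) {v} → (∀ i → lookup v i ∈ lookup xss i) → v ∈ vectorsFrom xss
    ∈-vectorsFrom⁺ []         {[]}    _   = here refl
    ∈-vectorsFrom⁺ (xs ∷ xss) {a ∷ v} v∈ = ∈-productWith⁺ _∷_ (v∈ zero) (∈-vectorsFrom⁺ xss (v∈ ∘ suc))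

    ∈-vectorsFrom⁻ : ∀ {m} (xss : Vec (List A) m) {v} → v ∈ vectorsFrom xss → ∀ i → lookup v i ∈ lookup xss i
    ∈-vectorsFrom⁻ (xs ∷ xss) v∈ i with ∈-productWith⁻ _∷_ xs (λ _ → vectorsFrom xss) v∈
    ∈-vectorsFrom⁻ (xs ∷ xss) v∈ zero    | a , v , a∈ , v∈′ , refl = a∈
    ∈-vectorsFrom⁻ (xs ∷ xss) v∈ (suc i) | a , v , a∈ , v∈′ , refl = ∈-vectorsFrom⁻ xss v∈′ i

    vectorsFrom-unique : ∀ {m} (xss : Vec (List A) m) → (∀ i → Unique (lookup xss i)) → Unique (vectorsFrom xss)
    vectorsFrom-unique []         _    = All.[] ∷ []
    vectorsFrom-unique (xs ∷ xss) uxss =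
      Unique-productWith⁺ _∷_ (uxss zero) (λ _ → vectorsFrom-unique xss (uxss ∘ suc)) (λ { _ _ _ _ refl → refl , refl })

    allVectors : List A → (m : ℕ) → List (Vec A m)
    allVectors xs m = vectorsFrom (replicate m xs)

    ∈-allVectors : ∀ {xs} m (v : Vec A m) → (∀ a → a ∈ xs) → v ∈ allVectors xs m
    ∈-allVectors {xs} m v ∈xs = ∈-vectorsFrom⁺ (replicate m xs) (λ i → subst (_ ∈_) (sym (lookup-replicate i xs)) (∈xs _))

    allVectors-unique : ∀ {xs} m → Unique xs → Unique (allVectors xs m)
    allVectors-unique {xs} m u = vectorsFrom-unique (replicate m xs) (λ i → subst Unique (sym (lookup-replicate i xs)) u)

  bools : List Bool
  bools = true ∷ false ∷ []

  ∈-bools : ∀ b → b ∈ bools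
  ∈-bools true  = here refl
  ∈-bools false = there (here refl)

  bools-unique : Unique bools
  bools-unique = ((λ ()) All.∷ All.[]) ∷ All.[] ∷ []

module Connectivity where

  open import Data.Bool using (Bool; true; false; _∧_; _∨_)
  import Data.Bool.Properties as Bool
  open import Data.Empty using (⊥; ⊥-elim)
  open import Data.Fin using (Fin; zero; suc)
  import Data.Fin.Properties as Fin
  open import Data.Fin.Subset using (Subset; ∣_∣)
  import Data.Fin.Subset.Properties as Subset
  open import Data.Nat using (ℕ; zero; suc; _≤_; _<_; z≤n; s≤s)
  import Data.Nat.Properties as ℕ
  open import Data.Product using (∃; _×_; _,_)
  open import Data.Sum using (_⊎_; inj₁; inj₂)
  open import Data.Vec using (Vec; []; _∷_; lookup; tabulate)
  open import Data.Vec.Properties using (lookup∘tabulate)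
  import Data.Vec.Properties as Vec
  open import Function using (_∘_)
  open import Relation.Nullary using (Dec; yes; no)
  open import Relation.Nullary.Decidable using (_×-dec_; _→-dec_; map′; isYes)
  open import Relation.Binary.PropositionalEquality using (_≡_; _≢_; refl; sym; trans; cong; subst)

  open import Defs hiding (sym)
  open VectorEnumeration using (Vec-ext)

  ∨≡true⁻ : ∀ a {b} → a ∨ b ≡ true → a ≡ true ⊎ b ≡ true
  ∨≡true⁻ true  _ = inj₁ refl
  ∨≡true⁻ false e = inj₂ e

  ∨≡trueˡ : ∀ {a} b → a ≡ true → a ∨ b ≡ true
  ∨≡trueˡ b refl = refl

  ∨≡trueʳ : ∀ a {b} → b ≡ true → a ∨ b ≡ true
  ∨≡trueʳ true  _ = refl
  ∨≡trueʳ false e = e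

  ∧≡true⁻ : ∀ a {b} → a ∧ b ≡ true → a ≡ true × b ≡ true
  ∧≡true⁻ true e = refl , e

  ∧≡true⁺ : ∀ {a b} → a ≡ true → b ≡ true → a ∧ b ≡ true
  ∧≡true⁺ refl refl = refl

  ≢true⇒≡false : ∀ {b} → b ≢ true → b ≡ false
  ≢true⇒≡false = Bool.¬-not

  true≢false : ∀ {b} → b ≡ true → b ≡ false → ⊥
  true≢false refl ()

  Bool-ext : ∀ {a b : Bool} → (a ≡ true → b ≡ true) → (b ≡ true → a ≡ true) → a ≡ b
  Bool-ext {true}  {true}  _ _ = refl
  Bool-ext {true}  {false} f _ = sym (f refl)
  Bool-ext {false} {true}  _ g = g refl
  Bool-ext {false} {false} _ _ = refl

  ∈V⇒∣∣-pos : ∀ {m} {A : Subset m} i → i ∈V A → 1 ≤ ∣ A ∣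
  ∈V⇒∣∣-pos {A = true  ∷ A} zero    _ = s≤s z≤n
  ∈V⇒∣∣-pos {A = true  ∷ A} (suc i) _ = s≤s z≤n
  ∈V⇒∣∣-pos {A = false ∷ A} (suc i) e = ∈V⇒∣∣-pos {A = A} i e

  ⊆⇒∣∣≤ : ∀ {m} (A B : Subset m) → (∀ i → i ∈V A → i ∈V B) → ∣ A ∣ ≤ ∣ B ∣
  ⊆⇒∣∣≤ []          []          _   = z≤n
  ⊆⇒∣∣≤ (true  ∷ A) (true  ∷ B) A⊆B = s≤s (⊆⇒∣∣≤ A B (A⊆B ∘ suc))
  ⊆⇒∣∣≤ (true  ∷ A) (false ∷ B) A⊆B with () ← A⊆B zero refl
  ⊆⇒∣∣≤ (false ∷ A) (true  ∷ B) A⊆B = ℕ.m≤n⇒m≤1+n (⊆⇒∣∣≤ A B (A⊆B ∘ suc))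
  ⊆⇒∣∣≤ (false ∷ A) (false ∷ B) A⊆B = ⊆⇒∣∣≤ A B (A⊆B ∘ suc)

  ⊂⇒∣∣< : ∀ {m} (A B : Subset m) → (∀ i → i ∈V A → i ∈V B) → A ≢ B → ∣ A ∣ < ∣ B ∣
  ⊂⇒∣∣< []          []          _   A≢B = ⊥-elim (A≢B refl)
  ⊂⇒∣∣< (true  ∷ A) (true  ∷ B) A⊆B A≢B = s≤s (⊂⇒∣∣< A B (A⊆B ∘ suc) (A≢B ∘ cong (true ∷_)))
  ⊂⇒∣∣< (true  ∷ A) (false ∷ B) A⊆B _   with () ← A⊆B zero refl
  ⊂⇒∣∣< (false ∷ A) (true  ∷ B) A⊆B _   = s≤s (⊆⇒∣∣≤ A B (A⊆B ∘ suc))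
  ⊂⇒∣∣< (false ∷ A) (false ∷ B) A⊆B A≢B = ⊂⇒∣∣< A B (A⊆B ∘ suc) (A≢B ∘ cong (false ∷_))

  module _ {n : ℕ} where

    fromPred : (Fin n → Bool) → Subset n
    fromPred = tabulate

    fromRel : (Fin n → Fin n → Bool) → EdgeSet n
    fromRel f = tabulate (tabulate ∘ f)

    edge-fromRel : ∀ f i j → edge (fromRel f) i j ≡ f i j
    edge-fromRel f i j = trans (cong (λ row → lookup row j) (lookup∘tabulate (tabulate ∘ f) i)) (lookup∘tabulate (f i) j)

    EdgeSet-ext : ∀ {M M' : EdgeSet n} → (∀ i j → edge M i j ≡ edge M' i j) → M ≡ M'
    EdgeSet-ext M≗M' = Vec-ext (λ i → Vec-ext (M≗M' i))

    _⊆V_ : Subset n → Subset n → Set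
    B ⊆V W = ∀ i → i ∈V B → i ∈V W

    Walk-snoc : ∀ {M : EdgeSet n} {i j k} → Walk M i j → edge M j k ≡ true → Walk M i k
    Walk-snoc here        e = step e here
    Walk-snoc (step e' w) e = step e' (Walk-snoc w e)

    Walk-++ : ∀ {M : EdgeSet n} {i j k} → Walk M i j → Walk M j k → Walk M i k
    Walk-++ here       w' = w'
    Walk-++ (step e w) w' = step e (Walk-++ w w')

    Walk-reverse : ∀ {M : EdgeSet n} → (∀ i j → edge M i j ≡ edge M j i) → ∀ {i j} → Walk M i j → Walk M j i
    Walk-reverse M-sym here                 = here
    Walk-reverse M-sym (step {i} {j} e w) = Walk-snoc (Walk-reverse M-sym w) (trans (M-sym j i) e)

    Walk-mono : ∀ {M M' : EdgeSet n} → (∀ i j → edge M i j ≡ true → edge M' i j ≡ true) →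
      ∀ {i j} → Walk M i j → Walk M' i j
    Walk-mono M⊆M' here       = here
    Walk-mono M⊆M' (step e w) = step (M⊆M' _ _ e) (Walk-mono M⊆M' w)

    Closed : EdgeSet n → Subset n → Set
    Closed M C = ∀ u v → u ∈V C → edge M u v ≡ true → v ∈V C

    Walk-closed : ∀ {M C} → Closed M C → ∀ {i j} → i ∈V C → Walk M i j → j ∈V C
    Walk-closed         C-closed i∈C here       = i∈C
    Walk-closed {M} {C} C-closed i∈C (step e w) = Walk-closed {M} {C} C-closed (C-closed _ _ i∈C e) w

    anyᶠ : ∀ {m} → (Fin m → Bool) → Bool
    anyᶠ {zero}  f = false
    anyᶠ {suc m} f = f zero ∨ anyᶠ (f ∘ suc)

    anyᶠ⁻ : ∀ {m} (f : Fin m → Bool) → anyᶠ f ≡ true → ∃ λ i → f i ≡ true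
    anyᶠ⁻ {suc m} f e with ∨≡true⁻ (f zero) e
    ... | inj₁ e′ = zero , e′
    ... | inj₂ e′ with anyᶠ⁻ (f ∘ suc) e′
    ... | i , e″ = suc i , e″

    anyᶠ⁺ : ∀ {m} (f : Fin m → Bool) i → f i ≡ true → anyᶠ f ≡ true
    anyᶠ⁺ {suc m} f zero    e = ∨≡trueˡ _ e
    anyᶠ⁺ {suc m} f (suc i) e = ∨≡trueʳ (f zero) (anyᶠ⁺ (f ∘ suc) i e)

    singleton : Fin n → Subset n
    singleton w = fromPred (λ v → isYes (v Fin.≟ w))

    ∈-singleton : ∀ w → w ∈V singleton w
    ∈-singleton w with w Fin.≟ w | lookup∘tabulate (λ v → isYes (v Fin.≟ w)) w
    ... | yes _   | eq = eq
    ... | no w≢w  | _  = ⊥-elim (w≢w refl)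

    ∈-singleton⁻ : ∀ w v → v ∈V singleton w → v ≡ w
    ∈-singleton⁻ w v v∈ with v Fin.≟ w | trans (sym (lookup∘tabulate (λ v → isYes (v Fin.≟ w)) v)) v∈
    ... | yes v≡w | _ = v≡w

    module _ (M : EdgeSet n) where

      grow : Subset n → Subset n
      grow A = fromPred (λ v → lookup A v ∨ anyᶠ (λ u → lookup A u ∧ edge M u v))

      grow-⊇ : ∀ A v → v ∈V A → v ∈V grow A
      grow-⊇ A v e = trans (lookup∘tabulate _ v) (∨≡trueˡ _ e)

      grow-edge : ∀ A u v → u ∈V A → edge M u v ≡ true → v ∈V grow A
      grow-edge A u v u∈ e =
        trans (lookup∘tabulate _ v) (∨≡trueʳ (lookup A v) (anyᶠ⁺ (λ u → lookup A u ∧ edge M u v) u (∧≡true⁺ u∈ e)))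

      grow⁻ : ∀ A v → v ∈V grow A → v ∈V A ⊎ ∃ λ u → u ∈V A × edge M u v ≡ true
      grow⁻ A v v∈ with ∨≡true⁻ (lookup A v) (trans (sym (lookup∘tabulate _ v)) v∈)
      ... | inj₁ e = inj₁ e
      ... | inj₂ e with anyᶠ⁻ (λ u → lookup A u ∧ edge M u v) e
      ... | u , e′ = inj₂ (u , ∧≡true⁻ (lookup A u) e′)

      grow^ : ℕ → Subset n → Subset n
      grow^ zero    A = A
      grow^ (suc k) A = grow (grow^ k A)

      grow^-least : ∀ {A C} → Closed M C → A ⊆V C → ∀ k → grow^ k A ⊆V C
      grow^-least             C-closed A⊆C zero    v v∈ = A⊆C v v∈
      grow^-least {A} {C} C-closed A⊆C (suc k) v v∈ with grow⁻ (grow^ k A) v v∈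
      ... | inj₁ v∈′          = grow^-least {A} {C} C-closed A⊆C k v v∈′
      ... | inj₂ (u , u∈ , e) = C-closed u v (grow^-least {A} {C} C-closed A⊆C k u u∈) e

      grow^-⊇ : ∀ A k → A ⊆V grow^ k A
      grow^-⊇ A zero    v v∈ = v∈
      grow^-⊇ A (suc k) v v∈ = grow-⊇ (grow^ k A) v (grow^-⊇ A k v v∈)

      grow^-Walk : ∀ {A w} → (∀ v → v ∈V A → Walk M w v) → ∀ k v → v ∈V grow^ k A → Walk M w v
      grow^-Walk walks zero    v v∈ = walks v v∈
      grow^-Walk {A} walks (suc k) v v∈ with grow⁻ (grow^ k A) v v∈
      ... | inj₁ v∈′          = grow^-Walk walks k v v∈′
      ... | inj₂ (u , u∈ , e) = Walk-snoc (grow^-Walk walks k u u∈) e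

      -- Each non-stationary step adds a vertex, so after k steps the set is stable or has > k elements.
      grow^-stable-or-large : ∀ A → 1 ≤ ∣ A ∣ → ∀ k → grow (grow^ k A) ≡ grow^ k A ⊎ suc k ≤ ∣ grow^ k A ∣
      grow^-stable-or-large A A≢∅ k with Vec.≡-dec Bool._≟_ (grow (grow^ k A)) (grow^ k A)
      ... | yes stable = inj₁ stable
      grow^-stable-or-large A A≢∅ zero    | no _ = inj₂ A≢∅
      grow^-stable-or-large A A≢∅ (suc k) | no unstable with grow^-stable-or-large A A≢∅ k
      ... | inj₁ stable = ⊥-elim (unstable (cong grow stable))
      ... | inj₂ large  = inj₂ (ℕ.<-≤-trans (s≤s large)
             (⊂⇒∣∣< (grow^ k A) (grow (grow^ k A)) (grow-⊇ (grow^ k A)) (unstable ∘ cong grow ∘ sym)))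

      grow^n-stable : ∀ A → 1 ≤ ∣ A ∣ → grow (grow^ n A) ≡ grow^ n A
      grow^n-stable A A≢∅ with grow^-stable-or-large A A≢∅ n
      ... | inj₁ stable = stable
      ... | inj₂ large  = ⊥-elim (ℕ.<⇒≱ large (Subset.∣p∣≤n (grow^ n A)))

      component : Fin n → Subset n
      component w = grow^ n (singleton w)

      ∈-component : ∀ w → w ∈V component w
      ∈-component w = grow^-⊇ (singleton w) n w (∈-singleton w)

      component-closed : ∀ w → Closed M (component w)
      component-closed w u v u∈ e =
        subst (v ∈V_) (grow^n-stable (singleton w) (∈V⇒∣∣-pos {A = singleton w} w (∈-singleton w)))
          (grow-edge (component w) u v u∈ e)

      component⇒Walk : ∀ w v → v ∈V component w → Walk M w v
      component⇒Walk w = grow^-Walk (λ v v∈ → subst (Walk M w) (sym (∈-singleton⁻ w v v∈)) here) n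

      Walk⇒component : ∀ w v → Walk M w v → v ∈V component w
      Walk⇒component w v = Walk-closed {M} {component w} (component-closed w) (∈-component w)

      component-least : ∀ {C} w → Closed M C → w ∈V C → component w ⊆V C
      component-least {C} w C-closed w∈C =
        grow^-least {singleton w} {C} C-closed (λ v v∈ → subst (_∈V C) (sym (∈-singleton⁻ w v v∈)) w∈C) n

    connected? : ∀ (B : Subset n) (M : EdgeSet n) → Dec (Connected B M)
    connected? B M = map′ to from
      (Fin.any? (λ i → lookup B i Bool.≟ true) ×-dec
       Fin.all? (λ i → Fin.all? (λ j →
         (lookup B i Bool.≟ true) →-dec ((lookup B j Bool.≟ true) →-dec (lookup (component M i) j Bool.≟ true)))))
      where
      to : _ → Connected B M
      to (B≢∅ , in-component) = B≢∅ , λ i j i∈ j∈ → component⇒Walk M i j (in-component i j i∈ j∈)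
      from : Connected B M → _
      from (B≢∅ , walks) = B≢∅ , λ i j i∈ j∈ → Walk⇒component M i j (walks i j i∈ j∈)

module Subgraphs where

  open import Data.Bool using (Bool; true; false; _∧_; _∨_; not)
  import Data.Bool.Properties as Bool
  open import Data.Empty using (⊥-elim)
  open import Data.Fin using (Fin; zero; suc)
  import Data.Fin.Properties as Fin
  open import Data.Fin.Subset using (Subset; _─_)
  open import Data.List using (List; filter)
  open import Data.List.Membership.Propositional using (_∈_)
  open import Data.List.Membership.Propositional.Properties using (∈-filter⁺; ∈-filter⁻)
  open import Data.List.Relation.Unary.Unique.Propositional using (Unique)
  import Data.List.Relation.Unary.Unique.Propositional.Properties as Unique
  open import Data.Nat using (ℕ)
  open import Data.Product using (∃; _×_; _,_; proj₁; proj₂)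
  open import Data.Sum using (_⊎_; inj₁; inj₂)
  open import Data.Vec using (_∷_; lookup)
  open import Relation.Nullary using (Dec)
  open import Relation.Nullary.Decidable using (_×-dec_; _→-dec_)
  open import Relation.Binary.PropositionalEquality using (_≡_; refl; sym; trans; cong; cong₂)

  open import Defs hiding (sym)
  open VectorEnumeration
  open Connectivity
  open ListEnumeration

  lookup-─ : ∀ {m} (W B : Subset m) i → lookup (W ─ B) i ≡ lookup W i ∧ not (lookup B i)
  lookup-─ (w ∷ W) (true  ∷ B) zero    = sym (Bool.∧-zeroʳ w)
  lookup-─ (w ∷ W) (false ∷ B) zero    = sym (Bool.∧-identityʳ w)
  lookup-─ (w ∷ W) (b     ∷ B) (suc i) = lookup-─ W B i

  module _ {n : ℕ} where

    ∈V-─⁻ : ∀ (W B : Subset n) i → i ∈V (W ─ B) → i ∈V W × lookup B i ≡ false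
    ∈V-─⁻ W B i i∈ with lookup W i | lookup B i | trans (sym (lookup-─ W B i)) i∈
    ... | true | false | _ = refl , refl

    ∈V-─⁺ : ∀ (W B : Subset n) i → i ∈V W → lookup B i ≡ false → i ∈V (W ─ B)
    ∈V-─⁺ W B i i∈W i∉B = trans (lookup-─ W B i) (cong₂ (λ w b → w ∧ not b) i∈W i∉B)

    ∉V-─ : ∀ (W B : Subset n) i → i ∈V B → lookup (W ─ B) i ≡ false
    ∉V-─ W B i i∈B = trans (lookup-─ W B i) (trans (cong (λ b → lookup W i ∧ not b) i∈B) (Bool.∧-zeroʳ _))

    lookup-─-∉ : ∀ (W B : Subset n) i → lookup B i ≡ false → lookup (W ─ B) i ≡ lookup W i
    lookup-─-∉ W B i i∉B = trans (lookup-─ W B i) (trans (cong (λ b → lookup W i ∧ not b) i∉B) (Bool.∧-identityʳ _))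

    ─-⊆ : ∀ (W B : Subset n) → (W ─ B) ⊆V W
    ─-⊆ W B i i∈ = proj₁ (∈V-─⁻ W B i i∈)

    restrict : EdgeSet n → Subset n → EdgeSet n
    restrict M B = fromRel (λ i j → edge M i j ∧ (lookup B i ∧ lookup B j))

    infixr 6 _∪ₑ_
    _∪ₑ_ : EdgeSet n → EdgeSet n → EdgeSet n
    M ∪ₑ M' = fromRel (λ i j → edge M i j ∨ edge M' i j)

    edge-∪ₑ⁺ˡ : ∀ M M' i j → edge M i j ≡ true → edge (M ∪ₑ M') i j ≡ true
    edge-∪ₑ⁺ˡ M M' i j e = trans (edge-fromRel _ i j) (∨≡trueˡ _ e)

    edge-∪ₑ⁺ʳ : ∀ M M' i j → edge M' i j ≡ true → edge (M ∪ₑ M') i j ≡ true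
    edge-∪ₑ⁺ʳ M M' i j e = trans (edge-fromRel _ i j) (∨≡trueʳ (edge M i j) e)

    edge-∪ₑ⁻ : ∀ M M' i j → edge (M ∪ₑ M') i j ≡ true → edge M i j ≡ true ⊎ edge M' i j ≡ true
    edge-∪ₑ⁻ M M' i j e = ∨≡true⁻ (edge M i j) (trans (sym (edge-fromRel _ i j)) e)

    EdgesWithin : EdgeSet n → Subset n → Set
    EdgesWithin M B = ∀ i j → edge M i j ≡ true → i ∈V B × j ∈V B

    restrict-∪ₑˡ : ∀ {H S B} → EdgesWithin H B → (∀ i j → edge S i j ≡ true → lookup B i ≡ false) →
      restrict (H ∪ₑ S) B ≡ H
    restrict-∪ₑˡ {H} {S} {B} H⊆B S∩B=∅ = EdgeSet-ext λ i j →
      trans (edge-fromRel _ i j) (trans (cong (_∧ (lookup B i ∧ lookup B j)) (edge-fromRel _ i j)) (cases i j))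
      where
      cases : ∀ i j → (edge H i j ∨ edge S i j) ∧ (lookup B i ∧ lookup B j) ≡ edge H i j
      cases i j with edge H i j in eH | edge S i j in eS
      ... | true  | _     rewrite proj₁ (H⊆B i j eH) | proj₂ (H⊆B i j eH) = refl
      ... | false | true  rewrite S∩B=∅ i j eS = refl
      ... | false | false = Bool.∧-zeroˡ (lookup B i ∧ lookup B j)

    restrict-∪ₑʳ : ∀ {H S C} → EdgesWithin S C → (∀ i j → edge H i j ≡ true → lookup C i ≡ false) →
      restrict (H ∪ₑ S) C ≡ S
    restrict-∪ₑʳ {H} {S} {C} S⊆C H∩C=∅ = EdgeSet-ext λ i j →
      trans (edge-fromRel _ i j) (trans (cong (_∧ (lookup C i ∧ lookup C j)) (edge-fromRel _ i j)) (cases i j))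
      where
      cases : ∀ i j → (edge H i j ∨ edge S i j) ∧ (lookup C i ∧ lookup C j) ≡ edge S i j
      cases i j with edge H i j in eH | edge S i j in eS
      ... | true  | true  = ⊥-elim (true≢false (proj₁ (S⊆C i j eS)) (H∩C=∅ i j eH))
      ... | true  | false rewrite H∩C=∅ i j eH = refl
      ... | false | true  rewrite proj₁ (S⊆C i j eS) | proj₂ (S⊆C i j eS) = refl
      ... | false | false = refl

    restrict-∪ₑ-restrict-─ : ∀ {S W B} → EdgesWithin S W → (∀ i j → edge S i j ≡ true → lookup B i ≡ lookup B j) →
      restrict S B ∪ₑ restrict S (W ─ B) ≡ S
    restrict-∪ₑ-restrict-─ {S} {W} {B} S⊆W B-saturated = EdgeSet-ext λ i j →
      trans (edge-fromRel _ i j) (trans (cong₂ _∨_ (edge-fromRel _ i j) (edge-fromRel _ i j)) (cases i j))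
      where
      cases : ∀ i j → (edge S i j ∧ (lookup B i ∧ lookup B j)) ∨ (edge S i j ∧ (lookup (W ─ B) i ∧ lookup (W ─ B) j))
                      ≡ edge S i j
      cases i j with edge S i j in eS
      ... | false = refl
      ... | true with lookup B i in eBi | lookup B j in eBj | B-saturated i j eS
      ...   | true  | true  | _ = refl
      ...   | false | false | _ = ∧≡true⁺ {lookup (W ─ B) i} {lookup (W ─ B) j}
          (∈V-─⁺ W B i (proj₁ (S⊆W i j eS)) eBi) (∈V-─⁺ W B j (proj₂ (S⊆W i j eS)) eBj)

    restrict-sym : ∀ {M} B → (∀ i j → edge M i j ≡ edge M j i) → ∀ i j → edge (restrict M B) i j ≡ edge (restrict M B) j i
    restrict-sym {M} B M-sym i j =
      trans (edge-fromRel _ i j)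
            (trans (cong₂ _∧_ (M-sym i j) (Bool.∧-comm (lookup B i) (lookup B j))) (sym (edge-fromRel _ j i)))

    restrict-Walk : ∀ {M B} → Closed M B → ∀ {i j} → i ∈V B → Walk M i j → Walk (restrict M B) i j
    restrict-Walk B-closed i∈ here = here
    restrict-Walk {M} {B} B-closed {i} i∈ (step {j = k} e w) =
      step (trans (edge-fromRel _ i k) (∧≡true⁺ e (∧≡true⁺ i∈ k∈)))
           (restrict-Walk {M} {B} B-closed k∈ w)
      where k∈ = B-closed i k i∈ e

    subsets : List (Subset n)
    subsets = allVectors bools n

    ∈-subsets : ∀ B → B ∈ subsets
    ∈-subsets B = ∈-allVectors n B ∈-bools

    subsets-unique : Unique subsets
    subsets-unique = allVectors-unique n bools-unique

    edgeSets : List (EdgeSet n)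
    edgeSets = allVectors subsets n

    ∈-edgeSets : ∀ M → M ∈ edgeSets
    ∈-edgeSets M = ∈-allVectors n M ∈-subsets

    edgeSets-unique : Unique edgeSets
    edgeSets-unique = allVectors-unique n subsets-unique

  module _ {n : ℕ} (G : Graph n) where

    isSubgraph? : ∀ U M → Dec (IsSubgraph G U M)
    isSubgraph? U M =
      Fin.all? (λ i → Fin.all? (λ j → (edge M i j Bool.≟ true) →-dec
        ((adj G i j Bool.≟ true) ×-dec ((lookup U i Bool.≟ true) ×-dec (lookup U j Bool.≟ true)))))
      ×-dec Fin.all? (λ i → Fin.all? (λ j → edge M i j Bool.≟ edge M j i))

    subgraphsOn : Subset n → List (EdgeSet n)
    subgraphsOn U = filter (isSubgraph? U) edgeSets

    ∈-subgraphsOn⁺ : ∀ U {M} → IsSubgraph G U M → M ∈ subgraphsOn U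
    ∈-subgraphsOn⁺ U {M} M⊆U = ∈-filter⁺ (isSubgraph? U) (∈-edgeSets M) M⊆U

    ∈-subgraphsOn⁻ : ∀ U {M} → M ∈ subgraphsOn U → IsSubgraph G U M
    ∈-subgraphsOn⁻ U M∈ = proj₂ (∈-filter⁻ (isSubgraph? U) {xs = edgeSets} M∈)

    subgraphsOn-unique : ∀ U → Unique (subgraphsOn U)
    subgraphsOn-unique U = Unique.filter⁺ (isSubgraph? U) edgeSets-unique

    IsSubgraph⇒EdgesWithin : ∀ {U M} → IsSubgraph G U M → EdgesWithin M U
    IsSubgraph⇒EdgesWithin (M⊆G , _) i j e = proj₂ (M⊆G i j e)

    restrict-IsSubgraph : ∀ {U M} B → IsSubgraph G U M → IsSubgraph G B (restrict M B)
    restrict-IsSubgraph {U} {M} B (M⊆G , M-sym) = within , restrict-sym {M = M} B M-sym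
      where
      within : ∀ i j → edge (restrict M B) i j ≡ true → (adj G i j ≡ true) × i ∈V B × j ∈V B
      within i j e with ∧≡true⁻ (edge M i j) (trans (sym (edge-fromRel _ i j)) e)
      ... | eM , e∈ = proj₁ (M⊆G i j eM) , ∧≡true⁻ (lookup B i) e∈

    -- Edge sets S on W correspond to triples (B, H, S') where B is the vertex set of the component of
    -- w₀ in S, H is S restricted to B (so (B, H) is connected and rooted at w₀), and S' is an edge set on W ─ B.
    module RootedDecomposition (W : Subset n) (w₀ : Fin n) where

      RootedConnected : Subset n × EdgeSet n → Set
      RootedConnected (B , H) = w₀ ∈V B × B ⊆V W × IsSubgraph G B H × Connected B H

      rootedAt? : ∀ B → Dec (w₀ ∈V B × B ⊆V W)
      rootedAt? B = (lookup B w₀ Bool.≟ true) ×-dec Fin.all? (λ i → (lookup B i Bool.≟ true) →-dec (lookup W i Bool.≟ true))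

      rootedConnected : List (Subset n × EdgeSet n)
      rootedConnected = productWith _,_ (filter rootedAt? subsets) (λ B → filter (connected? B) (subgraphsOn B))

      ∈-rootedConnected⁻ : ∀ {BH} → BH ∈ rootedConnected → RootedConnected BH
      ∈-rootedConnected⁻ BH∈ with ∈-productWith⁻ _,_ (filter rootedAt? subsets) (λ B → filter (connected? B) (subgraphsOn B)) BH∈
      ... | B , H , B∈ , H∈ , refl with ∈-filter⁻ rootedAt? {xs = subsets} B∈ | ∈-filter⁻ (connected? B) {xs = subgraphsOn B} H∈
      ... | _ , (w₀∈B , B⊆W) | H∈′ , H-connected = w₀∈B , B⊆W , ∈-subgraphsOn⁻ B H∈′ , H-connected

      ∈-rootedConnected⁺ : ∀ {BH} → RootedConnected BH → BH ∈ rootedConnected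
      ∈-rootedConnected⁺ {B , H} (w₀∈B , B⊆W , H⊆B , H-connected) =
        ∈-productWith⁺ _,_ (∈-filter⁺ rootedAt? (∈-subsets B) (w₀∈B , B⊆W))
                           (∈-filter⁺ (connected? B) (∈-subgraphsOn⁺ B H⊆B) H-connected)

      rootedConnected-unique : Unique rootedConnected
      rootedConnected-unique =
        Unique-productWith⁺ _,_ (Unique.filter⁺ rootedAt? subsets-unique)
          (λ {B} _ → Unique.filter⁺ (connected? B) (subgraphsOn-unique B)) (λ { _ _ _ _ refl → refl , refl })

      splittings : List ((Subset n × EdgeSet n) × EdgeSet n)
      splittings = productWith _,_ rootedConnected (λ (B , _) → subgraphsOn (W ─ B))

      ∈-splittings⁻ : ∀ {t} → t ∈ splittings → RootedConnected (proj₁ t) × IsSubgraph G (W ─ proj₁ (proj₁ t)) (proj₂ t)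
      ∈-splittings⁻ t∈ with ∈-productWith⁻ _,_ rootedConnected (λ (B , _) → subgraphsOn (W ─ B)) t∈
      ... | (B , H) , S' , BH∈ , S'∈ , refl = ∈-rootedConnected⁻ BH∈ , ∈-subgraphsOn⁻ (W ─ B) S'∈

      ∈-splittings⁺ : ∀ {B H S'} → RootedConnected (B , H) → IsSubgraph G (W ─ B) S' → ((B , H) , S') ∈ splittings
      ∈-splittings⁺ {B} BH S'⊆ = ∈-productWith⁺ _,_ (∈-rootedConnected⁺ BH) (∈-subgraphsOn⁺ (W ─ B) S'⊆)

      splittings-unique : Unique splittings
      splittings-unique =
        Unique-productWith⁺ _,_ rootedConnected-unique (λ {(B , _)} _ → subgraphsOn-unique (W ─ B)) (λ { _ _ _ _ refl → refl , refl })

      glue : (Subset n × EdgeSet n) × EdgeSet n → EdgeSet n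
      glue ((_ , H) , S') = H ∪ₑ S'

      module Glued {B H S'} (BH : RootedConnected (B , H)) (S'⊆ : IsSubgraph G (W ─ B) S') where
        private
          w₀∈B : w₀ ∈V B
          w₀∈B = proj₁ BH
          B⊆W : B ⊆V W
          B⊆W = proj₁ (proj₂ BH)
          H⊆B : IsSubgraph G B H
          H⊆B = proj₁ (proj₂ (proj₂ BH))
          H-connected : Connected B H
          H-connected = proj₂ (proj₂ (proj₂ BH))
          S'∩B=∅ : ∀ i j → edge S' i j ≡ true → lookup B i ≡ false
          S'∩B=∅ i j e = proj₂ (∈V-─⁻ W B i (proj₁ (IsSubgraph⇒EdgesWithin {W ─ B} {S'} S'⊆ i j e)))
          H∩[W─B]=∅ : ∀ i j → edge H i j ≡ true → lookup (W ─ B) i ≡ false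
          H∩[W─B]=∅ i j e = ∉V-─ W B i (proj₁ (IsSubgraph⇒EdgesWithin {B} {H} H⊆B i j e))

        glue-disjoint : ∀ i j → edge H i j ≡ true → edge S' i j ≡ false
        glue-disjoint i j e = ≢true⇒≡false (λ e′ → true≢false (proj₁ (IsSubgraph⇒EdgesWithin {B} {H} H⊆B i j e))
            (S'∩B=∅ i j e′))

        B-closed : Closed (H ∪ₑ S') B
        B-closed u v u∈ e with edge-∪ₑ⁻ H S' u v e
        ... | inj₁ eH = proj₂ (IsSubgraph⇒EdgesWithin {B} {H} H⊆B u v eH)
        ... | inj₂ eS = ⊥-elim (true≢false u∈ (S'∩B=∅ u v eS))

        component-glue : component (H ∪ₑ S') w₀ ≡ B
        component-glue = Vec-ext λ v → Bool-ext
          (component-least (H ∪ₑ S') {B} w₀ B-closed w₀∈B v)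
          (λ v∈ → Walk⇒component (H ∪ₑ S') w₀ v (Walk-mono (edge-∪ₑ⁺ˡ H S') (proj₂ H-connected w₀ v w₀∈B v∈)))

        restrict-glue-B : restrict (H ∪ₑ S') B ≡ H
        restrict-glue-B = restrict-∪ₑˡ {H = H} {S'} {B} (IsSubgraph⇒EdgesWithin {B} {H} H⊆B) S'∩B=∅

        restrict-glue-W─B : restrict (H ∪ₑ S') (W ─ B) ≡ S'
        restrict-glue-W─B = restrict-∪ₑʳ {H = H} {S'} {W ─ B} (IsSubgraph⇒EdgesWithin {W ─ B} {S'} S'⊆) H∩[W─B]=∅

        glue-IsSubgraph : IsSubgraph G W (H ∪ₑ S')
        glue-IsSubgraph = within , glue-sym
          where
          within : ∀ i j → edge (H ∪ₑ S') i j ≡ true → (adj G i j ≡ true) × i ∈V W × j ∈V W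
          within i j e with edge-∪ₑ⁻ H S' i j e
          ... | inj₁ eH = proj₁ (proj₁ H⊆B i j eH)
              , B⊆W i (proj₁ (proj₂ (proj₁ H⊆B i j eH))) , B⊆W j (proj₂ (proj₂ (proj₁ H⊆B i j eH)))
          ... | inj₂ eS = proj₁ (proj₁ S'⊆ i j eS)
              , ─-⊆ W B i (proj₁ (proj₂ (proj₁ S'⊆ i j eS))) , ─-⊆ W B j (proj₂ (proj₂ (proj₁ S'⊆ i j eS)))
          glue-sym : ∀ i j → edge (H ∪ₑ S') i j ≡ edge (H ∪ₑ S') j i
          glue-sym i j = trans (edge-fromRel _ i j) (trans (cong₂ _∨_ (proj₂ H⊆B i j) (proj₂ S'⊆ i j)) (sym (edge-fromRel _ j i)))

      glue-into : ∀ {t} → t ∈ splittings → glue t ∈ subgraphsOn W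
      glue-into {(B , H) , S'} t∈ = ∈-subgraphsOn⁺ W
        (Glued.glue-IsSubgraph {B} {H} {S'} (proj₁ (∈-splittings⁻ t∈)) (proj₂ (∈-splittings⁻ t∈)))

      glue-injective : InjectiveOn glue splittings
      glue-injective {(B , H) , S'} {(B' , H') , S''} t∈ t'∈ S≡ =
        cong₂ _,_ (cong₂ _,_ B≡ H≡) S'≡
        where
        module T  = Glued {B} {H} {S'} (proj₁ (∈-splittings⁻ t∈))  (proj₂ (∈-splittings⁻ t∈))
        module T' = Glued {B'} {H'} {S''} (proj₁ (∈-splittings⁻ t'∈)) (proj₂ (∈-splittings⁻ t'∈))
        B≡ = trans (sym T.component-glue) (trans (cong (λ S → component S w₀) S≡) T'.component-glue)
        H≡ = trans (sym T.restrict-glue-B) (trans (cong₂ restrict S≡ B≡) T'.restrict-glue-B)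
        S'≡ = trans (sym T.restrict-glue-W─B) (trans (cong₂ (λ S B → restrict S (W ─ B)) S≡ B≡) T'.restrict-glue-W─B)

      glue-onto : w₀ ∈V W → ∀ {S} → S ∈ subgraphsOn W → ∃ λ t → t ∈ splittings × glue t ≡ S
      glue-onto w₀∈W {S} S∈ = ((B , H) , S') , ∈-splittings⁺ (w₀∈B , B⊆W , H⊆B , H-connected) S'⊆ , H∪S'≡S
        where
        S⊆W : IsSubgraph G W S
        S⊆W = ∈-subgraphsOn⁻ W S∈
        B = component S w₀
        H = restrict S B
        S' = restrict S (W ─ B)
        w₀∈B : w₀ ∈V B
        w₀∈B = ∈-component S w₀
        B⊆W : B ⊆V W
        B⊆W = component-least S {W} w₀ (λ u v _ e → proj₂ (IsSubgraph⇒EdgesWithin {W} {S} S⊆W u v e)) w₀∈W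
        H⊆B : IsSubgraph G B H
        H⊆B = restrict-IsSubgraph {W} {S} B S⊆W
        S'⊆ : IsSubgraph G (W ─ B) S'
        S'⊆ = restrict-IsSubgraph {W} {S} (W ─ B) S⊆W
        walk-from-w₀ : ∀ v → v ∈V B → Walk H w₀ v
        walk-from-w₀ v v∈ = restrict-Walk {M = S} {B = B} (component-closed S w₀) w₀∈B (component⇒Walk S w₀ v v∈)
        H-connected : Connected B H
        H-connected = (w₀ , w₀∈B) , λ i j i∈ j∈ →
          Walk-++ (Walk-reverse (restrict-sym {M = S} B (proj₂ S⊆W)) (walk-from-w₀ i i∈)) (walk-from-w₀ j j∈)
        H∪S'≡S : H ∪ₑ S' ≡ S
        H∪S'≡S = restrict-∪ₑ-restrict-─ {S = S} {W} {B} (IsSubgraph⇒EdgesWithin {W} {S} S⊆W) λ i j e →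
          Bool-ext (λ i∈ → component-closed S w₀ i j i∈ e) (λ j∈ → component-closed S w₀ j i j∈ (trans (proj₂ S⊆W j i) e))

module EdgeCount where

  open import Data.Bool using (true; false; if_then_else_; _∨_; T)
  open import Data.Empty using (⊥-elim)
  open import Data.Fin using (Fin; toℕ)
  open import Data.List using ([]; _∷_; map; allFin)
  open import Data.List.Membership.Propositional using (_∈_)
  open import Data.List.Membership.Propositional.Properties using (∈-allFin)
  open import Data.List.Relation.Unary.Any using (here; there)
  import Data.List.Relation.Unary.All as All
  open import Data.List.Relation.Unary.AllPairs using (_∷_)
  open import Data.List.Relation.Unary.Unique.Propositional using (Unique)
  import Data.List.Relation.Unary.Unique.Propositional.Properties as Unique
  open import Data.Nat as ℕ using (ℕ; suc; _<_; _<ᵇ_)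
  import Data.Nat.Properties as ℕ
  open import Data.Product using (_×_; proj₁; proj₂)
  open import Data.Unit using (tt)
  open import Function using (_∘_)
  open import Relation.Nullary using (¬_)
  open import Relation.Binary.PropositionalEquality using (_≡_; _≢_; refl; sym; trans; cong; cong₂; subst)

  import Algebra.Properties.CommutativeSemigroup ℕ.+-commutativeSemigroup as ℕ+

  open import Defs hiding (sym)
  open Connectivity using (fromRel; edge-fromRel)
  open Subgraphs using (_∪ₑ_)

  module _ {A : Set} where

    sumℕ-map-+ : ∀ (f g : A → ℕ) xs → sumℕ (map (λ a → f a ℕ.+ g a) xs) ≡ sumℕ (map f xs) ℕ.+ sumℕ (map g xs)
    sumℕ-map-+ f g []       = refl
    sumℕ-map-+ f g (x ∷ xs) =
      trans (cong (f x ℕ.+ g x ℕ.+_) (sumℕ-map-+ f g xs)) (ℕ+.interchange (f x) (g x) _ _)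

    sumℕ-cong-∈ : ∀ {f g : A → ℕ} xs → (∀ {x} → x ∈ xs → f x ≡ g x) → sumℕ (map f xs) ≡ sumℕ (map g xs)
    sumℕ-cong-∈ []       f≡g = refl
    sumℕ-cong-∈ (x ∷ xs) f≡g = cong₂ ℕ._+_ (f≡g (here refl)) (sumℕ-cong-∈ xs (f≡g ∘ there))

    sumℕ-zero : ∀ (f : A → ℕ) xs → (∀ x → f x ≡ 0) → sumℕ (map f xs) ≡ 0
    sumℕ-zero f []       f≡0 = refl
    sumℕ-zero f (x ∷ xs) f≡0 = cong₂ ℕ._+_ (f≡0 x) (sumℕ-zero f xs f≡0)

    sumℕ-bump : ∀ (f f' : A → ℕ) xs {a} → Unique xs → a ∈ xs →
      (∀ {x} → x ∈ xs → x ≢ a → f' x ≡ f x) → f' a ≡ suc (f a) → sumℕ (map f' xs) ≡ suc (sumℕ (map f xs))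
    sumℕ-bump f f' (x ∷ xs) (x∉ ∷ u) (here refl) same bumped =
      cong₂ ℕ._+_ bumped (sumℕ-cong-∈ xs (λ y∈ → same (there y∈) (λ y≡x → All.lookup x∉ y∈ (sym y≡x))))
    sumℕ-bump f f' (x ∷ xs) (x∉ ∷ u) (there a∈) same bumped =
      trans (cong₂ ℕ._+_ (same (here refl) (All.lookup x∉ a∈)) (sumℕ-bump f f' xs u a∈ (same ∘ there) bumped))
            (ℕ.+-suc (f x) _)

  module _ {n : ℕ} where

    edgeIndicator : EdgeSet n → Fin n → Fin n → ℕ
    edgeIndicator M i j = if toℕ i <ᵇ toℕ j then (if edge M i j then 1 else 0) else 0

    edgesFrom : EdgeSet n → Fin n → ℕ
    edgesFrom M i = sumℕ (map (edgeIndicator M i) (allFin n))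

    numEdges-∪ₑ : ∀ H S → (∀ i j → edge H i j ≡ true → edge S i j ≡ false) →
      numEdges (H ∪ₑ S) ≡ numEdges H ℕ.+ numEdges S
    numEdges-∪ₑ H S disjoint =
      trans (sumℕ-cong-∈ (allFin n) (λ {i} _ →
               trans (sumℕ-cong-∈ (allFin n) (λ {j} _ → indicator-∪ i j (disjoint i j)))
                     (sumℕ-map-+ (edgeIndicator H i) (edgeIndicator S i) (allFin n))))
            (sumℕ-map-+ (edgesFrom H) (edgesFrom S) (allFin n))
      where
      indicator-∪ : ∀ i j → (edge H i j ≡ true → edge S i j ≡ false) →
        edgeIndicator (H ∪ₑ S) i j ≡ edgeIndicator H i j ℕ.+ edgeIndicator S i j
      indicator-∪ i j disj rewrite edge-fromRel (λ i j → edge H i j ∨ edge S i j) i j with toℕ i <ᵇ toℕ j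
      ... | false = refl
      ... | true with edge H i j | edge S i j | disj
      ...   | true  | true  | d with () ← d refl
      ...   | true  | false | _ = refl
      ...   | false | true  | _ = refl
      ...   | false | false | _ = refl

    emptyEdges : EdgeSet n
    emptyEdges = fromRel (λ _ _ → false)

    numEdges-empty : numEdges emptyEdges ≡ 0
    numEdges-empty = sumℕ-zero _ (allFin n) (λ i → sumℕ-zero _ (allFin n) (λ j → indicator-empty i j))
      where
      indicator-empty : ∀ i j → edgeIndicator emptyEdges i j ≡ 0
      indicator-empty i j rewrite edge-fromRel (λ _ _ → false) i j with toℕ i <ᵇ toℕ j
      ... | true  = refl
      ... | false = refl

    numEdges-insert : ∀ (M M' : EdgeSet n) a b → toℕ a < toℕ b → edge M a b ≡ false → edge M' a b ≡ true →
      (∀ i j → toℕ i < toℕ j → ¬ (i ≡ a × j ≡ b) → edge M' i j ≡ edge M i j) →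
      numEdges M' ≡ suc (numEdges M)
    numEdges-insert M M' a b a<b ab∉M ab∈M' same =
      sumℕ-bump (edgesFrom M) (edgesFrom M') (allFin n) (Unique.allFin⁺ n) (∈-allFin a)
        (λ {i} _ i≢a → sumℕ-cong-∈ (allFin n) (λ {j} _ → unchanged i j (i≢a ∘ proj₁)))
        (sumℕ-bump (edgeIndicator M a) (edgeIndicator M' a) (allFin n) (Unique.allFin⁺ n) (∈-allFin b)
          (λ {j} _ j≢b → unchanged a j (j≢b ∘ proj₂)) changed)
      where
      unchanged : ∀ i j → ¬ (i ≡ a × j ≡ b) → edgeIndicator M' i j ≡ edgeIndicator M i j
      unchanged i j ≢ab with toℕ i <ᵇ toℕ j in i<ᵇj
      ... | false = refl
      ... | true rewrite same i j (ℕ.<ᵇ⇒< (toℕ i) (toℕ j) (subst T (sym i<ᵇj) tt)) ≢ab = refl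
      changed : edgeIndicator M' a b ≡ suc (edgeIndicator M a b)
      changed with toℕ a <ᵇ toℕ b in a<ᵇb
      ... | true  rewrite ab∉M | ab∈M' = refl
      ... | false = ⊥-elim (subst T a<ᵇb (ℕ.<⇒<ᵇ a<b))

module SubgraphTriples where

  open import Data.Bool using (Bool; true; false; if_then_else_)
  open import Data.Empty using (⊥-elim)
  open import Data.Fin using (Fin; zero; suc; toℕ)
  import Data.Fin.Properties as Fin
  open import Data.Fin.Subset using (Subset; ∣_∣; _─_; ⊤)
  import Data.Fin.Subset.Properties as Subset
  open import Data.List using (List; []; _∷_; map; concatMap; applyUpTo)
  open import Data.List.Membership.Propositional using (_∈_)
  open import Data.List.Membership.Propositional.Properties using (∈-applyUpTo⁺; ∈-applyUpTo⁻; ∈-map⁺)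
  open import Data.List.Relation.Unary.Any using (here; there)
  open import Data.List.Relation.Unary.All using (All; []; _∷_)
  import Data.List.Relation.Unary.All as All
  import Data.List.Relation.Unary.AllPairs as AllPairs
  open import Data.List.Relation.Unary.Linked using (Linked; []; [-]; _∷_)
  import Data.List.Relation.Unary.Linked as Linked
  import Data.List.Relation.Unary.Linked.Properties as Linked
  open import Data.List.Relation.Unary.Unique.Propositional using (Unique)
  import Data.List.Relation.Unary.Unique.Propositional.Properties as Unique
  open import Data.Maybe using (Maybe; just; nothing)
  import Data.Maybe as Maybe
  open import Data.Nat as ℕ using (ℕ; zero; suc; _≤_; _<_; z≤n; s≤s)
  import Data.Nat.Properties as ℕ
  open import Data.Product using (∃; _×_; _,_; proj₁; proj₂)
  open import Data.Vec using ([]; _∷_; lookup)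
  open import Data.Vec.Properties using (lookup-replicate)
  open import Function using (_∘_; _⇔_; mk⇔; Equivalence)
  open import Relation.Binary.PropositionalEquality using (_≡_; _≢_; refl; sym; trans; cong; subst)

  open import Defs hiding (sym)
  open ListEnumeration
  open Compositions
  open Connectivity
  open Subgraphs

  oneTo : ℕ → List ℕ
  oneTo = applyUpTo suc

  triplesOn : ∀ {n} → Subset n → EdgeSet n → List (RawTriple n)
  triplesOn B H = productWith (triple B H) (compositions ∣ B ∣) (oneTo ∘ firstPart)

  ∈-oneTo⁻ : ∀ a {r} → r ∈ oneTo a → 1 ≤ r × r ≤ a
  ∈-oneTo⁻ a r∈ with ∈-applyUpTo⁻ suc r∈
  ... | i , i<a , refl = s≤s z≤n , i<a

  ∈-oneTo⁺ : ∀ a {r} → 1 ≤ r → r ≤ a → r ∈ oneTo a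
  ∈-oneTo⁺ a {suc r} _ r<a = ∈-applyUpTo⁺ suc r<a

  oneTo-unique : ∀ a → Unique (oneTo a)
  oneTo-unique a = Unique.applyUpTo⁺₁ suc a (λ i<j _ eq → ℕ.<-irrefl (ℕ.suc-injective eq) i<j)

  ∈-triplesOn⁻ : ∀ {n} {B : Subset n} {H t} → t ∈ triplesOn B H →
    verts t ≡ B × edges t ≡ H × IsComposition (comp t) ∣ B ∣ × 1 ≤ r t × r t ≤ firstPart (comp t)
  ∈-triplesOn⁻ {B = B} {H} t∈ with ∈-productWith⁻ (triple B H) (compositions ∣ B ∣) (oneTo ∘ firstPart) t∈
  ... | α , r , α∈ , r∈ , refl = refl , refl , ∈-compositions⁻ ∣ B ∣ α∈ , ∈-oneTo⁻ (firstPart α) r∈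

  ∈-triplesOn⁺ : ∀ {n} {t : RawTriple n} → IsComposition (comp t) ∣ verts t ∣ → 1 ≤ r t → r t ≤ firstPart (comp t) →
    t ∈ triplesOn (verts t) (edges t)
  ∈-triplesOn⁺ {t = t} α⊨ 1≤r r≤α₁ =
    ∈-productWith⁺ (triple (verts t) (edges t)) (∈-compositions⁺ _ α⊨) (∈-oneTo⁺ (firstPart (comp t)) 1≤r r≤α₁)

  triplesOn-unique : ∀ {n} (B : Subset n) H → Unique (triplesOn B H)
  triplesOn-unique B H =
    Unique-productWith⁺ (triple B H) (compositions-unique ∣ B ∣) (λ {α} _ → oneTo-unique (firstPart α))
      (λ { _ _ _ _ refl → refl , refl })

  least : ∀ {m} → Subset m → Maybe (Fin m)
  least []          = nothing
  least (true  ∷ W) = just zero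
  least (false ∷ W) = Maybe.map suc (least W)

  least-nothing : ∀ {m} (W : Subset m) → least W ≡ nothing → ∀ i → lookup W i ≡ false
  least-nothing (false ∷ W) eq zero    = refl
  least-nothing (false ∷ W) eq (suc i) with least W in eq′
  ... | nothing = least-nothing W eq′ i

  least-just : ∀ {m} (W : Subset m) {w} → least W ≡ just w → w ∈V W × (∀ i → i ∈V W → toℕ w ≤ toℕ i)
  least-just (true  ∷ W) refl = refl , λ _ _ → z≤n
  least-just (false ∷ W) eq with least W in eq′
  least-just (false ∷ W) refl | just w with least-just W eq′
  ... | w∈W , w-least = w∈W , λ { (suc i) i∈ → s≤s (w-least i i∈) }

  minV-≤ : ∀ {m} (B : Subset m) i → i ∈V B → minV B ≤ toℕ i
  minV-≤ (true  ∷ B) i       _  = z≤n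
  minV-≤ (false ∷ B) (suc i) i∈ = s≤s (minV-≤ B i i∈)

  minV-∈ : ∀ {m} (B : Subset m) i → i ∈V B → ∃ λ u → u ∈V B × minV B ≡ toℕ u
  minV-∈ (true  ∷ B) i       _  = zero , refl , refl
  minV-∈ (false ∷ B) (suc i) i∈ with minV-∈ B i i∈
  ... | u , u∈ , minV≡u = suc u , u∈ , cong suc minV≡u

  bit : Bool → ℕ
  bit b = if b then 1 else 0

  bit-pos : ∀ b → 1 ≤ bit b → b ≡ true
  bit-pos true _ = refl

  bit≡0 : ∀ b → bit b ≡ 0 → b ≡ false
  bit≡0 false _ = refl

  occ-∷ : ∀ {n} v (t : RawTriple n) S → occ v (t ∷ S) ≡ bit (lookup (verts t) v) ℕ.+ occ v S
  occ-∷ v t S with lookup (verts t) v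
  ... | true  = refl
  ... | false = refl

  occ-pos : ∀ {n} v (S : List (RawTriple n)) → 1 ≤ occ v S → ∃ λ t → t ∈ S × v ∈V verts t
  occ-pos v (t ∷ S) 1≤occ with lookup (verts t) v in v∈?
  ... | true  = t , here refl , v∈?
  ... | false with occ-pos v S 1≤occ
  ...   | t' , t'∈ , v∈ = t' , there t'∈ , v∈

  bit-─ : ∀ {n} (W B : Subset n) v → B ⊆V W → bit (lookup B v) ℕ.+ bit (lookup (W ─ B) v) ≡ bit (lookup W v)
  bit-─ W B v B⊆W with lookup B v in v∈B?
  ... | true  = trans (cong (λ b → 1 ℕ.+ bit b) (∉V-─ W B v v∈B?)) (cong bit (sym (B⊆W v v∈B?)))
  ... | false = cong bit (lookup-─-∉ W B v v∈B?)

  blockMinima : ∀ {n} → List (RawTriple n) → List ℕ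
  blockMinima = map (minV ∘ verts)

  module _ {n : ℕ} (G : Graph n) where

    IsSTOn : Subset n → List (RawTriple n) → Set
    IsSTOn W S = All (IsConnTriple G) S × (∀ v → occ v S ≡ bit (lookup W v)) × Linked _<_ (blockMinima S)

    rootedTriples : Subset n → Fin n → List (RawTriple n)
    rootedTriples W w₀ = concatMap (λ (B , H) → triplesOn B H) (RootedDecomposition.rootedConnected G W w₀)

    -- Listed by recursion on the block containing the least vertex w₀ of W; k is fuel (∣ W ∣ ≤ k).
    subgraphTriples : ℕ → Subset n → List (List (RawTriple n))
    subgraphTriplesFrom : ℕ → Subset n → Maybe (Fin n) → List (List (RawTriple n))
    subgraphTriples zero    W = [] ∷ []
    subgraphTriples (suc k) W = subgraphTriplesFrom k W (least W)
    subgraphTriplesFrom k W nothing   = [] ∷ []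
    subgraphTriplesFrom k W (just w₀) = productWith _∷_ (rootedTriples W w₀) (λ t → subgraphTriples k (W ─ verts t))

    module _ (W : Subset n) (w₀ : Fin n) where
      open RootedDecomposition G W w₀

      ∈-rootedTriples⁻ : ∀ {t} → t ∈ rootedTriples W w₀ → IsConnTriple G t × w₀ ∈V verts t × verts t ⊆V W
      ∈-rootedTriples⁻ t∈ with ∈-concatMap⁻′ rootedConnected t∈
      ... | (B , H) , BH∈ , t∈′ with ∈-rootedConnected⁻ BH∈ | ∈-triplesOn⁻ {B = B} {H} t∈′
      ... | w₀∈B , B⊆W , H⊆B , H-connected | refl , refl , α⊨ , 1≤r , r≤α₁ =
        (H⊆B , H-connected , α⊨ , 1≤r , r≤α₁) , w₀∈B , B⊆W

      ∈-rootedTriples⁺ : ∀ {t} → IsConnTriple G t → w₀ ∈V verts t → verts t ⊆V W → t ∈ rootedTriples W w₀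
      ∈-rootedTriples⁺ {t} (H⊆B , H-connected , α⊨ , 1≤r , r≤α₁) w₀∈B B⊆W =
        ∈-concatMap⁺′ {a = verts t , edges t} (∈-rootedConnected⁺ (w₀∈B , B⊆W , H⊆B , H-connected))
          (∈-triplesOn⁺ {t = t} α⊨ 1≤r r≤α₁)

      rootedTriples-unique : Unique (rootedTriples W w₀)
      rootedTriples-unique = Unique-concatMap⁺ rootedConnected-unique (λ {(B , H)} _ → triplesOn-unique B H) disjoint
        where
        disjoint : ∀ {BH BH' t} → BH ∈ rootedConnected → BH' ∈ rootedConnected →
          t ∈ triplesOn (proj₁ BH) (proj₂ BH) → t ∈ triplesOn (proj₁ BH') (proj₂ BH') → BH ≡ BH'
        disjoint {B , H} {B' , H'} _ _ t∈ t∈′ with ∈-triplesOn⁻ {B = B} {H} t∈ | ∈-triplesOn⁻ {B = B'} {H'} t∈′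
        ... | refl , refl , _ | refl , refl , _ = refl

    ∣─∣< : ∀ (W B : Subset n) {w₀} → w₀ ∈V W → w₀ ∈V B → ∣ W ─ B ∣ < ∣ W ∣
    ∣─∣< W B w₀∈W w₀∈B = ⊂⇒∣∣< (W ─ B) W (─-⊆ W B) λ W─B≡W →
      true≢false w₀∈W (trans (cong (λ V → lookup V _) (sym W─B≡W)) (∉V-─ W B _ w₀∈B))

    block-nonempty : ∀ t → IsConnTriple G t → ∃ λ u → u ∈V verts t
    block-nonempty t (_ , (nonempty , _) , _) = nonempty

    IsSTOn-∅ : ∀ W → (∀ i → lookup W i ≡ false) → ∀ {S} → IsSTOn W S → S ≡ []
    IsSTOn-∅ W W≡∅ {[]}    _                     = refl
    IsSTOn-∅ W W≡∅ {t ∷ S} (t-conn ∷ _ , occ≡ , _) with block-nonempty t t-conn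
    ... | u , u∈ = ⊥-elim (ℕ.<⇒≱ (subst (1 ≤_) (trans (sym (occ-∷ u t S)) (occ≡ u)) 1≤)
        (ℕ.≤-reflexive (cong bit (W≡∅ u))))
      where 1≤ = subst (λ b → 1 ≤ bit b ℕ.+ occ u S) (sym u∈) (s≤s z≤n)

    occ-∈ : ∀ {v t} {S : List (RawTriple n)} → t ∈ S → v ∈V verts t → 1 ≤ occ v S
    occ-∈ {v} {S = t ∷ S} (here refl) v∈ = subst (1 ≤_) (sym (occ-∷ v t S))
      (subst (λ b → 1 ≤ bit b ℕ.+ occ v S) (sym v∈) (s≤s z≤n))
    occ-∈ {v} {S = t ∷ S} (there t∈) v∈ = subst (1 ≤_) (sym (occ-∷ v t S)) (ℕ.≤-trans (occ-∈ t∈ v∈) (ℕ.m≤n+m _ _))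

    block⊆ : ∀ W {S t} → IsSTOn W S → t ∈ S → verts t ⊆V W
    block⊆ W (_ , occ≡ , _) t∈ v v∈ = bit-pos _ (subst (1 ≤_) (occ≡ v) (occ-∈ t∈ v∈))

    blocks-above : ∀ W B {w₀} → w₀ ∈V B → (∀ i → i ∈V W → toℕ w₀ ≤ toℕ i) →
      ∀ {S} → IsSTOn (W ─ B) S → ∀ {t} → t ∈ S → toℕ w₀ < minV (verts t)
    blocks-above W B {w₀} w₀∈B w₀-least S-st@(S-conn , _ , _) {t} t∈ with block-nonempty t (All.lookup S-conn t∈)
    ... | u₀ , u₀∈ with minV-∈ (verts t) u₀ u₀∈
    ... | u , u∈ , minV≡u = subst (toℕ w₀ <_) (sym minV≡u) (ℕ.≤∧≢⇒< (w₀-least u u∈W) w₀≢u)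
      where
      u∈W─B = block⊆ (W ─ B) S-st t∈ u u∈
      u∈W = proj₁ (∈V-─⁻ W B u u∈W─B)
      w₀≢u : toℕ w₀ ≢ toℕ u
      w₀≢u eq = true≢false w₀∈B (subst (λ z → lookup B z ≡ false) (sym (Fin.toℕ-injective eq))
          (proj₂ (∈V-─⁻ W B u u∈W─B)))

    IsSTOn-∷ : ∀ W {t S w₀} → IsConnTriple G t → w₀ ∈V verts t → verts t ⊆V W →
      (∀ i → i ∈V W → toℕ w₀ ≤ toℕ i) → IsSTOn (W ─ verts t) S → IsSTOn W (t ∷ S)
    IsSTOn-∷ W {t} {S} t-conn w₀∈B B⊆W w₀-least S-st@(S-conn , occ≡ , linked) =
      t-conn ∷ S-conn ,
      (λ v → trans (occ-∷ v t S) (trans (cong (bit (lookup (verts t) v) ℕ.+_) (occ≡ v)) (bit-─ W (verts t) v B⊆W))) ,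
      head-linked S (λ t∈ → blocks-above W (verts t) w₀∈B w₀-least S-st t∈) linked
      where
      head-linked : ∀ S′ → (∀ {t'} → t' ∈ S′ → toℕ _ < minV (verts t')) →
          Linked _<_ (blockMinima S′) → Linked _<_ (blockMinima (t ∷ S′))
      head-linked []        _     _      = [-]
      head-linked (t' ∷ S′) above linked′ = ℕ.≤-<-trans (minV-≤ (verts t) _ w₀∈B) (above (here refl)) ∷ linked′

    head-block-least : ∀ {t : RawTriple n} {S} → Linked _<_ (blockMinima (t ∷ S)) →
      ∀ {t'} → t' ∈ S → minV (verts t) < minV (verts t')
    head-block-least linked t'∈ = All.lookup (AllPairs.head (Linked.Linked⇒AllPairs ℕ.<-trans linked)) (∈-map⁺ (minV ∘ verts) t'∈)

    least≤minV : ∀ (W : Subset n) t {w₀ : Fin n} → IsConnTriple G t → verts t ⊆V W →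
      (∀ i → i ∈V W → toℕ w₀ ≤ toℕ i) → toℕ w₀ ≤ minV (verts t)
    least≤minV W t {w₀} t-conn B⊆W w₀-least with block-nonempty t t-conn
    ... | u₀ , u₀∈ with minV-∈ (verts t) u₀ u₀∈
    ... | u , u∈ , minV≡u = subst (toℕ w₀ ≤_) (sym minV≡u) (w₀-least u (B⊆W u u∈))

    occ-∷-∉ : ∀ {v} (t : RawTriple n) S → lookup (verts t) v ≡ false → occ v (t ∷ S) ≡ occ v S
    occ-∷-∉ {v} t S v∉ = trans (occ-∷ v t S) (cong (λ b → bit b ℕ.+ occ v S) v∉)

    -- The least vertex of W lies in the first block, since the blocks are ordered by their least vertices.
    root∈head : ∀ W (t : RawTriple n) S {w₀} → w₀ ∈V W → (∀ i → i ∈V W → toℕ w₀ ≤ toℕ i) →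
      IsSTOn W (t ∷ S) → w₀ ∈V verts t
    root∈head W t S {w₀} w₀∈W w₀-least tS-st@(t-conn ∷ _ , occ≡ , linked) with lookup (verts t) w₀ in w₀∈B?
    ... | true  = refl
    ... | false with occ-pos w₀ S (ℕ.≤-reflexive (sym (trans (sym (occ-∷-∉ {w₀} t S w₀∈B?)) (trans (occ≡ w₀) (cong bit w₀∈W)))))
    ...   | t' , t'∈ , w₀∈B' = ⊥-elim (ℕ.<-irrefl refl
            (ℕ.≤-<-trans (least≤minV W t t-conn (block⊆ W tS-st (here refl)) w₀-least)
              (ℕ.<-≤-trans (head-block-least {t} {S} linked t'∈) (minV-≤ (verts t') w₀ w₀∈B'))))

    IsSTOn-∷⁻ : ∀ W (t : RawTriple n) S → IsSTOn W (t ∷ S) → IsSTOn (W ─ verts t) S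
    IsSTOn-∷⁻ W t S tS-st@(_ ∷ S-conn , occ≡ , linked) = S-conn , occ-rest , Linked.tail linked
      where
      B⊆W = block⊆ W tS-st (here refl)
      occ-rest : ∀ v → occ v S ≡ bit (lookup (W ─ verts t) v)
      occ-rest v = ℕ.+-cancelˡ-≡ (bit (lookup (verts t) v)) _ _
        (trans (sym (occ-∷ v t S)) (trans (occ≡ v) (sym (bit-─ W (verts t) v B⊆W))))

    ∣─∣≤ : ∀ k W {t w₀} → ∣ W ∣ ≤ suc k → w₀ ∈V W → w₀ ∈V verts t → ∣ W ─ verts t ∣ ≤ k
    ∣─∣≤ k W {t} le w₀∈W w₀∈B = ℕ.≤-pred (ℕ.<-≤-trans (∣─∣< W (verts t) w₀∈W w₀∈B) le)

    ∣∣≤0 : ∀ (W : Subset n) → ∣ W ∣ ≤ 0 → ∀ i → lookup W i ≡ false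
    ∣∣≤0 W le i = ≢true⇒≡false (λ i∈ → ℕ.<⇒≱ (∈V⇒∣∣-pos {A = W} i i∈) le)

    IsSTOn-[] : ∀ W → (∀ i → lookup W i ≡ false) → IsSTOn W []
    IsSTOn-[] W W≡∅ = [] , (λ v → cong bit (sym (W≡∅ v))) , []

    ∈-subgraphTriples⁻ : ∀ k W {S} → ∣ W ∣ ≤ k → S ∈ subgraphTriples k W → IsSTOn W S
    ∈-subgraphTriples⁻ zero    W le (here refl) = IsSTOn-[] W (∣∣≤0 W le)
    ∈-subgraphTriples⁻ (suc k) W {S} le S∈ = from (least W) refl S∈
      where
      from : ∀ m → least W ≡ m → S ∈ subgraphTriplesFrom k W m → IsSTOn W S
      from nothing  least≡ (here refl) = IsSTOn-[] W (least-nothing W least≡)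
      from (just w₀) least≡ S∈′ with ∈-productWith⁻ _∷_ (rootedTriples W w₀) (λ t → subgraphTriples k (W ─ verts t)) S∈′
      ... | t , S' , t∈ , S'∈ , refl =
        IsSTOn-∷ W {t} {S'} {w₀} t-conn w₀∈B B⊆W w₀-least
          (∈-subgraphTriples⁻ k (W ─ verts t) (∣─∣≤ k W {t} le w₀∈W w₀∈B) S'∈)
        where
        t-conn = proj₁ (∈-rootedTriples⁻ W w₀ {t} t∈)
        w₀∈B = proj₁ (proj₂ (∈-rootedTriples⁻ W w₀ {t} t∈))
        B⊆W = proj₂ (proj₂ (∈-rootedTriples⁻ W w₀ {t} t∈))
        w₀∈W = proj₁ (least-just W least≡)
        w₀-least = proj₂ (least-just W least≡)

    ∈-subgraphTriples⁺ : ∀ k W {S} → ∣ W ∣ ≤ k → IsSTOn W S → S ∈ subgraphTriples k W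
    ∈-subgraphTriples⁺ zero W le S-st with refl ← IsSTOn-∅ W (∣∣≤0 W le) S-st = here refl
    ∈-subgraphTriples⁺ (suc k) W {S} le S-st = to (least W) refl S S-st
      where
      to : ∀ m → least W ≡ m → ∀ S → IsSTOn W S → S ∈ subgraphTriplesFrom k W m
      to nothing least≡ S S-st with refl ← IsSTOn-∅ W (least-nothing W least≡) S-st = here refl
      to (just w₀) least≡ [] (_ , occ≡ , _) =
        ⊥-elim (true≢false (proj₁ (least-just W least≡)) (bit≡0 (lookup W w₀) (sym (occ≡ w₀))))
      to (just w₀) least≡ (t ∷ S') tS-st@(t-conn ∷ _ , _ , _) =
        ∈-productWith⁺ _∷_ (∈-rootedTriples⁺ W w₀ {t} t-conn w₀∈B (block⊆ W tS-st (here refl)))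
          (∈-subgraphTriples⁺ k (W ─ verts t) (∣─∣≤ k W {t} le w₀∈W w₀∈B) (IsSTOn-∷⁻ W t S' tS-st))
        where
        w₀∈W = proj₁ (least-just W least≡)
        w₀∈B = root∈head W t S' w₀∈W (proj₂ (least-just W least≡)) tS-st

    subgraphTriples-unique : ∀ k W → Unique (subgraphTriples k W)
    subgraphTriples-unique zero    W = All.[] AllPairs.∷ AllPairs.[]
    subgraphTriples-unique (suc k) W = unique (least W)
      where
      unique : ∀ m → Unique (subgraphTriplesFrom k W m)
      unique nothing   = All.[] AllPairs.∷ AllPairs.[]
      unique (just w₀) = Unique-productWith⁺ _∷_ (rootedTriples-unique W w₀) (λ {t} _ → subgraphTriples-unique k (W ─ verts t))
                           (λ { _ _ _ _ refl → refl , refl })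

    IsSTOn-⊤⇔IsST : ∀ S → IsSTOn ⊤ S ⇔ IsST G S
    IsSTOn-⊤⇔IsST S = mk⇔
      (λ (S-conn , occ≡ , linked) → S-conn , (λ v → trans (occ≡ v) (cong bit (lookup-replicate v true))) , linked)
      (λ (S-conn , occ≡ , linked) → S-conn , (λ v → trans (occ≡ v) (cong bit (sym (lookup-replicate v true)))) , linked)

    ∈-subgraphTriples⇔IsST : ∀ S → S ∈ subgraphTriples n ⊤ ⇔ IsST G S
    ∈-subgraphTriples⇔IsST S = mk⇔
      (Equivalence.to (IsSTOn-⊤⇔IsST S) ∘ ∈-subgraphTriples⁻ n ⊤ (Subset.∣p∣≤n ⊤))
      (∈-subgraphTriples⁺ n ⊤ (Subset.∣p∣≤n ⊤) ∘ Equivalence.from (IsSTOn-⊤⇔IsST S))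

module TripleWeights {c ℓ} (R : CommutativeRing c ℓ) where

  open import Data.Fin using (Fin)
  open import Data.Fin.Subset using (Subset; ∣_∣)
  open import Data.Integer as ℤ using (ℤ; +_; -[1+_]; _⊖_)
  import Data.Integer.Properties as ℤ
  open import Data.List using (List; []; _∷_; _++_; concatMap; length)
  open import Data.List.Properties using (length-applyUpTo)
  open import Data.List.Relation.Binary.Permutation.Propositional using (_↭_)
  import Data.List.Relation.Binary.Permutation.Propositional.Properties as ↭
  open import Data.List.Sort using (sort-↭)
  open import Data.Nat as ℕ using (ℕ; zero; suc; z≤n; s≤s)
  import Data.Nat.Properties as ℕ
  open import Relation.Binary.Properties.DecTotalOrder ℕ.≤-decTotalOrder using (≥-decTotalOrder)
  import Relation.Binary.PropositionalEquality as ≡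

  open import Defs hiding (sym)
  open Compositions
  open SubgraphTriples using (oneTo; triplesOn)
  open RingSums R
  open PowerSums R

  open CommutativeRing R hiding (zero)
  open import Algebra.Properties.Ring ring using (-‿distribˡ-*; -‿distribʳ-*; -‿involutive)
  open import Algebra.Properties.CommutativeSemigroup *-commutativeSemigroup using (interchange)
  open import Algebra.Properties.Semiring.Mult semiring using (×-congʳ; ×-comm-*) renaming (_×_ to _×ₙ_)
  open import Relation.Binary.Reasoning.Setoid setoid

  -1^ℤ_ : ℤ → Carrier
  -1^ℤ (+ n)     = -1^ n
  -1^ℤ -[1+ n ]  = -1^ suc n

  -1^∣∣≡-1^ℤ : ∀ z → negOnePow R ℤ.∣ z ∣ ≡.≡ -1^ℤ z
  -1^∣∣≡-1^ℤ (+ n)    = ≡.refl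
  -1^∣∣≡-1^ℤ -[1+ n ] = ≡.refl

  -a*-b≈a*b : ∀ a b → (- a) * (- b) ≈ a * b
  -a*-b≈a*b a b = trans (sym (-‿distribˡ-* a (- b))) (trans (-‿cong (sym (-‿distribʳ-* a b))) (-‿involutive _))

  -1^ℤ-⊖ : ∀ m n → -1^ℤ (m ⊖ n) ≈ -1^ m * -1^ n
  -1^ℤ-⊖ m       zero    = trans (reflexive (≡.cong -1^ℤ_ (ℤ.⊖-≥ {m} {0} z≤n))) (sym (*-identityʳ _))
  -1^ℤ-⊖ zero    (suc n) = trans (reflexive (≡.cong -1^ℤ_ (ℤ.⊖-< {0} {suc n} (s≤s z≤n)))) (sym (*-identityˡ _))
  -1^ℤ-⊖ (suc m) (suc n) =
    trans (reflexive (≡.cong -1^ℤ_ (ℤ.[1+m]⊖[1+n]≡m⊖n m n))) (trans (-1^ℤ-⊖ m n) (sym (-a*-b≈a*b _ _)))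

  -1^ℤ-+ : ∀ a b → -1^ℤ (a ℤ.+ b) ≈ -1^ℤ a * -1^ℤ b
  -1^ℤ-+ (+ m)     (+ n)     = -1^-+ m n
  -1^ℤ-+ (+ m)     -[1+ n ]  = -1^ℤ-⊖ m (suc n)
  -1^ℤ-+ -[1+ m ]  (+ n)     = trans (-1^ℤ-⊖ n (suc m)) (*-comm _ _)
  -1^ℤ-+ -[1+ m ]  -[1+ n ]  =
    trans (-‿involutive _) (trans (-1^-+ m n) (sym (-a*-b≈a*b _ _)))

  -1^ℤ-neg : ∀ a → -1^ℤ (ℤ.- a) ≈ -1^ℤ a
  -1^ℤ-neg (+ zero)  = refl
  -1^ℤ-neg (+ suc n) = refl
  -1^ℤ-neg -[1+ n ]  = refl

  -1^ℤ-sub : ∀ a b → -1^ℤ (a ℤ.- b) ≈ -1^ℤ a * -1^ℤ b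
  -1^ℤ-sub a b = trans (-1^ℤ-+ a (ℤ.- b)) (*-congˡ (-1^ℤ-neg b))

  tripleSignExp : ∀ {n} → RawTriple n → ℤ
  tripleSignExp t =
    ((+ length (comp t)) ℤ.- (+ 1)) ℤ.+ (+ numEdges (edges t)) ℤ.- (+ ∣ verts t ∣) ℤ.+ (+ 1)

  -1^ℤ-tripleSignExp : ∀ {n} (t : RawTriple n) →
    -1^ℤ (tripleSignExp t) ≈ -1^ numEdges (edges t) * -1^ (length (comp t) ℕ.+ ∣ verts t ∣)
  -1^ℤ-tripleSignExp t = begin
    -1^ℤ (((+ l) ℤ.- (+ 1)) ℤ.+ (+ h) ℤ.- (+ v) ℤ.+ (+ 1))
      ≡⟨ ≡.cong -1^ℤ_ (solve 3 (λ l h v → ((l :- con (+ 1)) :+ h :- v) :+ con (+ 1) := h :+ l :- v) ≡.refl (+ l) (+ h) (+ v)) ⟩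
    -1^ℤ ((+ (h ℕ.+ l)) ℤ.- (+ v))
      ≈⟨ -1^ℤ-sub (+ (h ℕ.+ l)) (+ v) ⟩
    -1^ (h ℕ.+ l) * -1^ v
      ≈⟨ trans (*-congʳ (-1^-+ h l)) (*-assoc _ _ _) ⟩
    -1^ h * (-1^ l * -1^ v)
      ≈⟨ *-congˡ (-1^-+ l v) ⟨
    -1^ h * -1^ (l ℕ.+ v) ∎
    where
    open import Data.Integer.Solver using (module +-*-Solver)
    open +-*-Solver
    l = length (comp t)
    h = numEdges (edges t)
    v = ∣ verts t ∣

  module _ {N : ℕ} (x : Fin N → Carrier) where

    elemλ-↭ : ∀ {as bs} → as ↭ bs → elemλ R as x ≈ elemλ R bs x
    elemλ-↭ as↭bs = prodR-↭ (↭.map⁺ (λ k → elem R k x) as↭bs)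

    elemλ-++ : ∀ as bs → elemλ R (as ++ bs) x ≈ elemλ R as x * elemλ R bs x
    elemλ-++ []       bs = sym (*-identityˡ _)
    elemλ-++ (a ∷ as) bs = trans (*-congˡ (elemλ-++ as bs)) (sym (*-assoc _ _ _))

    weight : ∀ {n} → List (RawTriple n) → Carrier
    weight S = sign R S * elemλ R (type S) x

    tripleWeight : ∀ {n} → RawTriple n → Carrier
    tripleWeight t = -1^ℤ (tripleSignExp t) * elemλ R (comp t) x

    elemλ-type : ∀ {n} (S : List (RawTriple n)) → elemλ R (type S) x ≈ elemλ R (concatMap comp S) x
    elemλ-type S = elemλ-↭ (sort-↭ ≥-decTotalOrder (concatMap comp S))

    weight-[] : ∀ {n} → weight {n} [] ≈ 1#
    weight-[] {n} = trans (*-identityˡ _) (elemλ-type {n} [])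

    weight-∷ : ∀ {n} (t : RawTriple n) S → weight (t ∷ S) ≈ tripleWeight t * weight S
    weight-∷ t S = begin
      sign R (t ∷ S) * elemλ R (type (t ∷ S)) x
        ≈⟨ *-cong (reflexive (-1^∣∣≡-1^ℤ (tripleSignExp t ℤ.+ signExp S))) (elemλ-type (t ∷ S)) ⟩
      -1^ℤ (tripleSignExp t ℤ.+ signExp S) * elemλ R (comp t ++ concatMap comp S) x
        ≈⟨ *-cong (-1^ℤ-+ (tripleSignExp t) (signExp S)) (elemλ-++ (comp t) (concatMap comp S)) ⟩
      (-1^ℤ (tripleSignExp t) * -1^ℤ (signExp S)) * (elemλ R (comp t) x * elemλ R (concatMap comp S) x)
        ≈⟨ interchange _ _ _ _ ⟩
      tripleWeight t * (-1^ℤ (signExp S) * elemλ R (concatMap comp S) x)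
        ≈⟨ *-congˡ (*-cong (reflexive (≡.sym (-1^∣∣≡-1^ℤ (signExp S)))) (sym (elemλ-type S))) ⟩
      tripleWeight t * weight S ∎

    ∑-triplesOn : ∀ {n} (B : Subset n) H m → ∣ B ∣ ≡.≡ suc m →
      ∑ (triplesOn B H) tripleWeight ≈ -1^ numEdges H * psum ∣ B ∣ x
    ∑-triplesOn B H m ∣B∣≡ = begin
      ∑ (triplesOn B H) tripleWeight
        ≈⟨ ∑-productWith (triple B H) (compositions k) _ tripleWeight ⟩
      ∑ (compositions k) (λ α → ∑ (oneTo (firstPart α)) (λ r → tripleWeight (triple B H α r)))
        ≈⟨ ∑-cong (compositions k) (λ α → trans (∑-const (oneTo (firstPart α)) (tripleWeight (triple B H α 0)))
                                                (reflexive (≡.cong (_×ₙ tripleWeight (triple B H α 0)) (length-applyUpTo suc (firstPart α))))) ⟩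
      ∑ (compositions k) (λ α → firstPart α ×ₙ tripleWeight (triple B H α 0))
        ≈⟨ ∑-cong (compositions k) (λ α → trans (×-congʳ (firstPart α) (signs α)) (sym (×-comm-* (firstPart α) _ _))) ⟩
      ∑ (compositions k) (λ α → -1^ h * (firstPart α ×ₙ compositionTerm x k α))
        ≈⟨ *-distribˡ-∑ _ (compositions k) _ ⟨
      -1^ h * ∑ (compositions k) (λ α → firstPart α ×ₙ compositionTerm x k α)
        ≈⟨ *-congˡ (reflexive (≡.cong (λ k → ∑ (compositions k) (λ α → firstPart α ×ₙ compositionTerm x k α)) ∣B∣≡)) ⟩
      -1^ h * ∑ (compositions (suc m)) (λ α → firstPart α ×ₙ compositionTerm x (suc m) α)
        ≈⟨ *-congˡ (psum-compositions x m) ⟩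
      -1^ h * psum (suc m) x
        ≡⟨ ≡.cong (λ k → -1^ h * psum k x) (≡.sym ∣B∣≡) ⟩
      -1^ h * psum k x ∎
      where
      k = ∣ B ∣
      h = numEdges H
      signs : ∀ α → tripleWeight (triple B H α 0) ≈ -1^ h * compositionTerm x k α
      signs α = trans (*-congʳ (-1^ℤ-tripleSignExp (triple B H α 0))) (*-assoc _ _ _)

module Whitney {c ℓ} (R : CommutativeRing c ℓ) {n : ℕ} (G : Graph n) (N : ℕ) where

  open import Data.Bool using (Bool; true; false; if_then_else_)
  import Data.Bool.Properties as Bool
  open import Data.Empty using (⊥-elim)
  open import Data.Fin using (Fin; toℕ)
  import Data.Fin.Properties as Fin
  open import Data.Fin.Subset using (Subset)
  open import Data.List using (filter)
  open import Data.List.Membership.Propositional using (_∈_)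
  open import Data.List.Membership.Propositional.Properties using (∈-filter⁺; ∈-filter⁻)
  import Data.List.Relation.Unary.Unique.Propositional.Properties as Unique
  open import Data.Maybe using (Maybe)
  import Data.Maybe.Properties as Maybe
  open import Data.Nat as ℕ using (suc; _<_)
  import Data.Nat.Properties as ℕ
  open import Data.Product using (∃; _×_; _,_; proj₁; proj₂)
  open import Data.Sum using (_⊎_; inj₁; inj₂)
  open import Data.Vec using (Vec; lookup)
  open import Function using (_∘_)
  open import Relation.Nullary using (Dec; yes; no; does; ¬_; ¬?)
  open import Relation.Nullary.Decidable using (_×-dec_; _⊎-dec_; _→-dec_; dec-true; dec-false)
  open import Relation.Binary.Definitions using (tri<; tri≈; tri>)
  import Relation.Binary.PropositionalEquality as ≡
  open ≡ using (_≡_; _≢_)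

  open import Defs hiding (Graph; sym)
  open import Defs using () renaming (sym to adj-sym)
  open Connectivity
  open Subgraphs
  open EdgeCount
  open RingSums R
  open PowerSums R using (-1^_)

  open CommutativeRing R
  open import Algebra.Properties.Ring ring using (-‿distribˡ-*)
  open import Relation.Binary.Reasoning.Setoid setoid

  -- A colouring of the vertices by Fin N; nothing marks a vertex left uncoloured.
  Colouring : Set
  Colouring = Vec (Maybe (Fin N)) n

  _≟ᶜ_ : (a b : Maybe (Fin N)) → Dec (a ≡ b)
  _≟ᶜ_ = Maybe.≡-dec Fin._≟_

  ProperOn : Subset n → Colouring → Set
  ProperOn U κ = ∀ i j → i ∈V U → j ∈V U → adj G i j ≡ true → lookup κ i ≢ lookup κ j

  properOn? : ∀ U κ → Dec (ProperOn U κ)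
  properOn? U κ = Fin.all? λ i → Fin.all? λ j → (lookup U i Bool.≟ true) →-dec ((lookup U j Bool.≟ true) →-dec
    ((adj G i j Bool.≟ true) →-dec ¬? (lookup κ i ≟ᶜ lookup κ j)))

  ConstantAlong : EdgeSet n → Colouring → Set
  ConstantAlong M κ = ∀ i j → edge M i j ≡ true → lookup κ i ≡ lookup κ j

  constantAlong? : ∀ M κ → Dec (ConstantAlong M κ)
  constantAlong? M κ = Fin.all? λ i → Fin.all? λ j → (edge M i j Bool.≟ true) →-dec (lookup κ i ≟ᶜ lookup κ j)

  MonochromaticEdge : Subset n → Colouring → Fin n → Fin n → Set
  MonochromaticEdge U κ a b = a ∈V U × b ∈V U × adj G a b ≡ true × lookup κ a ≡ lookup κ b

  monochromaticEdge? : ∀ U κ → Dec (∃ λ a → ∃ λ b → MonochromaticEdge U κ a b)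
  monochromaticEdge? U κ = Fin.any? λ a → Fin.any? λ b → (lookup U a Bool.≟ true) ×-dec ((lookup U b Bool.≟ true) ×-dec
    ((adj G a b Bool.≟ true) ×-dec (lookup κ a ≟ᶜ lookup κ b)))

  signedIndicator : EdgeSet n → Colouring → Carrier
  signedIndicator S κ = -1^ numEdges S * 𝟙 (constantAlong? S κ)

  module SetEdge (a b : Fin n) where

    IsPair : Fin n → Fin n → Set
    IsPair i j = (i ≡ a × j ≡ b) ⊎ (i ≡ b × j ≡ a)

    isPair? : ∀ i j → Dec (IsPair i j)
    isPair? i j = ((i Fin.≟ a) ×-dec (j Fin.≟ b)) ⊎-dec ((i Fin.≟ b) ×-dec (j Fin.≟ a))

    swapPair : ∀ {i j} → IsPair i j → IsPair j i
    swapPair (inj₁ (i≡a , j≡b)) = inj₂ (j≡b , i≡a)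
    swapPair (inj₂ (i≡b , j≡a)) = inj₁ (j≡a , i≡b)

    setEdge : Bool → EdgeSet n → EdgeSet n
    setEdge v S = fromRel (λ i j → if does (isPair? i j) then v else edge S i j)

    setEdge-on : ∀ {v S i j} → IsPair i j → edge (setEdge v S) i j ≡ v
    setEdge-on {v} {S} {i} {j} p =
      ≡.trans (edge-fromRel _ i j) (≡.cong (if_then v else edge S i j) (dec-true (isPair? i j) p))

    setEdge-off : ∀ {v S i j} → ¬ IsPair i j → edge (setEdge v S) i j ≡ edge S i j
    setEdge-off {v} {S} {i} {j} ¬p =
      ≡.trans (edge-fromRel _ i j) (≡.cong (if_then v else edge S i j) (dec-false (isPair? i j) ¬p))

    pair-edge : ∀ {S v i j} → (∀ i j → edge S i j ≡ edge S j i) → edge S a b ≡ v → IsPair i j → edge S i j ≡ v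
    pair-edge S-sym ab≡v (inj₁ (≡.refl , ≡.refl)) = ab≡v
    pair-edge S-sym ab≡v (inj₂ (≡.refl , ≡.refl)) = ≡.trans (S-sym b a) ab≡v

    setEdge-IsSubgraph : ∀ {U} v S → a ∈V U → b ∈V U → adj G a b ≡ true →
      IsSubgraph G U S → IsSubgraph G U (setEdge v S)
    setEdge-IsSubgraph {U} v S a∈ b∈ ab∈G (S⊆G , S-sym) = within , symmetric
      where
      within : ∀ i j → edge (setEdge v S) i j ≡ true → (adj G i j ≡ true) × i ∈V U × j ∈V U
      within i j e with isPair? i j
      ... | no ¬p = S⊆G i j (≡.trans (≡.sym (setEdge-off {v} {S} ¬p)) e)
      ... | yes (inj₁ (≡.refl , ≡.refl)) = ab∈G , a∈ , b∈
      ... | yes (inj₂ (≡.refl , ≡.refl)) = ≡.trans (adj-sym G b a) ab∈G , b∈ , a∈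
      symmetric : ∀ i j → edge (setEdge v S) i j ≡ edge (setEdge v S) j i
      symmetric i j with isPair? i j
      ... | yes p = ≡.trans (setEdge-on {v} {S} p) (≡.sym (setEdge-on {v} {S} (swapPair p)))
      ... | no ¬p = ≡.trans (setEdge-off {v} {S} ¬p) (≡.trans (S-sym i j) (≡.sym (setEdge-off {v} {S} (¬p ∘ swapPair))))

  ∑-signedIndicator-without-monochromatic : ∀ U κ → ¬ (∃ λ a → ∃ λ b → MonochromaticEdge U κ a b) →
    ∑ (subgraphsOn G U) (λ S → signedIndicator S κ) ≈ 𝟙 (properOn? U κ)
  ∑-signedIndicator-without-monochromatic U κ no-mono = begin
    ∑ (subgraphsOn G U) (λ S → signedIndicator S κ)
      ≈⟨ ∑-single (subgraphsOn G U) _ (subgraphsOn-unique G U) (∈-subgraphsOn⁺ G U empty⊆U) nonempty-vanishes ⟩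
    -1^ numEdges (emptyEdges {n}) * 𝟙 (constantAlong? emptyEdges κ)
      ≈⟨ *-cong (reflexive (≡.cong -1^_ (numEdges-empty {n}))) (reflexive (𝟙-yes (constantAlong? emptyEdges κ) no-edges)) ⟩
    1# * 1#
      ≈⟨ *-identityˡ _ ⟩
    1#
      ≡⟨ 𝟙-yes (properOn? U κ) (λ i j i∈ j∈ ij∈G κi≡κj → no-mono (i , j , i∈ , j∈ , ij∈G , κi≡κj)) ⟨
    𝟙 (properOn? U κ) ∎
    where
    empty-edge : ∀ i j → edge emptyEdges i j ≡ false
    empty-edge = edge-fromRel _
    no-edges : ConstantAlong emptyEdges κ
    no-edges i j e = ⊥-elim (true≢false e (empty-edge i j))
    empty⊆U : IsSubgraph G U emptyEdges
    empty⊆U = no-edges′ , λ i j → ≡.trans (empty-edge i j) (≡.sym (empty-edge j i))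
      where no-edges′ = λ i j e → ⊥-elim (true≢false e (empty-edge i j))
    nonempty-vanishes : ∀ {S} → S ∈ subgraphsOn G U → S ≢ emptyEdges → signedIndicator S κ ≈ 0#
    nonempty-vanishes {S} S∈ S≢∅ with Fin.any? (λ i → Fin.any? (λ j → edge S i j Bool.≟ true))
    ... | no none = ⊥-elim (S≢∅ (EdgeSet-ext λ i j → ≡.trans (≢true⇒≡false (λ e → none (i , j , e)))
        (≡.sym (empty-edge i j))))
    ... | yes (i , j , e) = trans (*-congˡ (reflexive (𝟙-no (constantAlong? S κ) not-constant))) (zeroʳ _)
      where
      S⊆G = proj₁ (∈-subgraphsOn⁻ G U S∈) i j e
      not-constant : ¬ ConstantAlong S κ
      not-constant κ-const = no-mono (i , j , proj₁ (proj₂ S⊆G) , proj₂ (proj₂ S⊆G) , proj₁ S⊆G , κ-const i j e)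

  -- Toggling a monochromatic edge {a, b} is a sign-reversing involution on the subgraphs of U.
  module Toggle (U : Subset n) (κ : Colouring) (a b : Fin n) (a<b : toℕ a < toℕ b)
                (mono : MonochromaticEdge U κ a b) where
    open SetEdge a b

    private
      a∈ = proj₁ mono
      b∈ = proj₁ (proj₂ mono)
      ab∈G = proj₁ (proj₂ (proj₂ mono))
      κa≡κb = proj₂ (proj₂ (proj₂ mono))

    has-ab? : ∀ S → Dec (edge S a b ≡ true)
    has-ab? S = edge S a b Bool.≟ true

    without-ab = filter (¬? ∘ has-ab?) (subgraphsOn G U)
    with-ab    = filter has-ab? (subgraphsOn G U)

    ∈-without-ab⁻ : ∀ {S} → S ∈ without-ab → IsSubgraph G U S × edge S a b ≡ false
    ∈-without-ab⁻ S∈ with ∈-filter⁻ (¬? ∘ has-ab?) {xs = subgraphsOn G U} S∈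
    ... | S∈′ , ab∉S = ∈-subgraphsOn⁻ G U S∈′ , ≢true⇒≡false ab∉S

    ∈-with-ab⁻ : ∀ {S} → S ∈ with-ab → IsSubgraph G U S × edge S a b ≡ true
    ∈-with-ab⁻ S∈ with ∈-filter⁻ has-ab? {xs = subgraphsOn G U} S∈
    ... | S∈′ , ab∈S = ∈-subgraphsOn⁻ G U S∈′ , ab∈S

    insert : EdgeSet n → EdgeSet n
    insert = setEdge true

    ab-pair : IsPair a b
    ab-pair = inj₁ (≡.refl , ≡.refl)

    insert-into : ∀ {S} → S ∈ without-ab → insert S ∈ with-ab
    insert-into {S} S∈ =
      ∈-filter⁺ has-ab? (∈-subgraphsOn⁺ G U (setEdge-IsSubgraph {U} true S a∈ b∈ ab∈G (proj₁ (∈-without-ab⁻ S∈))))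
                (setEdge-on {true} {S} ab-pair)

    insert-injective : ∀ {S S'} → S ∈ without-ab → S' ∈ without-ab → insert S ≡ insert S' → S ≡ S'
    insert-injective {S} {S'} S∈ S'∈ eq = EdgeSet-ext same
      where
      same : ∀ i j → edge S i j ≡ edge S' i j
      same i j with isPair? i j
      ... | yes p = ≡.trans (pair-edge {S} (proj₂ (proj₁ (∈-without-ab⁻ S∈))) (proj₂ (∈-without-ab⁻ S∈)) p)
                            (≡.sym (pair-edge {S'} (proj₂ (proj₁ (∈-without-ab⁻ S'∈))) (proj₂ (∈-without-ab⁻ S'∈)) p))
      ... | no ¬p = ≡.trans (≡.sym (setEdge-off {true} {S} ¬p)) (≡.trans (≡.cong (λ M → edge M i j) eq) (setEdge-off {true} {S'} ¬p))

    insert-onto : ∀ {S₁} → S₁ ∈ with-ab → ∃ λ S → S ∈ without-ab × insert S ≡ S₁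
    insert-onto {S₁} S₁∈ =
      setEdge false S₁ ,
      ∈-filter⁺ (¬? ∘ has-ab?) (∈-subgraphsOn⁺ G U (setEdge-IsSubgraph {U} false S₁ a∈ b∈ ab∈G (proj₁ (∈-with-ab⁻ S₁∈))))
                (λ e → true≢false e (setEdge-on {false} {S₁} ab-pair)) ,
      EdgeSet-ext restored
      where
      restored : ∀ i j → edge (insert (setEdge false S₁)) i j ≡ edge S₁ i j
      restored i j with isPair? i j
      ... | yes p = ≡.trans (setEdge-on {true} {setEdge false S₁} p)
          (≡.sym (pair-edge {S₁} (proj₂ (proj₁ (∈-with-ab⁻ S₁∈))) (proj₂ (∈-with-ab⁻ S₁∈)) p))
      ... | no ¬p = ≡.trans (setEdge-off {true} {setEdge false S₁} ¬p) (setEdge-off {false} {S₁} ¬p)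

    insert-flips-sign : ∀ {S} → S ∈ without-ab → signedIndicator (insert S) κ ≈ - signedIndicator S κ
    insert-flips-sign {S} S∈ = begin
      -1^ numEdges (insert S) * 𝟙 (constantAlong? (insert S) κ)
        ≡⟨ ≡.cong₂ (λ k i → -1^ k * i) one-more (𝟙-⇔ (constantAlong? (insert S) κ) (constantAlong? S κ) drop add) ⟩
      -1^ suc (numEdges S) * 𝟙 (constantAlong? S κ)
        ≈⟨ -‿distribˡ-* _ _ ⟨
      - signedIndicator S κ ∎
      where
      one-more : numEdges (insert S) ≡ suc (numEdges S)
      one-more = numEdges-insert S (insert S) a b a<b (proj₂ (∈-without-ab⁻ S∈)) (setEdge-on {true} {S} ab-pair)
        (λ i j i<j ¬ab → setEdge-off {true} {S} λ where
           (inj₁ ab) → ¬ab ab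
           (inj₂ (≡.refl , ≡.refl)) → ℕ.<-asym a<b i<j)
      drop : ConstantAlong (insert S) κ → ConstantAlong S κ
      drop const i j e with isPair? i j
      ... | yes p = const i j (setEdge-on {true} {S} p)
      ... | no ¬p = const i j (≡.trans (setEdge-off {true} {S} ¬p) e)
      add : ConstantAlong S κ → ConstantAlong (insert S) κ
      add const i j e with isPair? i j
      ... | no ¬p = const i j (≡.trans (≡.sym (setEdge-off {true} {S} ¬p)) e)
      ... | yes (inj₁ (≡.refl , ≡.refl)) = κa≡κb
      ... | yes (inj₂ (≡.refl , ≡.refl)) = ≡.sym κa≡κb

    ∑-signedIndicator-cancels : ∑ (subgraphsOn G U) (λ S → signedIndicator S κ) ≈ 0#
    ∑-signedIndicator-cancels = begin
      ∑ (subgraphsOn G U) F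
        ≈⟨ ∑-partition has-ab? (subgraphsOn G U) F ⟩
      ∑ with-ab F + ∑ without-ab F
        ≈⟨ +-congʳ (∑-reindex without-ab with-ab insert (Unique.filter⁺ _ (subgraphsOn-unique G U))
                      (Unique.filter⁺ _ (subgraphsOn-unique G U)) insert-injective insert-into insert-onto F) ⟨
      ∑ without-ab (F ∘ insert) + ∑ without-ab F
        ≈⟨ +-congʳ (trans (∑-cong-∈ without-ab insert-flips-sign) (∑-neg without-ab F)) ⟩
      - ∑ without-ab F + ∑ without-ab F
        ≈⟨ -‿inverseˡ _ ⟩
      0# ∎
      where
      F : EdgeSet n → Carrier
      F S = signedIndicator S κ

  ∑-signedIndicator≈𝟙-properOn : ∀ U κ → ∑ (subgraphsOn G U) (λ S → signedIndicator S κ) ≈ 𝟙 (properOn? U κ)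
  ∑-signedIndicator≈𝟙-properOn U κ with monochromaticEdge? U κ
  ... | no no-mono = ∑-signedIndicator-without-monochromatic U κ no-mono
  ... | yes (a , b , mono@(a∈ , b∈ , ab∈G , κa≡κb)) = trans cancels (reflexive (≡.sym (𝟙-no (properOn? U κ) improper)))
    where
    improper : ¬ ProperOn U κ
    improper proper = proper a b a∈ b∈ ab∈G κa≡κb
    cancels : ∑ (subgraphsOn G U) (λ S → signedIndicator S κ) ≈ 0#
    cancels with ℕ.<-cmp (toℕ a) (toℕ b)
    ... | tri< a<b _ _ = Toggle.∑-signedIndicator-cancels U κ a b a<b mono
    ... | tri> _ _ b<a = Toggle.∑-signedIndicator-cancels U κ b a b<a (b∈ , a∈ , ≡.trans (adj-sym G b a) ab∈G , ≡.sym κa≡κb)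
    ... | tri≈ _ a≡b _ with ≡.refl ← Fin.toℕ-injective a≡b = ⊥-elim (true≢false ab∈G (irrefl G a))

module ChromaticRecurrence {c ℓ} (R : CommutativeRing c ℓ) {n : ℕ} (G : Graph n) (N : ℕ)
  (x : Fin N → CommutativeRing.Carrier R) where

  open import Data.Bool using (Bool; true; false; if_then_else_)
  import Data.Bool.Properties as Bool
  open import Data.Empty using (⊥-elim)
  open import Data.Fin using (zero; suc)
  open import Data.Nat using (zero; suc)
  import Data.Fin.Properties as Fin
  open import Data.Fin.Subset using (Subset; ∣_∣; _─_; ⊤)
  open import Data.List using (List; []; _∷_; map; allFin; filter; concatMap)
  open import Data.List.Membership.Propositional using (_∈_)
  open import Data.List.Membership.Propositional.Properties
    using (∈-filter⁺; ∈-filter⁻; ∈-map⁺; ∈-map⁻; ∈-allFin)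
  open import Data.List.Relation.Unary.Any using (here)
  import Data.List.Relation.Unary.All as All
  open import Data.List.Relation.Unary.AllPairs using ([]; _∷_)
  open import Data.List.Relation.Unary.Unique.Propositional using (Unique)
  import Data.List.Relation.Unary.Unique.Propositional.Properties as Unique
  open import Data.Maybe using (Maybe; just; nothing)
  import Data.Maybe.Properties as Maybe
  open import Data.Product using (∃; _×_; _,_; proj₁; proj₂)
  open import Data.Sum using (inj₁; inj₂)
  open import Data.Vec using (Vec; []; _∷_; lookup; tabulate; replicate)
  import Data.Vec as Vec
  import Data.Vec.Properties as Vec
  open import Function using (_∘_)
  open import Relation.Nullary using (Dec)
  open import Relation.Nullary.Decidable using (_→-dec_)
  import Relation.Binary.PropositionalEquality as ≡
  open ≡ using (_≡_)

  open import Defs hiding (Graph; sym)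
  open ListEnumeration using (InjectiveOn; productWith; ∈-productWith⁺; ∈-productWith⁻; Unique-productWith⁺)
  open VectorEnumeration
  open Connectivity
  open Subgraphs
  open EdgeCount
  open RingSums R
  open PowerSums R using (-1^_; -1^-+; psum; map-allFin-suc)
  open Whitney R G N

  open CommutativeRing R hiding (zero)
  open import Algebra.Properties.Semiring.Exp semiring using (_^_)
  open import Algebra.Properties.CommutativeSemigroup *-commutativeSemigroup using (interchange; x∙yz≈y∙xz)
  open import Relation.Binary.Reasoning.Setoid setoid

  choices : Bool → List (Maybe (Fin N))
  choices true  = map just (allFin N)
  choices false = nothing ∷ []

  colouringsOn : Subset n → List Colouring
  colouringsOn W = vectorsFrom (Vec.map choices W)

  ∈-colouringsOn⁻ : ∀ W {κ} → κ ∈ colouringsOn W → ∀ i → lookup κ i ∈ choices (lookup W i)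
  ∈-colouringsOn⁻ W {κ} κ∈ i = ≡.subst (lookup κ i ∈_) (Vec.lookup-map i choices W) (∈-vectorsFrom⁻ (Vec.map choices W) κ∈ i)

  ∈-colouringsOn⁺ : ∀ W {κ} → (∀ i → lookup κ i ∈ choices (lookup W i)) → κ ∈ colouringsOn W
  ∈-colouringsOn⁺ W {κ} κ∈ =
    ∈-vectorsFrom⁺ (Vec.map choices W) (λ i → ≡.subst (lookup κ i ∈_) (≡.sym (Vec.lookup-map i choices W)) (κ∈ i))

  colouringsOn-unique : ∀ W → Unique (colouringsOn W)
  colouringsOn-unique W = vectorsFrom-unique (Vec.map choices W)
    (λ i → ≡.subst Unique (≡.sym (Vec.lookup-map i choices W)) (choices-unique (lookup W i)))
    where
    choices-unique : ∀ b → Unique (choices b)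
    choices-unique true  = Unique.map⁺ Maybe.just-injective (Unique.allFin⁺ N)
    choices-unique false = All.[] ∷ []

  ∈-choices-false : ∀ {m} → m ∈ choices false → m ≡ nothing
  ∈-choices-false (here m≡) = m≡

  ∈-choices-true : ∀ {m} → m ∈ choices true → ∃ λ c → m ≡ just c
  ∈-choices-true m∈ with ∈-map⁻ just m∈
  ... | c , _ , m≡ = c , m≡

  just∈choices : ∀ c → just c ∈ choices true
  just∈choices c = ∈-map⁺ just (∈-allFin c)

  colourValue : Maybe (Fin N) → Carrier
  colourValue nothing  = 1#
  colourValue (just c) = x c

  colourMonomial : Colouring → Carrier
  colourMonomial κ = ∏ (allFin n) (λ i → colourValue (lookup κ i))

  -- X_{G[W]}(x), with the vertices outside W left uncoloured.
  chromaticOn : Subset n → Carrier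
  chromaticOn W = ∑ (colouringsOn W) (λ κ → 𝟙 (properOn? W κ) * colourMonomial κ)

  ∏-indicator-pow : ∀ {m} (B : Subset m) y → ∏ (allFin m) (λ i → if lookup B i then y else 1#) ≈ y ^ ∣ B ∣
  ∏-indicator-pow []          y = refl
  ∏-indicator-pow (true ∷ B)  y =
    trans (reflexive (≡.cong (prodR R) (map-allFin-suc (λ i → if lookup (true ∷ B) i then y else 1#))))
          (*-congˡ (∏-indicator-pow B y))
  ∏-indicator-pow (false ∷ B) y =
    trans (reflexive (≡.cong (prodR R) (map-allFin-suc (λ i → if lookup (false ∷ B) i then y else 1#))))
          (trans (*-identityˡ _) (∏-indicator-pow B y))

  ConstantOn : Subset n → Fin n → Colouring → Set
  ConstantOn B w₀ κ = ∀ i → i ∈V B → lookup κ i ≡ lookup κ w₀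

  constantOn? : ∀ B w₀ κ → Dec (ConstantOn B w₀ κ)
  constantOn? B w₀ κ = Fin.all? λ i → (lookup B i Bool.≟ true) →-dec (lookup κ i ≟ᶜ lookup κ w₀)

  -- A colouring of W constant on B ⊆ W is a colour c for B together with a colouring of W ─ B.
  module ColourBlock (W B : Subset n) (w₀ : Fin n) (B⊆W : B ⊆V W) (w₀∈B : w₀ ∈V B) where

    fill : Fin N × Colouring → Colouring
    fill (c , κ') = tabulate (λ i → if lookup B i then just c else lookup κ' i)

    erase : Colouring → Colouring
    erase κ = tabulate (λ i → if lookup B i then nothing else lookup κ i)

    fill-∈B : ∀ c κ' {i} → i ∈V B → lookup (fill (c , κ')) i ≡ just c
    fill-∈B c κ' {i} i∈ = ≡.trans (Vec.lookup∘tabulate _ i) (≡.cong (if_then just c else lookup κ' i) i∈)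

    fill-∉B : ∀ c κ' {i} → lookup B i ≡ false → lookup (fill (c , κ')) i ≡ lookup κ' i
    fill-∉B c κ' {i} i∉ = ≡.trans (Vec.lookup∘tabulate _ i) (≡.cong (if_then just c else lookup κ' i) i∉)

    erase-∈B : ∀ κ {i} → i ∈V B → lookup (erase κ) i ≡ nothing
    erase-∈B κ {i} i∈ = ≡.trans (Vec.lookup∘tabulate _ i) (≡.cong (if_then nothing else lookup κ i) i∈)

    erase-∉B : ∀ κ {i} → lookup B i ≡ false → lookup (erase κ) i ≡ lookup κ i
    erase-∉B κ {i} i∉ = ≡.trans (Vec.lookup∘tabulate _ i) (≡.cong (if_then nothing else lookup κ i) i∉)

    uncoloured-on-B : ∀ {κ'} → κ' ∈ colouringsOn (W ─ B) → ∀ {i} → i ∈V B → lookup κ' i ≡ nothing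
    uncoloured-on-B κ'∈ {i} i∈ = ∈-choices-false (≡.subst (λ b → _ ∈ choices b) (∉V-─ W B i i∈)
        (∈-colouringsOn⁻ (W ─ B) κ'∈ i))

    choice-off-B : ∀ {κ'} → κ' ∈ colouringsOn (W ─ B) → ∀ {i} → lookup B i ≡ false → lookup κ' i ∈ choices (lookup W i)
    choice-off-B κ'∈ {i} i∉ = ≡.subst (λ b → _ ∈ choices b) (lookup-─-∉ W B i i∉) (∈-colouringsOn⁻ (W ─ B) κ'∈ i)

    blockColourings : List (Fin N × Colouring)
    blockColourings = productWith _,_ (allFin N) (λ _ → colouringsOn (W ─ B))

    colouring∈ : ∀ {p} → p ∈ blockColourings → proj₂ p ∈ colouringsOn (W ─ B)
    colouring∈ p∈ with ∈-productWith⁻ _,_ (allFin N) (λ _ → colouringsOn (W ─ B)) p∈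
    ... | _ , _ , _ , κ'∈ , ≡.refl = κ'∈

    constantColourings : List Colouring
    constantColourings = filter (constantOn? B w₀) (colouringsOn W)

    fill-into : ∀ {p} → p ∈ blockColourings → fill p ∈ constantColourings
    fill-into {c , κ'} p∈ = ∈-filter⁺ (constantOn? B w₀) (∈-colouringsOn⁺ W choice-ok) constant
      where
      κ'∈ = colouring∈ p∈
      choice-ok : ∀ i → lookup (fill (c , κ')) i ∈ choices (lookup W i)
      choice-ok i with lookup B i in i∈B?
      ... | true  = ≡.subst₂ (λ m b → m ∈ choices b) (≡.sym (fill-∈B c κ' i∈B?)) (≡.sym (B⊆W i i∈B?)) (just∈choices c)
      ... | false = ≡.subst (_∈ choices (lookup W i)) (≡.sym (fill-∉B c κ' i∈B?)) (choice-off-B κ'∈ i∈B?)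
      constant : ConstantOn B w₀ (fill (c , κ'))
      constant i i∈ = ≡.trans (fill-∈B c κ' i∈) (≡.sym (fill-∈B c κ' w₀∈B))

    fill-injective : InjectiveOn fill blockColourings
    fill-injective {c , κ'} {c' , κ''} p∈ p'∈ eq = ≡.cong₂ _,_ c≡c' (Vec-ext κ'≗κ'')
      where
      κ'∈ = colouring∈ p∈
      κ''∈ = colouring∈ p'∈
      c≡c' = Maybe.just-injective (≡.trans (≡.sym (fill-∈B c κ' w₀∈B))
          (≡.trans (≡.cong (λ κ → lookup κ w₀) eq) (fill-∈B c' κ'' w₀∈B)))
      κ'≗κ'' : ∀ i → lookup κ' i ≡ lookup κ'' i
      κ'≗κ'' i with lookup B i in i∈B?
      ... | true  = ≡.trans (uncoloured-on-B κ'∈ i∈B?) (≡.sym (uncoloured-on-B κ''∈ i∈B?))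
      ... | false = ≡.trans (≡.sym (fill-∉B c κ' i∈B?)) (≡.trans (≡.cong (λ κ → lookup κ i) eq) (fill-∉B c' κ'' i∈B?))

    fill-onto : ∀ {κ} → κ ∈ constantColourings → ∃ λ p → p ∈ blockColourings × fill p ≡ κ
    fill-onto {κ} κ∈ with ∈-filter⁻ (constantOn? B w₀) {xs = colouringsOn W} κ∈
    ... | κ∈W , constant with ∈-choices-true (≡.subst (λ b → lookup κ w₀ ∈ choices b) (B⊆W w₀ w₀∈B)
        (∈-colouringsOn⁻ W κ∈W w₀))
    ... | c , κw₀≡c = (c , erase κ) , ∈-productWith⁺ _,_ (∈-allFin c) (∈-colouringsOn⁺ (W ─ B) choice-ok) , Vec-ext refilled
      where
      choice-ok : ∀ i → lookup (erase κ) i ∈ choices (lookup (W ─ B) i)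
      choice-ok i with lookup B i in i∈B?
      ... | true  = ≡.subst₂ (λ m b → m ∈ choices b) (≡.sym (erase-∈B κ i∈B?)) (≡.sym (∉V-─ W B i i∈B?)) (here ≡.refl)
      ... | false = ≡.subst₂ (λ m b → m ∈ choices b) (≡.sym (erase-∉B κ i∈B?)) (≡.sym (lookup-─-∉ W B i i∈B?))
                             (∈-colouringsOn⁻ W κ∈W i)
      refilled : ∀ i → lookup (fill (c , erase κ)) i ≡ lookup κ i
      refilled i with lookup B i in i∈B?
      ... | true  = ≡.trans (fill-∈B c (erase κ) i∈B?) (≡.sym (≡.trans (constant i i∈B?) κw₀≡c))
      ... | false = ≡.trans (fill-∉B c (erase κ) i∈B?) (erase-∉B κ i∈B?)

    F : Colouring → Carrier
    F κ = 𝟙 (properOn? (W ─ B) κ) * colourMonomial κ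

    F-fill : ∀ {p} → p ∈ blockColourings → F (fill p) ≈ x (proj₁ p) ^ ∣ B ∣ * F (proj₂ p)
    F-fill {c , κ'} p∈ = begin
      𝟙 (properOn? (W ─ B) (fill (c , κ'))) * colourMonomial (fill (c , κ'))
        ≈⟨ *-cong (reflexive (𝟙-⇔ (properOn? (W ─ B) (fill (c , κ'))) (properOn? (W ─ B) κ') to from)) monomial-fill ⟩
      𝟙 (properOn? (W ─ B) κ') * (x c ^ ∣ B ∣ * colourMonomial κ')
        ≈⟨ x∙yz≈y∙xz _ _ _ ⟩
      x c ^ ∣ B ∣ * F κ' ∎
      where
      κ'∈ = colouring∈ p∈
      agree : ∀ i → i ∈V (W ─ B) → lookup (fill (c , κ')) i ≡ lookup κ' i
      agree i i∈ = fill-∉B c κ' (proj₂ (∈V-─⁻ W B i i∈))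
      to : ProperOn (W ─ B) (fill (c , κ')) → ProperOn (W ─ B) κ'
      to proper i j i∈ j∈ ij∈G eq = proper i j i∈ j∈ ij∈G (≡.trans (agree i i∈) (≡.trans eq (≡.sym (agree j j∈))))
      from : ProperOn (W ─ B) κ' → ProperOn (W ─ B) (fill (c , κ'))
      from proper i j i∈ j∈ ij∈G eq = proper i j i∈ j∈ ij∈G (≡.trans (≡.sym (agree i i∈)) (≡.trans eq (agree j j∈)))
      value-fill : ∀ i → colourValue (lookup (fill (c , κ')) i) ≈ (if lookup B i then x c else 1#) * colourValue (lookup κ' i)
      value-fill i with lookup B i in i∈B?
      ... | true  = trans (reflexive (≡.cong colourValue (fill-∈B c κ' i∈B?)))
                          (trans (sym (*-identityʳ _)) (*-congˡ (reflexive (≡.cong colourValue (≡.sym (uncoloured-on-B κ'∈ i∈B?))))))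
      ... | false = trans (reflexive (≡.cong colourValue (fill-∉B c κ' i∈B?))) (sym (*-identityˡ _))
      monomial-fill : colourMonomial (fill (c , κ')) ≈ x c ^ ∣ B ∣ * colourMonomial κ'
      monomial-fill = trans (∏-cong (allFin n) value-fill) (trans (∏-distrib-* (allFin n) _ _) (*-congʳ (∏-indicator-pow B (x c))))

    ∑-constantOn : ∑ (colouringsOn W) (λ κ → 𝟙 (constantOn? B w₀ κ) * F κ) ≈ psum ∣ B ∣ x * chromaticOn (W ─ B)
    ∑-constantOn = begin
      ∑ (colouringsOn W) (λ κ → 𝟙 (constantOn? B w₀ κ) * F κ)
        ≈⟨ ∑-filter (constantOn? B w₀) (colouringsOn W) F ⟨
      ∑ constantColourings F
        ≈⟨ ∑-reindex blockColourings constantColourings fill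
             (Unique-productWith⁺ _,_ (Unique.allFin⁺ N) (λ _ → colouringsOn-unique (W ─ B))
               (λ { _ _ _ _ ≡.refl → ≡.refl , ≡.refl }))
             (Unique.filter⁺ (constantOn? B w₀) (colouringsOn-unique W)) fill-injective fill-into fill-onto F ⟨
      ∑ blockColourings (F ∘ fill)
        ≈⟨ ∑-cong-∈ blockColourings F-fill ⟩
      ∑ blockColourings (λ (c , κ') → x c ^ ∣ B ∣ * F κ')
        ≈⟨ ∑-productWith _,_ (allFin N) (λ _ → colouringsOn (W ─ B)) _ ⟩
      ∑ (allFin N) (λ c → ∑ (colouringsOn (W ─ B)) (λ κ' → x c ^ ∣ B ∣ * F κ'))
        ≈⟨ ∑-cong (allFin N) (λ c → *-distribˡ-∑ _ (colouringsOn (W ─ B)) F) ⟨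
      ∑ (allFin N) (λ c → x c ^ ∣ B ∣ * chromaticOn (W ─ B))
        ≈⟨ *-distribʳ-∑ _ (allFin N) _ ⟨
      psum ∣ B ∣ x * chromaticOn (W ─ B) ∎

  ConstantAlong-Walk : ∀ {H κ} → ConstantAlong H κ → ∀ {i j} → Walk H i j → lookup κ i ≡ lookup κ j
  ConstantAlong-Walk         const here       = ≡.refl
  ConstantAlong-Walk {H} {κ} const (step e w) = ≡.trans (const _ _ e) (ConstantAlong-Walk {H} {κ} const w)

  module Recurrence (W : Subset n) (w₀ : Fin n) (w₀∈W : w₀ ∈V W) where
    open RootedDecomposition G W w₀

    signedIndicator-glue : ∀ {B H S'} κ → RootedConnected (B , H) → IsSubgraph G (W ─ B) S' →
      signedIndicator (H ∪ₑ S') κ ≈ (-1^ numEdges H * 𝟙 (constantOn? B w₀ κ)) * signedIndicator S' κ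
    signedIndicator-glue {B} {H} {S'} κ BH@(w₀∈B , _ , H⊆B , H-connected) S'⊆ = begin
      -1^ numEdges (H ∪ₑ S') * 𝟙 (constantAlong? (H ∪ₑ S') κ)
        ≈⟨ *-cong (trans (reflexive (≡.cong -1^_ (numEdges-∪ₑ H S' (Glued.glue-disjoint {B} {H} {S'} BH S'⊆))))
                         (-1^-+ (numEdges H) (numEdges S')))
                  (𝟙-× (constantAlong? (H ∪ₑ S') κ) (constantOn? B w₀ κ) (constantAlong? S' κ) split join) ⟩
      (-1^ numEdges H * -1^ numEdges S') * (𝟙 (constantOn? B w₀ κ) * 𝟙 (constantAlong? S' κ))
        ≈⟨ interchange _ _ _ _ ⟩
      (-1^ numEdges H * 𝟙 (constantOn? B w₀ κ)) * signedIndicator S' κ ∎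
      where
      split : ConstantAlong (H ∪ₑ S') κ → ConstantOn B w₀ κ × ConstantAlong S' κ
      split const =
        (λ i i∈ → ≡.sym (ConstantAlong-Walk {H} {κ} (λ a b e → const a b (edge-∪ₑ⁺ˡ H S' a b e))
            (proj₂ H-connected w₀ i w₀∈B i∈))) ,
        (λ i j e → const i j (edge-∪ₑ⁺ʳ H S' i j e))
      join : ConstantOn B w₀ κ × ConstantAlong S' κ → ConstantAlong (H ∪ₑ S') κ
      join (const-B , const-S') i j e with edge-∪ₑ⁻ H S' i j e
      ... | inj₁ eH = ≡.trans (const-B i (proj₁ (proj₂ (proj₁ H⊆B i j eH))))
          (≡.sym (const-B j (proj₂ (proj₂ (proj₁ H⊆B i j eH)))))
      ... | inj₂ eS = const-S' i j eS

    rootedTerm : Subset n × EdgeSet n → Colouring → Carrier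
    rootedTerm (B , H) κ = (-1^ numEdges H * 𝟙 (constantOn? B w₀ κ)) * 𝟙 (properOn? (W ─ B) κ)

    -- Whitney's expansion on W, regrouped by the component of w₀, then Whitney's expansion on W ─ B.
    𝟙-properOn-rooted : ∀ κ → 𝟙 (properOn? W κ) ≈ ∑ rootedConnected (λ BH → rootedTerm BH κ)
    𝟙-properOn-rooted κ = begin
      𝟙 (properOn? W κ)
        ≈⟨ ∑-signedIndicator≈𝟙-properOn W κ ⟨
      ∑ (subgraphsOn G W) (λ S → signedIndicator S κ)
        ≈⟨ ∑-reindex splittings (subgraphsOn G W) glue splittings-unique (subgraphsOn-unique G W)
                     glue-injective glue-into (glue-onto w₀∈W) (λ S → signedIndicator S κ) ⟨
      ∑ splittings (λ t → signedIndicator (glue t) κ)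
        ≈⟨ ∑-productWith _,_ rootedConnected (λ (B , _) → subgraphsOn G (W ─ B)) _ ⟩
      ∑ rootedConnected (λ (B , H) → ∑ (subgraphsOn G (W ─ B)) (λ S' → signedIndicator (H ∪ₑ S') κ))
        ≈⟨ ∑-cong-∈ rootedConnected per-component ⟩
      ∑ rootedConnected (λ BH → rootedTerm BH κ) ∎
      where
      per-component : ∀ {BH} → BH ∈ rootedConnected →
        ∑ (subgraphsOn G (W ─ proj₁ BH)) (λ S' → signedIndicator (proj₂ BH ∪ₑ S') κ) ≈ rootedTerm BH κ
      per-component {B , H} BH∈ = begin
        ∑ (subgraphsOn G (W ─ B)) (λ S' → signedIndicator (H ∪ₑ S') κ)
          ≈⟨ ∑-cong-∈ (subgraphsOn G (W ─ B)) (λ {S'} S'∈ → signedIndicator-glue {B} {H} {S'} κ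
              (∈-rootedConnected⁻ BH∈) (∈-subgraphsOn⁻ G (W ─ B) S'∈)) ⟩
        ∑ (subgraphsOn G (W ─ B)) (λ S' → (-1^ numEdges H * 𝟙 (constantOn? B w₀ κ)) * signedIndicator S' κ)
          ≈⟨ *-distribˡ-∑ _ (subgraphsOn G (W ─ B)) _ ⟨
        (-1^ numEdges H * 𝟙 (constantOn? B w₀ κ)) * ∑ (subgraphsOn G (W ─ B)) (λ S' → signedIndicator S' κ)
          ≈⟨ *-congˡ (∑-signedIndicator≈𝟙-properOn (W ─ B) κ) ⟩
        rootedTerm (B , H) κ ∎

    chromaticOn-recurrence :
      chromaticOn W ≈ ∑ rootedConnected (λ (B , H) → -1^ numEdges H * (psum ∣ B ∣ x * chromaticOn (W ─ B)))
    chromaticOn-recurrence = begin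
      ∑ (colouringsOn W) (λ κ → 𝟙 (properOn? W κ) * colourMonomial κ)
        ≈⟨ ∑-cong (colouringsOn W) (λ κ → trans (*-congʳ (𝟙-properOn-rooted κ)) (*-distribʳ-∑ _ rootedConnected _)) ⟩
      ∑ (colouringsOn W) (λ κ → ∑ rootedConnected (λ BH → rootedTerm BH κ * colourMonomial κ))
        ≈⟨ ∑-comm (colouringsOn W) rootedConnected _ ⟩
      ∑ rootedConnected (λ BH → ∑ (colouringsOn W) (λ κ → rootedTerm BH κ * colourMonomial κ))
        ≈⟨ ∑-cong-∈ rootedConnected per-component ⟩
      ∑ rootedConnected (λ (B , H) → -1^ numEdges H * (psum ∣ B ∣ x * chromaticOn (W ─ B))) ∎
      where
      per-component : ∀ {BH} → BH ∈ rootedConnected → ∑ (colouringsOn W) (λ κ → rootedTerm BH κ * colourMonomial κ)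
        ≈ -1^ numEdges (proj₂ BH) * (psum ∣ proj₁ BH ∣ x * chromaticOn (W ─ proj₁ BH))
      per-component {B , H} BH∈ = begin
        ∑ (colouringsOn W) (λ κ → rootedTerm (B , H) κ * colourMonomial κ)
          ≈⟨ ∑-cong (colouringsOn W) (λ κ → trans (*-assoc _ _ _) (*-assoc _ _ _)) ⟩
        ∑ (colouringsOn W) (λ κ → -1^ numEdges H * (𝟙 (constantOn? B w₀ κ) * (𝟙 (properOn? (W ─ B) κ) * colourMonomial κ)))
          ≈⟨ *-distribˡ-∑ _ (colouringsOn W) _ ⟨
        -1^ numEdges H * ∑ (colouringsOn W) (λ κ → 𝟙 (constantOn? B w₀ κ) * (𝟙 (properOn? (W ─ B) κ) * colourMonomial κ))
          ≈⟨ *-congˡ (ColourBlock.∑-constantOn W B w₀ B⊆W w₀∈B) ⟩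
        -1^ numEdges H * (psum ∣ B ∣ x * chromaticOn (W ─ B)) ∎
        where
        w₀∈B = proj₁ (∈-rootedConnected⁻ BH∈)
        B⊆W = proj₁ (proj₂ (∈-rootedConnected⁻ BH∈))

  chromaticOn-empty : ∀ W → (∀ i → lookup W i ≡ false) → chromaticOn W ≈ 1#
  chromaticOn-empty W W≡∅ = begin
    chromaticOn W
      ≈⟨ ∑-single (colouringsOn W) _ (colouringsOn-unique W) uncoloured∈ (λ κ∈ κ≢ → ⊥-elim (κ≢ (only κ∈))) ⟩
    𝟙 (properOn? W uncoloured) * colourMonomial uncoloured
      ≈⟨ *-cong (reflexive (𝟙-yes (properOn? W uncoloured) (λ i _ i∈ _ _ _ → ⊥-elim (true≢false i∈ (W≡∅ i)))))
                (trans (∏-cong (allFin n) (λ i → reflexive (≡.cong colourValue (Vec.lookup-replicate i nothing)))) (∏-one (allFin n))) ⟩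
    1# * 1#
      ≈⟨ *-identityˡ _ ⟩
    1# ∎
    where
    uncoloured : Colouring
    uncoloured = replicate n nothing
    uncoloured∈ : uncoloured ∈ colouringsOn W
    uncoloured∈ = ∈-colouringsOn⁺ W λ i →
      ≡.subst₂ (λ m b → m ∈ choices b) (≡.sym (Vec.lookup-replicate i nothing)) (≡.sym (W≡∅ i)) (here ≡.refl)
    only : ∀ {κ} → κ ∈ colouringsOn W → κ ≡ uncoloured
    only κ∈ = Vec-ext λ i → ≡.trans (∈-choices-false (≡.subst (λ b → _ ∈ choices b) (W≡∅ i) (∈-colouringsOn⁻ W κ∈ i)))
                                    (≡.sym (Vec.lookup-replicate i nothing))

  allMaps≡allVectors : ∀ m → allMaps R N m ≡ allVectors (allFin N) m
  allMaps≡allVectors zero    = ≡.refl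
  allMaps≡allVectors (suc m) = ≡.cong (λ κs → concatMap (λ a → map (a ∷_) κs) (allFin N)) (allMaps≡allVectors m)

  chromSym≈chromaticOn-⊤ : chromSym R G x ≈ chromaticOn ⊤
  chromSym≈chromaticOn-⊤ = begin
    ∑ (filter (proper? R G) (allMaps R N n)) monomial
      ≈⟨ ∑-filter (proper? R G) (allMaps R N n) monomial ⟩
    ∑ (allMaps R N n) (λ κ → 𝟙 (proper? R G κ) * monomial κ)
      ≈⟨ ∑-cong (allMaps R N n) (λ κ → *-cong (reflexive (𝟙-⇔ (proper? R G κ) (properOn? ⊤ (Vec.map just κ)) (to {κ}) (from {κ})))
                                               (∏-cong (allFin n) (λ i → reflexive (≡.cong colourValue (≡.sym (lookup-just κ i)))))) ⟩
    ∑ (allMaps R N n) (λ κ → 𝟙 (properOn? ⊤ (Vec.map just κ)) * colourMonomial (Vec.map just κ))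
      ≈⟨ ∑-reindex (allMaps R N n) (colouringsOn ⊤) (Vec.map just) allMaps-unique (colouringsOn-unique ⊤)
                   just-injective just-into just-onto (λ κ → 𝟙 (properOn? ⊤ κ) * colourMonomial κ) ⟩
    chromaticOn ⊤ ∎
    where
    monomial : Vec (Fin N) n → Carrier
    monomial κ = ∏ (allFin n) (λ i → x (lookup κ i))
    ∈⊤ : ∀ i → i ∈V ⊤
    ∈⊤ i = Vec.lookup-replicate i true
    lookup-just : ∀ (κ : Vec (Fin N) n) i → lookup (Vec.map just κ) i ≡ just (lookup κ i)
    lookup-just κ i = Vec.lookup-map i just κ
    to : ∀ {κ} → Proper R G κ → ProperOn ⊤ (Vec.map just κ)
    to {κ} proper i j _ _ ij∈G eq =
      proper i j ij∈G (Maybe.just-injective (≡.trans (≡.sym (lookup-just κ i)) (≡.trans eq (lookup-just κ j))))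
    from : ∀ {κ} → ProperOn ⊤ (Vec.map just κ) → Proper R G κ
    from {κ} proper i j ij∈G eq =
      proper i j (∈⊤ i) (∈⊤ j) ij∈G (≡.trans (lookup-just κ i) (≡.trans (≡.cong just eq) (≡.sym (lookup-just κ j))))
    allMaps-unique : Unique (allMaps R N n)
    allMaps-unique = ≡.subst Unique (≡.sym (allMaps≡allVectors n)) (allVectors-unique n (Unique.allFin⁺ N))
    just-injective : InjectiveOn (Vec.map just) (allMaps R N n)
    just-injective {κ} {κ'} _ _ eq = Vec-ext λ i →
      Maybe.just-injective (≡.trans (≡.sym (lookup-just κ i)) (≡.trans (≡.cong (λ v → lookup v i) eq) (lookup-just κ' i)))
    just-into : ∀ {κ} → κ ∈ allMaps R N n → Vec.map just κ ∈ colouringsOn ⊤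
    just-into {κ} _ = ∈-colouringsOn⁺ ⊤ λ i →
      ≡.subst₂ (λ m b → m ∈ choices b) (≡.sym (lookup-just κ i)) (≡.sym (∈⊤ i)) (just∈choices (lookup κ i))
    just-onto : ∀ {κ'} → κ' ∈ colouringsOn ⊤ → ∃ λ κ → κ ∈ allMaps R N n × Vec.map just κ ≡ κ'
    just-onto {κ'} κ'∈ = κ , ≡.subst (κ ∈_) (≡.sym (allMaps≡allVectors n)) (∈-allVectors n κ ∈-allFin) , Vec-ext same
      where
      coloured : ∀ i → ∃ λ c → lookup κ' i ≡ just c
      coloured i = ∈-choices-true (≡.subst (λ b → lookup κ' i ∈ choices b) (∈⊤ i) (∈-colouringsOn⁻ ⊤ κ'∈ i))
      κ : Vec (Fin N) n
      κ = tabulate (proj₁ ∘ coloured)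
      same : ∀ i → lookup (Vec.map just κ) i ≡ lookup κ' i
      same i = ≡.trans (lookup-just κ i) (≡.trans (≡.cong just (Vec.lookup∘tabulate _ i)) (≡.sym (proj₂ (coloured i))))

module SubgraphTripleExpansion {c ℓ} (R : CommutativeRing c ℓ) {n : ℕ} (G : Graph n) (N : ℕ)
  (x : Fin N → CommutativeRing.Carrier R) where
  open import Data.Fin.Subset using (∣_∣; _─_)
  open import Data.List using (_∷_)
  open import Data.List.Membership.Propositional using (_∈_)
  open import Data.Maybe using (just; nothing)
  open import Data.Nat as ℕ using (zero; suc; _≤_)
  import Data.Nat.Properties as ℕ
  open import Data.Product using (_,_; proj₁; proj₂)
  open import Function using (_∘_)
  import Relation.Binary.PropositionalEquality as ≡
  open import Defs hiding (sym)
  open ListEnumeration using (productWith; ∈-concatMap⁺′)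
  open Connectivity using (∈V⇒∣∣-pos)
  open Subgraphs using (module RootedDecomposition)
  open SubgraphTriples

  open CommutativeRing R
  open RingSums R
  open PowerSums R using (-1^_; psum)
  open TripleWeights R
  open ChromaticRecurrence R G N x
  open import Relation.Binary.Reasoning.Setoid setoid

  ∑-rootedTriples : ∀ W w₀ → w₀ ∈V W → (f : RawTriple n → Carrier) →
    (∀ {t} → t ∈ rootedTriples G W w₀ → f t ≈ chromaticOn (W ─ verts t)) →
    ∑ (rootedTriples G W w₀) (λ t → tripleWeight x t * f t) ≈ chromaticOn W
  ∑-rootedTriples W w₀ w₀∈W f f≈ = begin
    ∑ (rootedTriples G W w₀) (λ t → tripleWeight x t * f t)
      ≈⟨ ∑-concatMap (λ (B , H) → triplesOn B H) rootedConnected _ ⟩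
    ∑ rootedConnected (λ (B , H) → ∑ (triplesOn B H) (λ t → tripleWeight x t * f t))
      ≈⟨ ∑-cong-∈ rootedConnected per-component ⟩
    ∑ rootedConnected (λ (B , H) → -1^ numEdges H * (psum ∣ B ∣ x * chromaticOn (W ─ B)))
      ≈⟨ Recurrence.chromaticOn-recurrence W w₀ w₀∈W ⟨
    chromaticOn W ∎
    where
    open RootedDecomposition G W w₀
    per-component : ∀ {BH} → BH ∈ rootedConnected →
      ∑ (triplesOn (proj₁ BH) (proj₂ BH)) (λ t → tripleWeight x t * f t)
        ≈ -1^ numEdges (proj₂ BH) * (psum ∣ proj₁ BH ∣ x * chromaticOn (W ─ proj₁ BH))
    per-component {B , H} BH∈ = begin
      ∑ (triplesOn B H) (λ t → tripleWeight x t * f t)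
        ≈⟨ ∑-cong-∈ (triplesOn B H) (λ {t} t∈ → *-congˡ (f-on-block {t} t∈)) ⟩
      ∑ (triplesOn B H) (λ t → tripleWeight x t * chromaticOn (W ─ B))
        ≈⟨ *-distribʳ-∑ _ (triplesOn B H) _ ⟨
      ∑ (triplesOn B H) (tripleWeight x) * chromaticOn (W ─ B)
        ≈⟨ *-congʳ (∑-triplesOn x B H (ℕ.pred ∣ B ∣) (≡.sym (ℕ.suc-pred ∣ B ∣ ⦃ ℕ.>-nonZero ∣B∣>0 ⦄))) ⟩
      (-1^ numEdges H * psum ∣ B ∣ x) * chromaticOn (W ─ B)
        ≈⟨ *-assoc _ _ _ ⟩
      -1^ numEdges H * (psum ∣ B ∣ x * chromaticOn (W ─ B)) ∎
      where
      ∣B∣>0 = ∈V⇒∣∣-pos {A = B} w₀ (proj₁ (∈-rootedConnected⁻ BH∈))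
      f-on-block : ∀ {t} → t ∈ triplesOn B H → f t ≈ chromaticOn (W ─ B)
      f-on-block t∈ with ≡.refl , _ ← ∈-triplesOn⁻ {B = B} {H} t∈ = f≈ (∈-concatMap⁺′ BH∈ t∈)

  ∑-subgraphTriples : ∀ k W → ∣ W ∣ ≤ k → ∑ (subgraphTriples G k W) (weight x) ≈ chromaticOn W
  ∑-subgraphTriples zero    W le = trans (+-identityʳ _) (trans (weight-[] x {n}) (sym (chromaticOn-empty W (∣∣≤0 G W le))))
  ∑-subgraphTriples (suc k) W le = from (least W) ≡.refl
    where
    from : ∀ m → least W ≡.≡ m → ∑ (subgraphTriplesFrom G k W m) (weight x) ≈ chromaticOn W
    from nothing   least≡ = trans (+-identityʳ _) (trans (weight-[] x {n}) (sym (chromaticOn-empty W (least-nothing W least≡))))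
    from (just w₀) least≡ = begin
      ∑ (productWith _∷_ (rootedTriples G W w₀) (λ t → subgraphTriples G k (W ─ verts t))) (weight x)
        ≈⟨ ∑-productWith _∷_ (rootedTriples G W w₀) _ (weight x) ⟩
      ∑ (rootedTriples G W w₀) (λ t → ∑ (subgraphTriples G k (W ─ verts t)) (weight x ∘ (t ∷_)))
        ≈⟨ ∑-cong (rootedTriples G W w₀) (λ t → trans (∑-cong (subgraphTriples G k (W ─ verts t)) (weight-∷ x t))
                                                      (sym (*-distribˡ-∑ _ (subgraphTriples G k (W ─ verts t)) (weight x)))) ⟩
      ∑ (rootedTriples G W w₀) (λ t → tripleWeight x t * ∑ (subgraphTriples G k (W ─ verts t)) (weight x))
        ≈⟨ ∑-rootedTriples W w₀ w₀∈W _ (λ {t} t∈ →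
             ∑-subgraphTriples k (W ─ verts t) (∣─∣≤ G k W {t} le w₀∈W
               (proj₁ (proj₂ (∈-rootedTriples⁻ G W w₀ {t} t∈))))) ⟩
      chromaticOn W ∎
      where
      w₀∈W = proj₁ (least-just W least≡)


open import Defs
open import Level using (Level)
open import Data.Nat using (ℕ)
open import Data.Fin using (Fin)
open import Data.List using (List; map)
open import Data.List.Membership.Propositional using (_∈_)
open import Data.List.Relation.Unary.Unique.Propositional using (Unique)
open import Function.Bundles using (_⇔_)
open import Algebra.Bundles using (CommutativeRing)

corollary5p14 : ∀ {c ℓ : Level} (R : CommutativeRing c ℓ) {n : ℕ} (G : Graph n)
    (L : List (List (RawTriple n))) → Unique L → (∀ S → (S ∈ L) ⇔ IsST G S) →
    ∀ (N : ℕ) (x : Fin N → CommutativeRing.Carrier R) →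
    CommutativeRing._≈_ R (chromSym R G x)
    (sumR R (map (λ S → CommutativeRing._*_ R (sign R S) (elemλ R (type S) x)) L))
corollary5p14 R {n} G L L-unique L⇔ST N x = begin
  chromSym R G x                        ≈⟨ chromSym≈chromaticOn-⊤ ⟩
  chromaticOn ⊤                         ≈⟨ ∑-subgraphTriples n ⊤ (Subset.∣p∣≤n ⊤) ⟨
  ∑ (subgraphTriples G n ⊤) (weight x)  ≈⟨ ∑-bag (weight x) (subgraphTriples-unique G n ⊤) L-unique
                                             (⇔.trans (∈-subgraphTriples⇔IsST G _) (⇔.sym (L⇔ST _))) ⟩
  ∑ L (weight x)                        ∎
  where
  open import Data.Fin.Subset using (⊤)
  import Data.Fin.Subset.Properties as Subset
  import Function.Properties.Equivalence as ⇔
  open CommutativeRing R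
  open SubgraphTriples
  open RingSums R
  open TripleWeights R
  open ChromaticRecurrence R G N x
  open SubgraphTripleExpansion R G N x
  open import Relation.Binary.Reasoning.Setoid setoid
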